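{- Let $T$ be a non-planar tanglegram with left tree $L$ rooted at $r$ and right tree $R$ rooted at $\rho$, and let $T^*$ be the graph consisting of $L$, $R$, the matching edges, and an additional edge $r\rho$. Then $T^*$ contains a subdivision of $K_{3,3}$ in which three of the six branch vertices of $K_{3,3}$ are vertices of $L$ and the other three are vertices of $R$.
   Context: A plane binary tree is a rooted tree in which every vertex has either two ordered children or none (a leaf). A tanglegram layout $(L,R,\sigma)$ consists of a plane binary tree $L$ with root $r$ drawn in $x\le 0$ with leaves on the line $x=0$, a plane binary tree $R$ with root $\rho$ drawn in $x\ge 1$ with leaves on $x=1$, both with $n$ leaves, and a perfect matching $\sigma$ between the leaf sets drawn as straight segments. Tanglegrams are equivalence classes of layouts under switches (interchanging the two child subtrees of an internal vertex, matching edges moving with their leaves); $L$ and $R$ may not be interchanged. A tanglegram is planar if some layout has no two crossing matching edges, and non-planar otherwise. -}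

module Defs where

open import Data.Nat using (ℕ; zero; suc)
open import Data.Fin using (Fin; _↑ˡ_; _↑ʳ_)
open import Data.Bool using (Bool; true; false)
open import Data.List using (List; []; _∷_; _++_; [_]; map; allFin)
open import Data.Nat.ListAction using (sum)
open import Data.List.Relation.Unary.Linked using (Linked)
open import Data.List.Relation.Unary.Unique.Propositional using (Unique)
open import Data.List.Membership.Propositional using (_∈_)
open import Data.List.Relation.Binary.Permutation.Propositional using (_↭_)
open import Data.Sum using (_⊎_; inj₁; inj₂)
open import Data.Product using (_×_; Σ; ∃)
open import Relation.Binary.PropositionalEquality using (_≡_; _≢_)
open import Relation.Nullary using (¬_)

-- A tanglegram layout (L , R , σ) on n leaves is encoded by labelling the
-- leaves of L and of R bijectively with Fin n; the matching σ joins the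
-- leaf of L and the leaf of R carrying the same label.

data Tree (A : Set) : Set where
  leaf : A → Tree A
  node : Tree A → Tree A → Tree A

leaves : ∀ {A} → Tree A → List A
leaves (leaf a)   = a ∷ []
leaves (node l r) = leaves l ++ leaves r

Labelled : (n : ℕ) → Tree (Fin n) → Set
Labelled n t = leaves t ↭ allFin n

-- Switch equivalence: t ~ t' iff t' is obtained from t by a sequence of
-- switches (interchanging the two ordered children of internal vertices).
data _~_ {A : Set} : Tree A → Tree A → Set where
  leaf~ : ∀ {a} → leaf a ~ leaf a
  keep  : ∀ {l r l' r'} → l ~ l' → r ~ r' → node l r ~ node l' r'
  swap  : ∀ {l r l' r'} → l ~ l' → r ~ r' → node l r ~ node r' l'

-- A layout (L , R) has no crossing matching edges iff the matching edges,
-- drawn as straight segments between the lines x = 0 and x = 1, join the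
-- k-th leaf of L to the k-th leaf of R for every k, i.e. the leaf label
-- sequences coincide.
CrossingFree : ∀ {n} → Tree (Fin n) → Tree (Fin n) → Set
CrossingFree L R = leaves L ≡ leaves R

Planar : ∀ {n} → Tree (Fin n) → Tree (Fin n) → Set
Planar L R = Σ _ λ L' → Σ _ λ R' → (L ~ L') × (R ~ R') × CrossingFree L' R'

data Pos {A : Set} : Tree A → Set where
  here  : ∀ {t} → Pos t
  left  : ∀ {l r} → Pos l → Pos (node l r)
  right : ∀ {l r} → Pos r → Pos (node l r)

data TreeEdge {A : Set} : {t : Tree A} → Pos t → Pos t → Set where
  toL  : ∀ {l r} → TreeEdge {t = node l r} here (left here)
  toR  : ∀ {l r} → TreeEdge {t = node l r} here (right here)
  inL  : ∀ {l r} {p q : Pos l} → TreeEdge p q → TreeEdge {t = node l r} (left p) (left q)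
  inR  : ∀ {l r} {p q : Pos r} → TreeEdge p q → TreeEdge {t = node l r} (right p) (right q)

data LeafAt {A : Set} : {t : Tree A} → Pos t → A → Set where
  atLeaf : ∀ {a} → LeafAt {t = leaf a} here a
  inL    : ∀ {l r a} {p : Pos l} → LeafAt p a → LeafAt {t = node l r} (left p) a
  inR    : ∀ {l r a} {p : Pos r} → LeafAt p a → LeafAt {t = node l r} (right p) a

TV : ∀ {n} → Tree (Fin n) → Tree (Fin n) → Set
TV L R = Pos L ⊎ Pos R

data TEdge {n} (L R : Tree (Fin n)) : TV L R → TV L R → Set where
  edgeL    : ∀ {p q} → TreeEdge p q → TEdge L R (inj₁ p) (inj₁ q)
  edgeR    : ∀ {p q} → TreeEdge p q → TEdge L R (inj₂ p) (inj₂ q)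
  matching : ∀ {p q a} → LeafAt p a → LeafAt q a → TEdge L R (inj₁ p) (inj₂ q)
  rootEdge : TEdge L R (inj₁ here) (inj₂ here)

TAdj : ∀ {n} (L R : Tree (Fin n)) → TV L R → TV L R → Set
TAdj L R x y = TEdge L R x y ⊎ TEdge L R y x

-- Branch vertices: branch (inject+ 3 i) (i : Fin 3) form one side,
-- branch (3 ↑ʳ j) the other side. path i j lists the internal vertices
-- of the subdivided edge between them.

sideA : Fin 3 → Fin 6
sideA i = i ↑ˡ 3

sideB : Fin 3 → Fin 6
sideB j = 3 ↑ʳ j

record K33Subdivision (V : Set) (Adj : V → V → Set) : Set where
  field
    branch     : Fin 6 → V
    branch-inj : ∀ i j → branch i ≡ branch j → i ≡ j
    path       : Fin 3 → Fin 3 → List V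
    walk       : ∀ i j → Linked Adj (branch (sideA i) ∷ path i j ++ [ branch (sideB j) ])
    simple     : ∀ i j → Unique (branch (sideA i) ∷ path i j ++ [ branch (sideB j) ])
    avoid      : ∀ i j k x → x ∈ path i j → x ≢ branch k
    disjoint   : ∀ i j i' j' x → x ∈ path i j → x ∈ path i' j' → (i ≡ i') × (j ≡ j')

isLeft : ∀ {X Y : Set} → X ⊎ Y → ℕ
isLeft (inj₁ _) = 1
isLeft (inj₂ _) = 0

branchesInL : ∀ {n} {L R : Tree (Fin n)} → K33Subdivision (TV L R) (TAdj L R) → ℕ
branchesInL S = sum (map (λ k → isLeft (K33Subdivision.branch S k)) (allFin 6))

{-# OPTIONS --safe #-}
-- Leaves are compared through the depths hL, hR of their lowest common ancestors in L and R. A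
-- tanglegram is planar unless it has a non-planar quartet: four leaves a, b, c, d on which L and R
-- induce ((a,b),(c,d)) and ((a,c),(b,d)), or (((a,b),c),d) and (((a,d),c),b). Indeed, without such a
-- quartet L can be switched top-down so that its leaf order is consistent with R, and R can then be
-- switched to realise that order. A non-planar quartet yields the K₃,₃ directly: three lowest common
-- ancestors in L and three in R, joined by tree paths, by the matching edges at a, b, c, d, and by
-- the edge between the roots.

module Submission where

open import Defs
open import Data.Nat using (ℕ)
open import Relation.Binary.PropositionalEquality using (_≡_; _≢_)
open import Data.Fin using (Fin)
open import Data.List.Membership.Propositional using (_∈_)
open import Data.List.Relation.Unary.Unique.Propositional using (Unique)
open import Data.Product using (_,_; _×_; Σ)
open import Relation.Nullary using (Dec; no; yes; ¬_)
open import Data.List using (List; [_]; _++_; _∷_; allFin)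
open import Data.List.Relation.Unary.Linked using (Linked)
open import Data.Maybe using (Maybe; just; nothing)
open import Data.Empty using (⊥-elim)
open import Data.List.Membership.Propositional.Properties using (∈-allFin)
open import Data.List.Relation.Binary.Permutation.Propositional using (_↭_; ↭-sym)
open import Data.List.Relation.Binary.Permutation.Propositional.Properties using (∈-resp-↭)
open import Data.List.Relation.Unary.Unique.Propositional.Properties using (allFin⁺)
open import Data.Sum using (inj₁; inj₂)

module Address where

  open import Data.Bool using (Bool; true; false)
  open import Data.Empty using (⊥-elim)
  open import Data.List using (List; []; _∷_; _++_; [_]; length; take)
  open import Data.List.Properties using (length-take)
  open import Data.Nat using (ℕ; zero; suc; _≤_; _<_; _+_; z≤n; s≤s)
  open import Data.Nat.Properties using (≤-trans; ≤-reflexive; ≤-total; ≤∧≢⇒<; <⇒≱; m⊓n≤m; m≤m+n; +-suc; +-identityʳ)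
  open import Data.Product using (_×_; _,_)
  open import Data.Sum using (_⊎_; inj₁; inj₂)
  open import Relation.Nullary using (¬_; Dec; yes; no)
  open import Relation.Binary.PropositionalEquality using (_≡_; refl; sym; trans; cong; subst)

  Address : Set
  Address = List Bool

  infix 4 _⊑_ _⊑?_

  data _⊑_ : Address → Address → Set where
    []⊑ : ∀ {β} → [] ⊑ β
    ∷⊑  : ∀ {b α β} → α ⊑ β → (b ∷ α) ⊑ (b ∷ β)

  ⊑-trans : ∀ {α β γ} → α ⊑ β → β ⊑ γ → α ⊑ γ
  ⊑-trans []⊑ q = []⊑
  ⊑-trans (∷⊑ p) (∷⊑ q) = ∷⊑ (⊑-trans p q)

  ⊑⇒length≤ : ∀ {α β} → α ⊑ β → length α ≤ length β
  ⊑⇒length≤ []⊑ = z≤n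
  ⊑⇒length≤ (∷⊑ p) = s≤s (⊑⇒length≤ p)

  ⊑∧length≥⇒≡ : ∀ {α β} → α ⊑ β → length β ≤ length α → α ≡ β
  ⊑∧length≥⇒≡ {β = []} []⊑ _ = refl
  ⊑∧length≥⇒≡ (∷⊑ p) (s≤s l) = cong (_ ∷_) (⊑∧length≥⇒≡ p l)

  _⊑?_ : ∀ α β → Dec (α ⊑ β)
  [] ⊑? β = yes []⊑
  (a ∷ α) ⊑? [] = no λ ()
  (false ∷ α) ⊑? (true ∷ β) = no λ ()
  (true ∷ α) ⊑? (false ∷ β) = no λ ()
  (false ∷ α) ⊑? (false ∷ β) with α ⊑? β
  ... | yes p = yes (∷⊑ p)
  ... | no ¬p = no λ { (∷⊑ p) → ¬p p }
  (true ∷ α) ⊑? (true ∷ β) with α ⊑? β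
  ... | yes p = yes (∷⊑ p)
  ... | no ¬p = no λ { (∷⊑ p) → ¬p p }

  ⊑-++ : ∀ σ α → σ ⊑ σ ++ α
  ⊑-++ [] α = []⊑
  ⊑-++ (b ∷ σ) α = ∷⊑ (⊑-++ σ α)

  ⊑-++-[]⁻ : ∀ σ {b c β} → σ ++ [ b ] ⊑ σ ++ (c ∷ β) → b ≡ c
  ⊑-++-[]⁻ [] (∷⊑ p) = refl
  ⊑-++-[]⁻ (x ∷ σ) (∷⊑ p) = ⊑-++-[]⁻ σ p

  take-⊑ : ∀ k (α : Address) → take k α ⊑ α
  take-⊑ zero α = []⊑
  take-⊑ (suc k) [] = []⊑
  take-⊑ (suc k) (b ∷ α) = ∷⊑ (take-⊑ k α)

  length-take-≤ : ∀ k (α : Address) → k ≤ length α → length (take k α) ≡ k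
  length-take-≤ zero α l = refl
  length-take-≤ (suc k) (b ∷ α) (s≤s l) = cong suc (length-take-≤ k α l)

  lcp : Address → Address → Address
  lcp [] β = []
  lcp (a ∷ α) [] = []
  lcp (false ∷ α) (false ∷ β) = false ∷ lcp α β
  lcp (true ∷ α) (true ∷ β) = true ∷ lcp α β
  lcp (false ∷ α) (true ∷ β) = []
  lcp (true ∷ α) (false ∷ β) = []

  lcp-⊑ˡ : ∀ α β → lcp α β ⊑ α
  lcp-⊑ˡ [] β = []⊑
  lcp-⊑ˡ (a ∷ α) [] = []⊑
  lcp-⊑ˡ (false ∷ α) (false ∷ β) = ∷⊑ (lcp-⊑ˡ α β)
  lcp-⊑ˡ (true ∷ α) (true ∷ β) = ∷⊑ (lcp-⊑ˡ α β)
  lcp-⊑ˡ (false ∷ α) (true ∷ β) = []⊑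
  lcp-⊑ˡ (true ∷ α) (false ∷ β) = []⊑

  lcp-⊑ʳ : ∀ α β → lcp α β ⊑ β
  lcp-⊑ʳ [] β = []⊑
  lcp-⊑ʳ (a ∷ α) [] = []⊑
  lcp-⊑ʳ (false ∷ α) (false ∷ β) = ∷⊑ (lcp-⊑ʳ α β)
  lcp-⊑ʳ (true ∷ α) (true ∷ β) = ∷⊑ (lcp-⊑ʳ α β)
  lcp-⊑ʳ (false ∷ α) (true ∷ β) = []⊑
  lcp-⊑ʳ (true ∷ α) (false ∷ β) = []⊑

  lcp-greatest : ∀ {σ α β} → σ ⊑ α → σ ⊑ β → σ ⊑ lcp α β
  lcp-greatest []⊑ q = []⊑
  lcp-greatest {false ∷ σ} (∷⊑ p) (∷⊑ q) = ∷⊑ (lcp-greatest p q)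
  lcp-greatest {true ∷ σ} (∷⊑ p) (∷⊑ q) = ∷⊑ (lcp-greatest p q)

  lcp-comm : ∀ α β → lcp α β ≡ lcp β α
  lcp-comm [] [] = refl
  lcp-comm [] (b ∷ β) = refl
  lcp-comm (a ∷ α) [] = refl
  lcp-comm (false ∷ α) (false ∷ β) = cong (false ∷_) (lcp-comm α β)
  lcp-comm (true ∷ α) (true ∷ β) = cong (true ∷_) (lcp-comm α β)
  lcp-comm (false ∷ α) (true ∷ β) = refl
  lcp-comm (true ∷ α) (false ∷ β) = refl

  lcpLength : Address → Address → ℕ
  lcpLength α β = length (lcp α β)

  lcpLength-comm : ∀ α β → lcpLength α β ≡ lcpLength β α
  lcpLength-comm α β = cong length (lcp-comm α β)

  ⊑⇒≤lcpLength : ∀ {σ α β} → σ ⊑ α → σ ⊑ β → length σ ≤ lcpLength α β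
  ⊑⇒≤lcpLength p q = ⊑⇒length≤ (lcp-greatest p q)

  lcpLength-++ : ∀ σ α β → lcpLength (σ ++ α) (σ ++ β) ≡ length σ + lcpLength α β
  lcpLength-++ [] α β = refl
  lcpLength-++ (false ∷ σ) α β = cong suc (lcpLength-++ σ α β)
  lcpLength-++ (true ∷ σ) α β = cong suc (lcpLength-++ σ α β)

  lcpLength-fork : ∀ σ α β → lcpLength (σ ++ false ∷ α) (σ ++ true ∷ β) ≡ length σ
  lcpLength-fork σ α β = trans (lcpLength-++ σ (false ∷ α) (true ∷ β)) (+-identityʳ (length σ))

  lcpLength-shared : ∀ σ b α β → suc (length σ) ≤ lcpLength (σ ++ b ∷ α) (σ ++ b ∷ β)
  lcpLength-shared σ false α β = subst (suc (length σ) ≤_) (sym (lcpLength-++ σ (false ∷ α) (false ∷ β)))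
    (≤-trans (s≤s (m≤m+n (length σ) _)) (≤-reflexive (sym (+-suc (length σ) _))))
  lcpLength-shared σ true α β = subst (suc (length σ) ≤_) (sym (lcpLength-++ σ (true ∷ α) (true ∷ β)))
    (≤-trans (s≤s (m≤m+n (length σ) _)) (≤-reflexive (sym (+-suc (length σ) _))))

  ⊑-by-length : ∀ {σ τ α} → σ ⊑ α → τ ⊑ α → length σ ≤ length τ → σ ⊑ τ
  ⊑-by-length []⊑ q l = []⊑
  ⊑-by-length (∷⊑ p) (∷⊑ q) (s≤s l) = ∷⊑ (⊑-by-length p q l)

  ⊑-through-lcp : ∀ {σ α β} → σ ⊑ α → length σ ≤ lcpLength α β → σ ⊑ β
  ⊑-through-lcp {α = α} {β} p l = ⊑-trans (⊑-by-length p (lcp-⊑ˡ α β) l) (lcp-⊑ʳ α β)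

  take-⊑-through-lcp : ∀ {k} α β → k ≤ lcpLength α β → take k α ⊑ β
  take-⊑-through-lcp {k} α β le =
    ⊑-through-lcp (take-⊑ k α) (≤-trans (≤-reflexive (length-take k α)) (≤-trans (m⊓n≤m k _) le))

  take-⋢-beyond-lcp : ∀ {k} α β → lcpLength α β < k → k ≤ length α → ¬ take k α ⊑ β
  take-⋢-beyond-lcp {k} α β lt le p =
    <⇒≱ lt (subst (_≤ lcpLength α β) (length-take-≤ k α le) (⊑⇒≤lcpLength (take-⊑ k α) p))

  take-≤lcpLength : ∀ {k} α β → k ≤ lcpLength α β → take k α ≡ take k β
  take-≤lcpLength {zero} α β l = refl
  take-≤lcpLength {suc k} [] β ()
  take-≤lcpLength {suc k} (a ∷ α) [] ()
  take-≤lcpLength {suc k} (false ∷ α) (true ∷ β) ()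
  take-≤lcpLength {suc k} (true ∷ α) (false ∷ β) ()
  take-≤lcpLength {suc k} (false ∷ α) (false ∷ β) (s≤s l) = cong (false ∷_) (take-≤lcpLength α β l)
  take-≤lcpLength {suc k} (true ∷ α) (true ∷ β) (s≤s l) = cong (true ∷_) (take-≤lcpLength α β l)

  lcpLength<length : ∀ α β → ¬ α ⊑ β → lcpLength α β < length α
  lcpLength<length α β ¬p with ≤-total (length α) (lcpLength α β)
  ... | inj₁ le = ⊥-elim (¬p (subst (_⊑ β) (⊑∧length≥⇒≡ (lcp-⊑ˡ α β) le) (lcp-⊑ʳ α β)))
  ... | inj₂ ge = ≤∧≢⇒< ge λ e → ¬p (subst (_⊑ β) (⊑∧length≥⇒≡ (lcp-⊑ˡ α β) (≤-reflexive (sym e))) (lcp-⊑ʳ α β))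

  Incomparable : Address → Address → Set
  Incomparable α β = ¬ α ⊑ β × ¬ β ⊑ α

  ThreePoint : ℕ → ℕ → ℕ → Set
  ThreePoint a b c = (b < a × b ≡ c) ⊎ (a < b × a ≡ c) ⊎ (a < c × a ≡ b)

  Incomparable-∷⁻ : ∀ {b α β} → Incomparable (b ∷ α) (b ∷ β) → Incomparable α β
  Incomparable-∷⁻ (p , q) = (λ r → p (∷⊑ r)) , (λ r → q (∷⊑ r))

  ThreePoint-suc : ∀ {a b c} → ThreePoint a b c → ThreePoint (suc a) (suc b) (suc c)
  ThreePoint-suc (inj₁ (l , e)) = inj₁ (s≤s l , cong suc e)
  ThreePoint-suc (inj₂ (inj₁ (l , e))) = inj₂ (inj₁ (s≤s l , cong suc e))
  ThreePoint-suc (inj₂ (inj₂ (l , e))) = inj₂ (inj₂ (s≤s l , cong suc e))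

  lcpLength-threePoint : ∀ α β γ → Incomparable α β → Incomparable α γ → Incomparable β γ →
                         ThreePoint (lcpLength α β) (lcpLength α γ) (lcpLength β γ)
  lcpLength-threePoint [] β γ (p , _) _ _ = ⊥-elim (p []⊑)
  lcpLength-threePoint (a ∷ α) [] γ (_ , q) _ _ = ⊥-elim (q []⊑)
  lcpLength-threePoint (a ∷ α) (b ∷ β) [] _ (_ , q) _ = ⊥-elim (q []⊑)
  lcpLength-threePoint (false ∷ α) (false ∷ β) (false ∷ γ) i j k =
    ThreePoint-suc (lcpLength-threePoint α β γ (Incomparable-∷⁻ i) (Incomparable-∷⁻ j) (Incomparable-∷⁻ k))
  lcpLength-threePoint (true ∷ α) (true ∷ β) (true ∷ γ) i j k =
    ThreePoint-suc (lcpLength-threePoint α β γ (Incomparable-∷⁻ i) (Incomparable-∷⁻ j) (Incomparable-∷⁻ k))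
  lcpLength-threePoint (false ∷ α) (false ∷ β) (true ∷ γ) _ _ _ = inj₁ (s≤s z≤n , refl)
  lcpLength-threePoint (true ∷ α) (true ∷ β) (false ∷ γ) _ _ _ = inj₁ (s≤s z≤n , refl)
  lcpLength-threePoint (false ∷ α) (true ∷ β) (false ∷ γ) _ _ _ = inj₂ (inj₁ (s≤s z≤n , refl))
  lcpLength-threePoint (true ∷ α) (false ∷ β) (true ∷ γ) _ _ _ = inj₂ (inj₁ (s≤s z≤n , refl))
  lcpLength-threePoint (false ∷ α) (true ∷ β) (true ∷ γ) _ _ _ = inj₂ (inj₂ (s≤s z≤n , refl))
  lcpLength-threePoint (true ∷ α) (false ∷ β) (false ∷ γ) _ _ _ = inj₂ (inj₂ (s≤s z≤n , refl))

module LeafAddress where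

  open Address
  open import Data.Bool using (true; false)
  open import Data.Empty using (⊥; ⊥-elim)
  open import Data.Fin using (Fin)
  open import Data.Fin.Properties using (_≟_)
  open import Data.List using (List; []; _∷_; _++_; length; take)
  open import Data.List.Membership.Propositional using (_∈_; _∉_)
  open import Data.List.Membership.Propositional.Properties using (∈-++⁻; ∈-++⁺ˡ; ∈-++⁺ʳ)
  open import Data.List.Relation.Unary.Any using (here; there)
  open import Data.List.Relation.Unary.All using (_∷_; lookup)
  import Data.List.Relation.Unary.All.Properties as All
  open import Data.List.Relation.Unary.AllPairs using ([]; _∷_)
  open import Data.List.Relation.Unary.Unique.Propositional using (Unique)
  open import Data.Nat using (ℕ; zero; suc; _≤_; _<_)
  open import Data.Nat.Properties using (≤-pred)
  open import Data.Product using (_×_; _,_; proj₁)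
  open import Data.Sum using (_⊎_; inj₁; inj₂)
  open import Relation.Nullary using (yes; no)
  open import Relation.Binary.PropositionalEquality using (_≡_; _≢_; refl; cong; setoid)
  open import Data.List.Relation.Binary.Permutation.Propositional using (_↭_; ↭-refl; ↭-sym; ↭-trans; ↭⇒↭ₛ)
  open import Data.List.Relation.Binary.Permutation.Propositional.Properties using (++⁺; ++-comm; ∈-resp-↭)
  import Data.List.Relation.Binary.Permutation.Setoid.Properties as Permutation

  module _ {A : Set} where

    Unique-++⁻ˡ : ∀ {xs ys : List A} → Unique (xs ++ ys) → Unique xs
    Unique-++⁻ˡ {[]} u = []
    Unique-++⁻ˡ {x ∷ xs} (a ∷ u) = All.++⁻ˡ xs a ∷ Unique-++⁻ˡ u

    Unique-++⁻ʳ : ∀ {xs ys : List A} → Unique (xs ++ ys) → Unique ys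
    Unique-++⁻ʳ {[]} u = u
    Unique-++⁻ʳ {x ∷ xs} (a ∷ u) = Unique-++⁻ʳ u

    Unique-++⇒disjoint : ∀ {xs ys : List A} {x} → Unique (xs ++ ys) → x ∈ xs → x ∈ ys → ⊥
    Unique-++⇒disjoint {y ∷ xs} (a ∷ u) (here refl) q = lookup (All.++⁻ʳ xs a) q refl
    Unique-++⇒disjoint {y ∷ xs} (a ∷ u) (there p) q = Unique-++⇒disjoint u p q

  module _ {A : Set} where

    ~⇒↭ : ∀ {t t′ : Tree A} → t ~ t′ → leaves t ↭ leaves t′
    ~⇒↭ leaf~ = ↭-refl
    ~⇒↭ (keep p q) = ++⁺ (~⇒↭ p) (~⇒↭ q)
    ~⇒↭ (swap {l} {r} p q) = ↭-trans (++-comm (leaves l) (leaves r)) (++⁺ (~⇒↭ q) (~⇒↭ p))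

    ∈-~ : ∀ {t t′ : Tree A} → t ~ t′ → ∀ {x} → x ∈ leaves t → x ∈ leaves t′
    ∈-~ p = ∈-resp-↭ (~⇒↭ p)

    ∈-~⁻ : ∀ {t t′ : Tree A} → t ~ t′ → ∀ {x} → x ∈ leaves t′ → x ∈ leaves t
    ∈-~⁻ p = ∈-resp-↭ (↭-sym (~⇒↭ p))

    Unique-↭ : ∀ {xs ys : List A} → xs ↭ ys → Unique xs → Unique ys
    Unique-↭ p = Permutation.Unique-resp-↭ (setoid A) (↭⇒↭ₛ p)

    Unique-~ : ∀ {t t′ : Tree A} → t ~ t′ → Unique (leaves t) → Unique (leaves t′)
    Unique-~ p = Unique-↭ (~⇒↭ p)

  module _ {n : ℕ} {l r : Tree (Fin n)} {x : Fin n} where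

    ∈-node⁻ : x ∈ leaves (node l r) → x ∈ leaves l ⊎ x ∈ leaves r
    ∈-node⁻ = ∈-++⁻ (leaves l)

    ∈-node⁺ˡ : x ∈ leaves l → x ∈ leaves (node l r)
    ∈-node⁺ˡ = ∈-++⁺ˡ

    ∈-node⁺ʳ : x ∈ leaves r → x ∈ leaves (node l r)
    ∈-node⁺ʳ = ∈-++⁺ʳ (leaves l)

    ∈-node⁻ʳ : x ∈ leaves (node l r) → x ∉ leaves l → x ∈ leaves r
    ∈-node⁻ʳ p q with ∈-node⁻ p
    ... | inj₁ a = ⊥-elim (q a)
    ... | inj₂ b = b

  module _ {n : ℕ} where
    open import Data.List.Membership.DecPropositional (_≟_ {n}) using (_∈?_)

    addr : Tree (Fin n) → Fin n → Address
    addr (leaf a) x = []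
    addr (node l r) x with x ∈? leaves l
    ... | yes _ = false ∷ addr l x
    ... | no _ = true ∷ addr r x

    addr-node : ∀ (l r : Tree (Fin n)) x → (x ∈ leaves l × addr (node l r) x ≡ false ∷ addr l x)
                                         ⊎ (x ∉ leaves l × addr (node l r) x ≡ true ∷ addr r x)
    addr-node l r x with x ∈? leaves l
    ... | yes p = inj₁ (p , refl)
    ... | no p = inj₂ (p , refl)

    addr-nodeˡ : ∀ {l r : Tree (Fin n)} {x} → x ∈ leaves l → addr (node l r) x ≡ false ∷ addr l x
    addr-nodeˡ {l} {r} {x} p with addr-node l r x
    ... | inj₁ (_ , e) = e
    ... | inj₂ (q , _) = ⊥-elim (q p)

    addr-nodeʳ : ∀ {l r : Tree (Fin n)} {x} → x ∉ leaves l → addr (node l r) x ≡ true ∷ addr r x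
    addr-nodeʳ {l} {r} {x} p with addr-node l r x
    ... | inj₁ (q , _) = ⊥-elim (p q)
    ... | inj₂ (_ , e) = e

    addr-incomparable : ∀ (t : Tree (Fin n)) {x y} → Unique (leaves t) → x ∈ leaves t → y ∈ leaves t → x ≢ y →
                        Incomparable (addr t x) (addr t y)
    addr-incomparable (leaf a) u (here refl) (here refl) x≢y = ⊥-elim (x≢y refl)
    addr-incomparable (node l r) {x} {y} u px py x≢y with addr-node l r x | addr-node l r y
    ... | inj₁ (xl , ex) | inj₁ (yl , ey) rewrite ex | ey =
        let (i , j) = addr-incomparable l (Unique-++⁻ˡ u) xl yl x≢y in
        (λ { (∷⊑ p) → i p }) , (λ { (∷⊑ p) → j p })
    ... | inj₁ (xl , ex) | inj₂ (yl , ey) rewrite ex | ey = (λ ()) , (λ ())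
    ... | inj₂ (xl , ex) | inj₁ (yl , ey) rewrite ex | ey = (λ ()) , (λ ())
    ... | inj₂ (xl , ex) | inj₂ (yl , ey) rewrite ex | ey =
        let (i , j) = addr-incomparable r (Unique-++⁻ʳ {xs = leaves l} u) (∈-node⁻ʳ {l = l} {r = r} px xl) (∈-node⁻ʳ {l = l} {r = r} py yl) x≢y in
        (λ { (∷⊑ p) → i p }) , (λ { (∷⊑ p) → j p })

    posAt : (t : Tree (Fin n)) → Address → Pos t
    posAt (leaf a) _ = here
    posAt (node l r) [] = here
    posAt (node l r) (false ∷ α) = left (posAt l α)
    posAt (node l r) (true ∷ α) = right (posAt r α)

    posAt-[] : ∀ (t : Tree (Fin n)) → posAt t [] ≡ here
    posAt-[] (leaf a) = refl
    posAt-[] (node l r) = refl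

    posAddress : {t : Tree (Fin n)} → Pos t → Address
    posAddress here = []
    posAddress (left p) = false ∷ posAddress p
    posAddress (right p) = true ∷ posAddress p

    ⊑-addr-node⁻ : ∀ l r {x b α} → x ∈ leaves (node l r) → b ∷ α ⊑ addr (node l r) x →
                   (b ≡ false × x ∈ leaves l × α ⊑ addr l x) ⊎ (b ≡ true × x ∈ leaves r × α ⊑ addr r x)
    ⊑-addr-node⁻ l r {x} px p with addr-node l r x
    ... | inj₁ (xl , e) rewrite e with p
    ...   | ∷⊑ q = inj₁ (refl , xl , q)
    ⊑-addr-node⁻ l r {x} px p | inj₂ (xl , e) rewrite e with p
    ...   | ∷⊑ q = inj₂ (refl , ∈-node⁻ʳ {l = l} {r = r} px xl , q)

    posAddress-posAt : ∀ (t : Tree (Fin n)) {x α} → x ∈ leaves t → α ⊑ addr t x → posAddress (posAt t α) ≡ α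
    posAddress-posAt (leaf a) px []⊑ = refl
    posAddress-posAt (node l r) {α = []} px p = refl
    posAddress-posAt (node l r) {α = b ∷ α} px p with ⊑-addr-node⁻ l r px p
    ... | inj₁ (refl , xl , q) = cong (false ∷_) (posAddress-posAt l xl q)
    ... | inj₂ (refl , xr , q) = cong (true ∷_) (posAddress-posAt r xr q)

    leafAt-addr : ∀ (t : Tree (Fin n)) {x} → x ∈ leaves t → LeafAt (posAt t (addr t x)) x
    leafAt-addr (leaf a) (here refl) = atLeaf
    leafAt-addr (node l r) {x} px with addr-node l r x
    ... | inj₁ (xl , e) rewrite e = inL (leafAt-addr l xl)
    ... | inj₂ (xl , e) rewrite e = inR (leafAt-addr r (∈-node⁻ʳ {l = l} {r = r} px xl))

    edgeAlong-addr : ∀ (t : Tree (Fin n)) {x} k → x ∈ leaves t → suc k ≤ length (addr t x) →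
                     TreeEdge (posAt t (take k (addr t x))) (posAt t (take (suc k) (addr t x)))
    edgeAlong-addr (leaf a) k px ()
    edgeAlong-addr (node l r) {x} zero px lt with addr-node l r x
    ... | inj₁ (xl , e) rewrite e | posAt-[] l = toL
    ... | inj₂ (xl , e) rewrite e | posAt-[] r = toR
    edgeAlong-addr (node l r) {x} (suc k) px lt with addr-node l r x
    ... | inj₁ (xl , e) rewrite e = inL (edgeAlong-addr l k xl (≤-pred lt))
    ... | inj₂ (xl , e) rewrite e = inR (edgeAlong-addr r k (∈-node⁻ʳ {l = l} {r = r} px xl) (≤-pred lt))

    lcaDepth : Tree (Fin n) → Fin n → Fin n → ℕ
    lcaDepth t x y = lcpLength (addr t x) (addr t y)

    lcaDepth-comm : ∀ t x y → lcaDepth t x y ≡ lcaDepth t y x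
    lcaDepth-comm t x y = lcpLength-comm (addr t x) (addr t y)

    module _ (t : Tree (Fin n)) (u : Unique (leaves t)) (all : ∀ x → x ∈ leaves t) where

      lcaDepth-threePoint : ∀ {x y z} → x ≢ y → x ≢ z → y ≢ z →
                            ThreePoint (lcaDepth t x y) (lcaDepth t x z) (lcaDepth t y z)
      lcaDepth-threePoint {x} {y} {z} x≢y x≢z y≢z = lcpLength-threePoint (addr t x) (addr t y) (addr t z)
        (addr-incomparable t u (all x) (all y) x≢y) (addr-incomparable t u (all x) (all z) x≢z)
        (addr-incomparable t u (all y) (all z) y≢z)

      lcaDepth<length : ∀ {x y} → x ≢ y → lcaDepth t x y < length (addr t x)
      lcaDepth<length {x} {y} x≢y =
        lcpLength<length (addr t x) (addr t y) (proj₁ (addr-incomparable t u (all x) (all y) x≢y))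

open Address using (ThreePoint)
module ThreePointCondition {X : Set} (h : X → X → ℕ) (h-comm : ∀ x y → h x y ≡ h y x)
  (h-threePoint : ∀ {x y z} → x ≢ y → x ≢ z → y ≢ z → ThreePoint (h x y) (h x z) (h y z)) where

  open import Data.Nat using (_≤_; _<_)
  open import Data.Nat.Properties using (<-irrefl; <-asym; <⇒≤; <⇒≢; ≤⇒≯; <-≤-trans; ≤-reflexive; <-cmp)
  open import Data.Empty using (⊥-elim)
  open import Data.Product using (_,_)
  open import Data.Sum using (inj₁; inj₂)
  open import Relation.Binary.Definitions using (tri<; tri≈; tri>)
  open import Relation.Binary.PropositionalEquality using (refl; sym; subst; subst₂; ≢-sym)

  h-xz<xy⇒xz≡yz : ∀ {x y z} → x ≢ y → x ≢ z → y ≢ z → h x z < h x y → h x z ≡ h y z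
  h-xz<xy⇒xz≡yz x≢y x≢z y≢z lt with h-threePoint x≢y x≢z y≢z
  ... | inj₁ (_ , e) = e
  ... | inj₂ (inj₁ (l , _)) = ⊥-elim (<-asym l lt)
  ... | inj₂ (inj₂ (_ , e)) = ⊥-elim (<⇒≢ lt (sym e))

  h-yz<xy⇒xz≡yz : ∀ {x y z} → x ≢ y → x ≢ z → y ≢ z → h y z < h x y → h x z ≡ h y z
  h-yz<xy⇒xz≡yz x≢y x≢z y≢z lt with h-threePoint x≢y x≢z y≢z
  ... | inj₁ (_ , e) = e
  ... | inj₂ (inj₁ (_ , e)) = ⊥-elim (<⇒≢ lt (sym e))
  ... | inj₂ (inj₂ (l , _)) = ⊥-elim (<-asym l lt)

  h-xy≡xz⇒xy<yz : ∀ {x y z} → x ≢ y → x ≢ z → y ≢ z → h x y ≡ h x z → h x y < h y z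
  h-xy≡xz⇒xy<yz x≢y x≢z y≢z eq with h-threePoint x≢y x≢z y≢z
  ... | inj₁ (l , _) = ⊥-elim (<⇒≢ l (sym eq))
  ... | inj₂ (inj₁ (l , _)) = ⊥-elim (<⇒≢ l eq)
  ... | inj₂ (inj₂ (l , _)) = l

  h-xy≤yz⇒xy≤xz : ∀ {x y z} → x ≢ y → x ≢ z → y ≢ z → h x y ≤ h y z → h x y ≤ h x z
  h-xy≤yz⇒xy≤xz {x} x≢y x≢z y≢z le with h-threePoint x≢y x≢z y≢z
  ... | inj₁ (l , e) = ⊥-elim (≤⇒≯ le (subst (_< h x _) e l))
  ... | inj₂ (inj₁ (l , _)) = <⇒≤ l
  ... | inj₂ (inj₂ (_ , e)) = ≤-reflexive e

  <h-trans : ∀ {m x y z} → x ≢ y → x ≢ z → y ≢ z → m < h x y → m < h y z → m < h x z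
  <h-trans {m} {x} {y} {z} x≢y x≢z y≢z p q with <-cmp (h x y) (h y z)
  ... | tri< a _ _ = <-≤-trans p (h-xy≤yz⇒xy≤xz x≢y x≢z y≢z (<⇒≤ a))
  ... | tri≈ _ b _ = <-≤-trans p (h-xy≤yz⇒xy≤xz x≢y x≢z y≢z (≤-reflexive b))
  ... | tri> _ _ c = <-≤-trans q (subst₂ _≤_ (h-comm z y) (h-comm z x)
          (h-xy≤yz⇒xy≤xz (≢-sym y≢z) (≢-sym x≢z) (≢-sym x≢y) (subst₂ _≤_ (h-comm y z) (h-comm x y) (<⇒≤ c))))

  h-xy<xz⇒zy<zx : ∀ {x y z} → x ≢ y → x ≢ z → y ≢ z → h x y < h x z → h z y < h z x
  h-xy<xz⇒zy<zx x≢y x≢z y≢z lt =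
    subst₂ _<_ (h-xz<xy⇒xz≡yz x≢z x≢y (≢-sym y≢z) lt) (h-comm _ _) lt

  h-xy<xz⇒y≢z : ∀ {x y z} → h x y < h x z → y ≢ z
  h-xy<xz⇒y≢z lt refl = <-irrefl refl lt

module Quartet {X : Set} (hL hR : X → X → ℕ)
  (hL-comm : ∀ x y → hL x y ≡ hL y x) (hR-comm : ∀ x y → hR x y ≡ hR y x)
  (hR-threePoint : ∀ {x y z} → x ≢ y → x ≢ z → y ≢ z → ThreePoint (hR x y) (hR x z) (hR y z)) where

  open import Data.Nat using (_≤_; _<_)
  open import Data.Nat.Properties
    using (<-irrefl; <-asym; <-≤-trans; <⇒≱; ≰⇒>; ≤-antisym; _≤?_; <-cmp; module ≤-Reasoning)
  open import Data.Empty using (⊥; ⊥-elim)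
  open import Data.Product using (Σ; _×_; _,_)
  open import Data.Sum using (_⊎_; inj₁; inj₂)
  open import Relation.Nullary using (yes; no)
  open import Relation.Binary.Definitions using (DecidableEquality; tri<; tri≈; tri>)
  open import Relation.Binary.PropositionalEquality using (refl; sym; trans; subst; ≢-sym)

  open ThreePointCondition hR hR-comm hR-threePoint public

  Distinct4 : X → X → X → X → Set
  Distinct4 a b c d = a ≢ b × a ≢ c × a ≢ d × b ≢ c × b ≢ d × c ≢ d

  -- L = ((a,b),(c,d)) and R = ((a,c),(b,d)) on the leaves a, b, c, d.
  BalancedQuartet : X → X → X → X → Set
  BalancedQuartet a b c d =
    Distinct4 a b c d × hL a c < hL a b × hL a c < hL c d × hR a b < hR a c × hR a b < hR b d

  -- L = (((a,b),c),d) and R = (((a,d),c),b) on the leaves a, b, c, d.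
  CaterpillarQuartet : X → X → X → X → Set
  CaterpillarQuartet a b c d =
    Distinct4 a b c d × hL a c < hL a b × hL a d < hL a c × hR a c < hR a d × hR a b < hR a c

  NonPlanarQuartet : Set
  NonPlanarQuartet = Σ X λ a → Σ X λ b → Σ X λ c → Σ X λ d → BalancedQuartet a b c d ⊎ CaterpillarQuartet a b c d

  -- P and Q are the leaf sets of the two subtrees of a vertex of L, O the leaves outside it.
  record Split (P Q O : X → Set) : Set where
    field
      P≢Q : ∀ {p q} → P p → Q q → p ≢ q
      P≢O : ∀ {p o} → P p → O o → p ≢ o
      Q≢O : ∀ {q o} → Q q → O o → q ≢ o
      P-cohesive : ∀ {p p′ q} → P p → P p′ → Q q → hL p q < hL p p′
      Q-cohesive : ∀ {q q′ p} → Q q → Q q′ → P p → hL q p < hL q q′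
      P-separated : ∀ {p q o} → P p → Q q → O o → hL p o < hL p q
      Q-separated : ∀ {p q o} → P p → Q q → O o → hL q o < hL q p

  Split-swap : ∀ {P Q O} → Split P Q O → Split Q P O
  Split-swap s = record
    { P≢Q = λ q p e → P≢Q p q (sym e)
    ; P≢O = Q≢O
    ; Q≢O = P≢O
    ; P-cohesive = Q-cohesive
    ; Q-cohesive = P-cohesive
    ; P-separated = λ q p o → Q-separated p q o
    ; Q-separated = λ q p o → P-separated p q o
    }
    where open Split s

  module _ {P Q O} (S : Split P Q O) where
    open Split S

    split-caterpillar : ∀ {p p′ q o} → P p → P p′ → Q q → O o → p ≢ p′ →
                        hR p q < hR p o → hR p p′ < hR p q → NonPlanarQuartet
    split-caterpillar {p} {p′} {q} {o} Pp Pp′ Qq Oo p≢p′ r₁ r₂ =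
      p , p′ , q , o , inj₂ (dist , P-cohesive Pp Pp′ Qq , P-separated Pp Qq Oo , r₁ , r₂)
      where
      dist : Distinct4 p p′ q o
      dist = p≢p′ , P≢Q Pp Qq , P≢O Pp Oo , P≢Q Pp′ Qq , P≢O Pp′ Oo , Q≢O Qq Oo

    split-balanced : ∀ {p p′ q q′} → P p → P p′ → Q q → Q q′ → p ≢ p′ → q ≢ q′ →
                     hR p p′ < hR p q → hR p p′ < hR p′ q′ → NonPlanarQuartet
    split-balanced {p} {p′} {q} {q′} Pp Pp′ Qq Qq′ p≢p′ q≢q′ r₁ r₂ =
      p , p′ , q , q′ , inj₁ (dist , P-cohesive Pp Pp′ Qq , subst (_< hL q q′) (hL-comm q p) (Q-cohesive Qq Qq′ Pp) , r₁ , r₂)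
      where
      dist : Distinct4 p p′ q q′
      dist = p≢p′ , P≢Q Pp Qq , P≢Q Pp Qq′ , P≢Q Pp′ Qq , P≢Q Pp′ Qq′ , q≢q′

    nested-conflict : ∀ {p q p′ o} → P p → Q q → P p′ → O o →
                      hR q p′ < hR q o → hR q o < hR p o → NonPlanarQuartet
    nested-conflict {p} {q} {p′} {o} Pp Qq Pp′ Oo H q<p =
      split-caterpillar Pp Pp′ Qq Oo p≢p′ r₁ r₂
      where
      open ≤-Reasoning
      p≢o : p ≢ o
      p≢o = P≢O Pp Oo
      q≢o : q ≢ o
      q≢o = Q≢O Qq Oo
      p′≢o : p′ ≢ o
      p′≢o = P≢O Pp′ Oo
      e₁ : hR q p′ ≡ hR o p′
      e₁ = h-xz<xy⇒xz≡yz q≢o (≢-sym (P≢Q Pp′ Qq)) (≢-sym p′≢o) H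
      oq<po : hR o q < hR p o
      oq<po = begin-strict hR o q ≡⟨ hR-comm o q ⟩ hR q o <⟨ q<p ⟩ hR p o ∎
      e₂ : hR p q ≡ hR o q
      e₂ = h-yz<xy⇒xz≡yz p≢o (P≢Q Pp Qq) (≢-sym q≢o) oq<po
      op′<po : hR o p′ < hR p o
      op′<po = begin-strict hR o p′ ≡⟨ sym e₁ ⟩ hR q p′ <⟨ H ⟩ hR q o <⟨ q<p ⟩ hR p o ∎
      p≢p′ : p ≢ p′
      p≢p′ refl = <-irrefl refl (begin-strict hR p o ≡⟨ hR-comm p o ⟩ hR o p <⟨ op′<po ⟩ hR p o ∎)
      r₁ : hR p q < hR p o
      r₁ = begin-strict hR p q ≡⟨ e₂ ⟩ hR o q <⟨ oq<po ⟩ hR p o ∎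
      r₂ : hR p p′ < hR p q
      r₂ = begin-strict hR p p′ ≡⟨ h-yz<xy⇒xz≡yz p≢o p≢p′ (≢-sym p′≢o) op′<po ⟩ hR o p′ ≡⟨ sym e₁ ⟩ hR q p′
                        <⟨ H ⟩ hR q o ≡⟨ hR-comm q o ⟩ hR o q ≡⟨ sym e₂ ⟩ hR p q ∎

  -- Both orders of the blocks P and Q clash with the same right neighbour o.
  module RightConflicts {P Q O} (S : Split P Q O) {p₁ q₁ q₂ p₂ o}
    (P₁ : P p₁) (Q₁ : Q q₁) (Q₂ : Q q₂) (P₂ : P p₂) (Oo : O o)
    (H₁ : hR p₁ q₁ < hR p₁ o) (H₂ : hR q₂ p₂ < hR q₂ o) where
    open Split S
    open ≤-Reasoning

    p₁≢o : p₁ ≢ o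
    p₁≢o = P≢O P₁ Oo
    p₂≢o : p₂ ≢ o
    p₂≢o = P≢O P₂ Oo
    q₁≢o : q₁ ≢ o
    q₁≢o = Q≢O Q₁ Oo
    q₂≢o : q₂ ≢ o
    q₂≢o = Q≢O Q₂ Oo

    e₁ : hR p₁ q₁ ≡ hR o q₁
    e₁ = h-xz<xy⇒xz≡yz p₁≢o (P≢Q P₁ Q₁) (≢-sym q₁≢o) H₁
    e₂ : hR q₂ p₂ ≡ hR o p₂
    e₂ = h-xz<xy⇒xz≡yz q₂≢o (≢-sym (P≢Q P₂ Q₂)) (≢-sym p₂≢o) H₂

    module Tie (k₁≡k₂ : hR p₁ o ≡ hR q₂ o) where
      op₂<p₁o : hR o p₂ < hR p₁ o
      op₂<p₁o = begin-strict hR o p₂ ≡⟨ sym e₂ ⟩ hR q₂ p₂ <⟨ H₂ ⟩ hR q₂ o ≡⟨ sym k₁≡k₂ ⟩ hR p₁ o ∎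
      p₁≢p₂ : p₁ ≢ p₂
      p₁≢p₂ refl = <-irrefl refl (begin-strict hR p₁ o ≡⟨ hR-comm p₁ o ⟩ hR o p₁ <⟨ op₂<p₁o ⟩ hR p₁ o ∎)
      oq₁<q₂o : hR o q₁ < hR q₂ o
      oq₁<q₂o = begin-strict hR o q₁ ≡⟨ sym e₁ ⟩ hR p₁ q₁ <⟨ H₁ ⟩ hR p₁ o ≡⟨ k₁≡k₂ ⟩ hR q₂ o ∎
      q₂≢q₁ : q₂ ≢ q₁
      q₂≢q₁ refl = <-irrefl refl (begin-strict hR q₂ o ≡⟨ hR-comm q₂ o ⟩ hR o q₂ <⟨ oq₁<q₂o ⟩ hR q₂ o ∎)
      e₃ : hR p₁ p₂ ≡ hR o p₂
      e₃ = h-yz<xy⇒xz≡yz p₁≢o p₁≢p₂ (≢-sym p₂≢o) op₂<p₁o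
      e₄ : hR q₂ q₁ ≡ hR o q₁
      e₄ = h-yz<xy⇒xz≡yz q₂≢o q₂≢q₁ (≢-sym q₁≢o) oq₁<q₂o
      op₁<p₁q₂ : hR o p₁ < hR p₁ q₂
      op₁<p₁q₂ = h-xy≡xz⇒xy<yz (≢-sym p₁≢o) (≢-sym q₂≢o) (P≢Q P₁ Q₂)
                   (trans (hR-comm o p₁) (trans k₁≡k₂ (hR-comm q₂ o)))

      quartet : NonPlanarQuartet
      quartet with <-cmp (hR o p₂) (hR o q₁)
      ... | tri> _ _ t<s = split-caterpillar (Split-swap S) Q₂ Q₁ P₂ Oo q₂≢q₁ H₂
              (begin-strict hR q₂ q₁ ≡⟨ e₄ ⟩ hR o q₁ <⟨ t<s ⟩ hR o p₂ ≡⟨ sym e₂ ⟩ hR q₂ p₂ ∎)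
      ... | tri< s<t _ _ = split-caterpillar S P₁ P₂ Q₁ Oo p₁≢p₂ H₁
              (begin-strict hR p₁ p₂ ≡⟨ e₃ ⟩ hR o p₂ <⟨ s<t ⟩ hR o q₁ ≡⟨ sym e₁ ⟩ hR p₁ q₁ ∎)
      ... | tri≈ _ s=t _ = split-balanced S P₁ P₂ Q₂ Q₁ p₁≢p₂ q₂≢q₁
              (begin-strict hR p₁ p₂ ≡⟨ e₃ ⟩ hR o p₂ <⟨ op₂<p₁o ⟩ hR p₁ o ≡⟨ hR-comm p₁ o ⟩ hR o p₁ <⟨ op₁<p₁q₂ ⟩ hR p₁ q₂ ∎)
              (h-xy≡xz⇒xy<yz p₁≢p₂ (P≢Q P₁ Q₁) (P≢Q P₂ Q₁) (trans e₃ (trans s=t (sym e₁))))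

    quartet : NonPlanarQuartet
    quartet with <-cmp (hR p₁ o) (hR q₂ o)
    ... | tri> _ _ k₂<k₁ = nested-conflict S P₁ Q₂ P₂ Oo H₂ k₂<k₁
    ... | tri< k₁<k₂ _ _ = nested-conflict (Split-swap S) Q₂ P₁ Q₁ Oo H₁ k₁<k₂
    ... | tri≈ _ k₁≡k₂ _ = Tie.quartet k₁≡k₂

  -- One order of P and Q clashes with the right neighbour r, the other with the left neighbour l.
  module CrossedConflicts {P Q O} (S : Split P Q O) {p₁ q₁ p₂ q₂ l r}
    (P₁ : P p₁) (Q₁ : Q q₁) (P₂ : P p₂) (Q₂ : Q q₂) (Ol : O l) (Or : O r) (l≢r : l ≢ r)
    (Inv : ∀ {z} → P z ⊎ Q z → hR l r ≤ hR l z)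
    (H₁ : hR p₁ q₁ < hR p₁ r) (H₂ : hR p₂ q₂ < hR p₂ l) where
    open Split S
    open ≤-Reasoning

    p₁≢l : p₁ ≢ l
    p₁≢l = P≢O P₁ Ol
    p₂≢l : p₂ ≢ l
    p₂≢l = P≢O P₂ Ol
    q₁≢l : q₁ ≢ l
    q₁≢l = Q≢O Q₁ Ol
    q₂≢l : q₂ ≢ l
    q₂≢l = Q≢O Q₂ Ol
    p₁≢r : p₁ ≢ r
    p₁≢r = P≢O P₁ Or
    p₂≢r : p₂ ≢ r
    p₂≢r = P≢O P₂ Or
    q₁≢r : q₁ ≢ r
    q₁≢r = Q≢O Q₁ Or
    q₂≢r : q₂ ≢ r
    q₂≢r = Q≢O Q₂ Or

    Inv′ : ∀ {z} → P z ⊎ Q z → z ≢ l → z ≢ r → hR l r ≤ hR r z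
    Inv′ {z} pz z≢l z≢r with hR l r ≤? hR r z
    ... | yes p = p
    ... | no ¬p = ⊥-elim (<⇒≱ (begin-strict hR l z ≡⟨ h-yz<xy⇒xz≡yz l≢r (≢-sym z≢l) (≢-sym z≢r) (≰⇒> ¬p) ⟩
                                         hR r z <⟨ ≰⇒> ¬p ⟩ hR l r ∎) (Inv pz))

    e₁ : hR p₁ q₁ ≡ hR r q₁
    e₁ = h-xz<xy⇒xz≡yz p₁≢r (P≢Q P₁ Q₁) (≢-sym q₁≢r) H₁
    e₂ : hR p₂ q₂ ≡ hR l q₂
    e₂ = h-xz<xy⇒xz≡yz p₂≢l (P≢Q P₂ Q₂) (≢-sym q₂≢l) H₂

    p₁l<p₁r : hR p₁ l < hR p₁ r
    p₁l<p₁r with hR p₁ r ≤? hR p₁ l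
    ... | no ¬p = ≰⇒> ¬p
    ... | yes le = ⊥-elim (<⇒≱ rq₁<lr (Inv′ (inj₂ Q₁) q₁≢l q₁≢r))
      where
      rq₁<lr : hR r q₁ < hR l r
      rq₁<lr = begin-strict hR r q₁ ≡⟨ sym e₁ ⟩ hR p₁ q₁ <⟨ H₁ ⟩ hR p₁ r ≡⟨ hR-comm p₁ r ⟩ hR r p₁
                 ≤⟨ h-xy≤yz⇒xy≤xz (≢-sym p₁≢r) (≢-sym l≢r) p₁≢l (subst (_≤ hR p₁ l) (hR-comm p₁ r) le) ⟩
                 hR r l ≡⟨ hR-comm r l ⟩ hR l r ∎

    p₂r<p₂l : hR p₂ r < hR p₂ l
    p₂r<p₂l with hR p₂ l ≤? hR p₂ r
    ... | no ¬p = ≰⇒> ¬p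
    ... | yes le = ⊥-elim (<⇒≱ lq₂<lr (Inv (inj₂ Q₂)))
      where
      lq₂<lr : hR l q₂ < hR l r
      lq₂<lr = begin-strict hR l q₂ ≡⟨ sym e₂ ⟩ hR p₂ q₂ <⟨ H₂ ⟩ hR p₂ l ≡⟨ hR-comm p₂ l ⟩ hR l p₂
                 ≤⟨ h-xy≤yz⇒xy≤xz (≢-sym p₂≢l) l≢r p₂≢r (subst (_≤ hR p₂ r) (hR-comm p₂ l) le) ⟩ hR l r ∎

    p₁l≡lr : hR p₁ l ≡ hR l r
    p₁l≡lr = trans (h-xz<xy⇒xz≡yz p₁≢r p₁≢l (≢-sym l≢r) p₁l<p₁r) (hR-comm r l)
    p₂r≡lr : hR p₂ r ≡ hR l r
    p₂r≡lr = h-xz<xy⇒xz≡yz p₂≢l p₂≢r l≢r p₂r<p₂l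

    p₁≢p₂ : p₁ ≢ p₂
    p₁≢p₂ refl = <-asym p₁l<p₁r p₂r<p₂l

    p₁p₂≡lr : hR p₁ p₂ ≡ hR l r
    p₁p₂≡lr = trans (h-yz<xy⇒xz≡yz p₁≢r p₁≢p₂ (≢-sym p₂≢r) rp₂<p₁r) (trans (hR-comm r p₂) p₂r≡lr)
      where
      rp₂<p₁r : hR r p₂ < hR p₁ r
      rp₂<p₁r = begin-strict hR r p₂ ≡⟨ hR-comm r p₂ ⟩ hR p₂ r ≡⟨ p₂r≡lr ⟩ hR l r ≡⟨ sym p₁l≡lr ⟩ hR p₁ l <⟨ p₁l<p₁r ⟩ hR p₁ r ∎

    lr≤p₁q₁ : hR l r ≤ hR p₁ q₁
    lr≤p₁q₁ = subst (_≤ hR p₁ q₁) p₁l≡lr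
      (h-xy≤yz⇒xy≤xz p₁≢l (P≢Q P₁ Q₁) (≢-sym q₁≢l) (subst (_≤ hR l q₁) (sym p₁l≡lr) (Inv (inj₂ Q₁))))
    lr≤p₂q₂ : hR l r ≤ hR p₂ q₂
    lr≤p₂q₂ = subst (_≤ hR p₂ q₂) p₂r≡lr
      (h-xy≤yz⇒xy≤xz p₂≢r (P≢Q P₂ Q₂) (≢-sym q₂≢r) (subst (_≤ hR r q₂) (sym p₂r≡lr) (Inv′ (inj₂ Q₂) q₂≢l q₂≢r)))

    both-tight : hR p₁ q₁ ≡ hR l r → hR p₂ q₂ ≡ hR l r → NonPlanarQuartet
    both-tight t₁ t₂ = split-balanced S P₁ P₂ Q₂ Q₁ p₁≢p₂ q₂≢q₁
                         (subst (_< hR p₁ q₂) (sym p₁p₂≡lr) lr<p₁q₂) (subst (_< hR p₂ q₁) (sym p₁p₂≡lr) lr<p₂q₁)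
      where
      lr<p₂q₁ : hR l r < hR p₂ q₁
      lr<p₂q₁ = <h-trans p₂≢l (P≢Q P₂ Q₁) (≢-sym q₁≢l) (subst (_< hR p₂ l) p₂r≡lr p₂r<p₂l)
                  (subst (_< hR l q₁) p₁l≡lr (h-xy≡xz⇒xy<yz p₁≢l (P≢Q P₁ Q₁) (≢-sym q₁≢l) (trans p₁l≡lr (sym t₁))))
      lr<p₁q₂ : hR l r < hR p₁ q₂
      lr<p₁q₂ = <h-trans p₁≢r (P≢Q P₁ Q₂) (≢-sym q₂≢r) (subst (_< hR p₁ r) p₁l≡lr p₁l<p₁r)
                  (subst (_< hR r q₂) p₂r≡lr (h-xy≡xz⇒xy<yz p₂≢r (P≢Q P₂ Q₂) (≢-sym q₂≢r) (trans p₂r≡lr (sym t₂))))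
      q₂≢q₁ : q₂ ≢ q₁
      q₂≢q₁ refl = <-irrefl (sym t₂) lr<p₂q₁

    quartet : NonPlanarQuartet
    quartet with hR p₁ q₁ ≤? hR l r | hR p₂ q₂ ≤? hR l r
    ... | no ¬p | _ = split-caterpillar S P₁ P₂ Q₁ Or p₁≢p₂ H₁ (subst (_< hR p₁ q₁) (sym p₁p₂≡lr) (≰⇒> ¬p))
    ... | yes _ | no ¬p = split-caterpillar S P₂ P₁ Q₂ Ol (≢-sym p₁≢p₂) H₂
                            (subst (_< hR p₂ q₂) (trans (sym p₁p₂≡lr) (hR-comm p₁ p₂)) (≰⇒> ¬p))
    ... | yes a | yes b = both-tight (≤-antisym a lr≤p₁q₁) (≤-antisym b lr≤p₂q₂)

  argmax-absorbs : DecidableEquality X → ∀ {P W : X → Set} → (∀ {x w} → P x → W w → x ≢ w) →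
                   ∀ {x₀ w₀} → P x₀ → W w₀ → (∀ {x w} → P x → W w → hR x w ≤ hR x₀ w₀) →
                   (∀ {x w} → P x → W w → x ≢ x₀ → w ≢ w₀ → hR x x₀ < hR x w → hR x x₀ < hR x₀ w₀ →
                      hR x₀ w ≡ hR x x₀ → hR x w₀ ≡ hR x x₀ → hR w w₀ ≡ hR x x₀ → ⊥) →
                   ∀ {x z w} → P x → P z → W w → hR x z < hR x w → hR x z < hR x w₀
  argmax-absorbs _≟_ P≢W {x₀} {w₀} P₀ W₀ max bad {x} {z} {w} Px Pz Ww lt with w ≟ w₀
  ... | yes refl = lt
  ... | no w≢w₀ with hR x w ≤? hR w w₀
  ...   | yes le = <-≤-trans lt (h-xy≤yz⇒xy≤xz (P≢W Px Ww) (P≢W Px W₀) w≢w₀ le)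
  ...   | no ¬le = ⊥-elim (bad Px Ww x≢x₀ w≢w₀ xx₀<xw (<-≤-trans xx₀<xw (max Px Ww))
                            (trans e₂ (trans (hR-comm w₀ w) (sym xx₀≡ww₀))) (trans e₁ (sym xx₀≡ww₀)) (sym xx₀≡ww₀))
    where
    open ≤-Reasoning
    ww₀<xw : hR w w₀ < hR x w
    ww₀<xw = ≰⇒> ¬le
    e₁ : hR x w₀ ≡ hR w w₀
    e₁ = h-yz<xy⇒xz≡yz (P≢W Px Ww) (P≢W Px W₀) w≢w₀ ww₀<xw
    x≢x₀ : x ≢ x₀
    x≢x₀ refl = <-irrefl refl (begin-strict hR x w₀ ≡⟨ e₁ ⟩ hR w w₀ <⟨ ww₀<xw ⟩ hR x w ≤⟨ max Px Ww ⟩ hR x w₀ ∎)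
    e₂ : hR x₀ w ≡ hR w₀ w
    e₂ = h-yz<xy⇒xz≡yz (P≢W P₀ W₀) (P≢W P₀ Ww) (≢-sym w≢w₀)
           (begin-strict hR w₀ w ≡⟨ hR-comm w₀ w ⟩ hR w w₀ <⟨ ww₀<xw ⟩ hR x w ≤⟨ max Px Ww ⟩ hR x₀ w₀ ∎)
    xx₀≡ww₀ : hR x x₀ ≡ hR w w₀
    xx₀≡ww₀ = trans (h-yz<xy⇒xz≡yz (P≢W Px Ww) x≢x₀ (≢-sym (P≢W P₀ Ww))
                       (begin-strict hR w x₀ ≡⟨ hR-comm w x₀ ⟩ hR x₀ w ≡⟨ e₂ ⟩ hR w₀ w ≡⟨ hR-comm w₀ w ⟩ hR w w₀ <⟨ ww₀<xw ⟩ hR x w ∎))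
                    (trans (hR-comm w x₀) (trans e₂ (hR-comm w₀ w)))
    xx₀<xw : hR x x₀ < hR x w
    xx₀<xw = subst (_< hR x w) (sym xx₀≡ww₀) ww₀<xw

module Ordered {A : Set} where

  open import Data.Empty using (⊥)
  open import Data.List using (List; []; _∷_; _++_; fromMaybe)
  open import Data.List.Membership.Propositional using (_∈_)
  open import Data.List.Membership.Propositional.Properties using (∈-++⁻; ∈-++⁺ˡ; ∈-++⁺ʳ)
  open import Data.List.Relation.Unary.Any using (here; there)
  open import Data.Maybe using (Maybe; just)
  open import Data.Product using (Σ; _×_; _,_)
  open import Data.Sum using (_⊎_; inj₁; inj₂)
  open import Relation.Binary.PropositionalEquality using (_≡_; refl; cong)
  open import Relation.Nullary using (¬_; Dec; yes; no)
  open import Data.List.Relation.Unary.All using (All; []; _∷_)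
  open import Data.List.Properties using (++-identityʳ)

  data Before (x y : A) : List A → Set where
    now   : ∀ {σ} → y ∈ σ → Before x y (x ∷ σ)
    later : ∀ {w σ} → Before x y σ → Before x y (w ∷ σ)

  data Ordered3 (x y z : A) : List A → Set where
    now   : ∀ {σ} → Before y z σ → Ordered3 x y z (x ∷ σ)
    later : ∀ {w σ} → Ordered3 x y z σ → Ordered3 x y z (w ∷ σ)

  ∈-fromMaybe⁻ : ∀ {m : Maybe A} {x} → x ∈ fromMaybe m → m ≡ just x
  ∈-fromMaybe⁻ {just a} (here refl) = refl

  ¬Before-fromMaybe : ∀ {x y} {m : Maybe A} → Before x y (fromMaybe m) → ⊥
  ¬Before-fromMaybe {m = just a} (now ())
  ¬Before-fromMaybe {m = just a} (later ())

  ¬Ordered3-fromMaybe : ∀ {x y z} {m : Maybe A} → Ordered3 x y z (fromMaybe m) → ⊥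
  ¬Ordered3-fromMaybe {m = just a} (now ())
  ¬Ordered3-fromMaybe {m = just a} (later ())

  Before⇒∈ˡ : ∀ {x y σ} → Before x y σ → x ∈ σ
  Before⇒∈ˡ (now _) = here refl
  Before⇒∈ˡ (later p) = there (Before⇒∈ˡ p)

  Before⇒∈ʳ : ∀ {x y σ} → Before x y σ → y ∈ σ
  Before⇒∈ʳ (now p) = there p
  Before⇒∈ʳ (later p) = there (Before⇒∈ʳ p)

  Ordered3⇒∈₁ : ∀ {x y z σ} → Ordered3 x y z σ → x ∈ σ
  Ordered3⇒∈₁ (now _) = here refl
  Ordered3⇒∈₁ (later p) = there (Ordered3⇒∈₁ p)

  Ordered3⇒∈₂ : ∀ {x y z σ} → Ordered3 x y z σ → y ∈ σ
  Ordered3⇒∈₂ (now p) = there (Before⇒∈ˡ p)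
  Ordered3⇒∈₂ (later p) = there (Ordered3⇒∈₂ p)

  Ordered3⇒∈₃ : ∀ {x y z σ} → Ordered3 x y z σ → z ∈ σ
  Ordered3⇒∈₃ (now p) = there (Before⇒∈ʳ p)
  Ordered3⇒∈₃ (later p) = there (Ordered3⇒∈₃ p)

  Before-++⁺ : ∀ {x y α β} → x ∈ α → y ∈ β → Before x y (α ++ β)
  Before-++⁺ {α = a ∷ α} (here refl) q = now (∈-++⁺ʳ α q)
  Before-++⁺ {α = a ∷ α} (there p) q = later (Before-++⁺ p q)

  Before-++⁺ˡ : ∀ {x y α β} → Before x y α → Before x y (α ++ β)
  Before-++⁺ˡ (now q) = now (∈-++⁺ˡ q)
  Before-++⁺ˡ (later p) = later (Before-++⁺ˡ p)

  Before-++⁺ʳ : ∀ {x y} α {β} → Before x y β → Before x y (α ++ β)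
  Before-++⁺ʳ [] p = p
  Before-++⁺ʳ (a ∷ α) p = later (Before-++⁺ʳ α p)

  Before-++⁻ : ∀ {x y} α {β} → Before x y (α ++ β) → Before x y α ⊎ (x ∈ α × y ∈ β) ⊎ Before x y β
  Before-++⁻ [] p = inj₂ (inj₂ p)
  Before-++⁻ (a ∷ α) (now q) with ∈-++⁻ α q
  ... | inj₁ q₁ = inj₁ (now q₁)
  ... | inj₂ q₂ = inj₂ (inj₁ (here refl , q₂))
  Before-++⁻ (a ∷ α) (later p) with Before-++⁻ α p
  ... | inj₁ r = inj₁ (later r)
  ... | inj₂ (inj₁ (u , v)) = inj₂ (inj₁ (there u , v))
  ... | inj₂ (inj₂ r) = inj₂ (inj₂ r)

  Ordered3-++⁺ˡ : ∀ {x y z α β} → Ordered3 x y z α → Ordered3 x y z (α ++ β)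
  Ordered3-++⁺ˡ (now q) = now (Before-++⁺ˡ q)
  Ordered3-++⁺ˡ (later p) = later (Ordered3-++⁺ˡ p)

  Ordered3-++⁺ʳ : ∀ {x y z} α {β} → Ordered3 x y z β → Ordered3 x y z (α ++ β)
  Ordered3-++⁺ʳ [] p = p
  Ordered3-++⁺ʳ (a ∷ α) p = later (Ordered3-++⁺ʳ α p)

  Ordered3-++⁺-∈-Before : ∀ {x y z α β} → x ∈ α → Before y z β → Ordered3 x y z (α ++ β)
  Ordered3-++⁺-∈-Before {α = a ∷ α} (here refl) q = now (Before-++⁺ʳ α q)
  Ordered3-++⁺-∈-Before {α = a ∷ α} (there p) q = later (Ordered3-++⁺-∈-Before p q)

  Ordered3-++⁺-Before-∈ : ∀ {x y z α β} → Before x y α → z ∈ β → Ordered3 x y z (α ++ β)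
  Ordered3-++⁺-Before-∈ (now p) q = now (Before-++⁺ p q)
  Ordered3-++⁺-Before-∈ (later p) q = later (Ordered3-++⁺-Before-∈ p q)

  Ordered3-++⁻ : ∀ {x y z} α {β} → Ordered3 x y z (α ++ β) →
                 Ordered3 x y z α ⊎ (Before x y α × z ∈ β) ⊎ (x ∈ α × Before y z β) ⊎ Ordered3 x y z β
  Ordered3-++⁻ [] p = inj₂ (inj₂ (inj₂ p))
  Ordered3-++⁻ (a ∷ α) (now q) with Before-++⁻ α q
  ... | inj₁ r = inj₁ (now r)
  ... | inj₂ (inj₁ (u , v)) = inj₂ (inj₁ (now u , v))
  ... | inj₂ (inj₂ r) = inj₂ (inj₂ (inj₁ (here refl , r)))
  Ordered3-++⁻ (a ∷ α) (later p) with Ordered3-++⁻ α p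
  ... | inj₁ r = inj₁ (later r)
  ... | inj₂ (inj₁ (u , v)) = inj₂ (inj₁ (later u , v))
  ... | inj₂ (inj₂ (inj₁ (u , v))) = inj₂ (inj₂ (inj₁ (there u , v)))
  ... | inj₂ (inj₂ (inj₂ r)) = inj₂ (inj₂ (inj₂ r))

  module _ {P : A → Set} (P? : ∀ x → Dec (P x)) where
    Interleaved : List A → Set
    Interleaved π = Σ A λ x → Σ A λ z → Σ A λ y → Ordered3 x z y π × ((P x × P y × ¬ P z) ⊎ (¬ P x × ¬ P y × P z))

    blocks : (π : List A)
           → (Σ (List A) λ α → Σ (List A) λ β → π ≡ α ++ β × All P α × All (λ x → ¬ P x) β)
           ⊎ (Σ (List A) λ α → Σ (List A) λ β → π ≡ α ++ β × All (λ x → ¬ P x) α × All P β)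
           ⊎ Interleaved π
    blocks [] = inj₁ ([] , [] , refl , [] , [])
    blocks (e ∷ π) with blocks π | P? e
    ... | inj₁ (α , β , refl , pa , nb) | yes pe = inj₁ (e ∷ α , β , refl , pe ∷ pa , nb)
    ... | inj₁ ([] , β , refl , pa , nb) | no ne = inj₁ ([] , e ∷ β , refl , [] , ne ∷ nb)
    ... | inj₁ (a ∷ α , [] , refl , pa , nb) | no ne = inj₂ (inj₁ (e ∷ [] , a ∷ α , cong (e ∷_) (++-identityʳ (a ∷ α)) , ne ∷ [] , pa))
    ... | inj₁ (a ∷ α , b ∷ β , refl , pa ∷ _ , nb ∷ _) | no ne =
            inj₂ (inj₂ (e , a , b , now (Before-++⁺ {α = a ∷ α} (here refl) (here refl)) , inj₂ (ne , nb , pa)))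
    ... | inj₂ (inj₁ (α , β , refl , na , pb)) | no ne = inj₂ (inj₁ (e ∷ α , β , refl , ne ∷ na , pb))
    ... | inj₂ (inj₁ ([] , β , refl , na , pb)) | yes pe = inj₂ (inj₁ ([] , e ∷ β , refl , [] , pe ∷ pb))
    ... | inj₂ (inj₁ (a ∷ α , [] , refl , na , pb)) | yes pe = inj₁ (e ∷ [] , a ∷ α , cong (e ∷_) (++-identityʳ (a ∷ α)) , pe ∷ [] , na)
    ... | inj₂ (inj₁ (a ∷ α , b ∷ β , refl , na ∷ _ , pb ∷ _)) | yes pe =
            inj₂ (inj₂ (e , a , b , now (Before-++⁺ {α = a ∷ α} (here refl) (here refl)) , inj₁ (pe , pb , na)))
    ... | inj₂ (inj₂ (x , z , y , o , c)) | _ = inj₂ (inj₂ (x , z , y , later o , c))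

module Consistency {X : Set} (h : X → X → ℕ) (h-comm : ∀ x y → h x y ≡ h y x)
  (h-threePoint : ∀ {x y z} → x ≢ y → x ≢ z → y ≢ z → ThreePoint (h x y) (h x z) (h y z)) where

  open import Data.Nat using (_≤_; _<_)
  open import Data.Nat.Properties using (<⇒≱; ≮⇒≥)
  open import Data.Empty using (⊥; ⊥-elim)
  open import Data.List using (List; _++_; fromMaybe)
  open import Data.List.Membership.Propositional using (_∈_)
  open import Data.List.Membership.Propositional.Properties using (∈-++⁻)
  open import Data.List.Relation.Unary.Any using (here)
  open import Data.Maybe using (Maybe; just)
  open import Data.Product using (_×_; _,_)
  open import Data.Sum using (_⊎_; inj₁; inj₂)
  open import Relation.Binary.PropositionalEquality using (refl; sym; subst; ≢-sym)

  open ThreePointCondition h h-comm h-threePoint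
  open Ordered {X}

  Consistent : List X → Set
  Consistent σ = ∀ {x y z} → Ordered3 x y z σ → h x z ≤ h x y

  Consistent-++⁻ˡ : ∀ {α β} → Consistent (α ++ β) → Consistent α
  Consistent-++⁻ˡ N o = N (Ordered3-++⁺ˡ o)
  Consistent-++⁻ʳ : ∀ {α β} → Consistent (α ++ β) → Consistent β
  Consistent-++⁻ʳ {α} N o = N (Ordered3-++⁺ʳ α o)

  framed : Maybe X → List X → Maybe X → List X
  framed l π r = fromMaybe l ++ (π ++ fromMaybe r)

  module ConsistentConcat {l r : Maybe X} {P Q : X → Set} {π1 π2 : List X} {w0 v0 : X}
    (m1 : ∀ {x} → x ∈ π1 → P x) (m2 : ∀ {x} → x ∈ π2 → Q x)
    (outl : ∀ {x} → x ∈ fromMaybe l → P x ⊎ Q x → ⊥)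
    (outr : ∀ {x} → x ∈ fromMaybe r → P x ⊎ Q x → ⊥)
    (dPQ : ∀ {p q} → P p → Q q → p ≢ q)
    (Inv : ∀ {a b z} → l ≡ just a → r ≡ just b → P z ⊎ Q z → h a b ≤ h a z)
    (FR : ∀ {b x y} → r ≡ just b → P x → Q y → h x b ≤ h x y)
    (FL : ∀ {a x y} → l ≡ just a → P x → Q y → h a y ≤ h a x)
    (V0 : v0 ∈ fromMaybe l ⊎ P v0)
    (CR : ∀ {x z w} → P x → P z → Q w ⊎ w ∈ fromMaybe r → h x z < h x w → h x z < h x w0)
    (CL : ∀ {y z v} → Q y → Q z → v ∈ fromMaybe l ⊎ P v → h y z < h y v → h y z < h y v0)
    (N1 : Consistent (framed l π1 (just w0))) (N2 : Consistent (framed (just v0) π2 r)) where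

    no-left-conflict : ∀ {x z y} → x ∈ fromMaybe l ⊎ P x → Before z y π2 → h x z < h x y → ⊥
    no-left-conflict {x} {z} {y} vx occ lt = <⇒≱ back (N2 (now (Before-++⁺ˡ occ)))
      where
      Qz : Q z
      Qz = m2 (Before⇒∈ˡ occ)
      Qy : Q y
      Qy = m2 (Before⇒∈ʳ occ)
      notQ : ∀ {a q} → a ∈ fromMaybe l ⊎ P a → Q q → a ≢ q
      notQ (inj₁ al) Qq e = outl al (inj₂ (subst Q (sym e) Qq))
      notQ (inj₂ Pa) Qq e = dPQ Pa Qq e
      xQ : ∀ {q} → Q q → x ≢ q
      xQ = notQ vx
      v0Q : ∀ {q} → Q q → v0 ≢ q
      v0Q = notQ V0
      zy : z ≢ y
      zy = h-xy<xz⇒y≢z lt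
      c1 : h y z < h y x
      c1 = h-xy<xz⇒zy<zx (xQ Qz) (xQ Qy) zy lt
      c2 : h y z < h y v0
      c2 = CL Qy Qz vx c1
      back : h v0 z < h v0 y
      back = h-xy<xz⇒zy<zx (≢-sym zy) (≢-sym (v0Q Qy)) (≢-sym (v0Q Qz)) c2

    mPQ : ∀ {z} → z ∈ π1 ++ π2 → P z ⊎ Q z
    mPQ {z} p with ∈-++⁻ π1 p
    ... | inj₁ a = inj₁ (m1 a)
    ... | inj₂ b = inj₂ (m2 b)

    consistent : Consistent (framed l (π1 ++ π2) r)
    consistent {x} {z} {y} occ with Ordered3-++⁻ (fromMaybe l) {(π1 ++ π2) ++ fromMaybe r} occ
    ... | inj₁ o = ⊥-elim (¬Ordered3-fromMaybe {m = l} o)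
    ... | inj₂ (inj₁ (o , _)) = ⊥-elim (¬Before-fromMaybe {m = l} o)
    ... | inj₂ (inj₂ (inj₂ o)) = inner (Ordered3-++⁻ (π1 ++ π2) {fromMaybe r} o)
      where
      inner : Ordered3 x z y (π1 ++ π2) ⊎ (Before x z (π1 ++ π2) × y ∈ fromMaybe r) ⊎
              (x ∈ π1 ++ π2 × Before z y (fromMaybe r)) ⊎ Ordered3 x z y (fromMaybe r) → h x y ≤ h x z
      inner (inj₁ o′) with Ordered3-++⁻ π1 {π2} o′
      ... | inj₁ o1 = N1 (Ordered3-++⁺ʳ (fromMaybe l) (Ordered3-++⁺ˡ o1))
      ... | inj₂ (inj₁ (o1 , yq)) = ≮⇒≥ (λ lt → <⇒≱ (CR (m1 (Before⇒∈ˡ o1)) (m1 (Before⇒∈ʳ o1)) (inj₁ (m2 yq)) lt)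
                                         (N1 (Ordered3-++⁺ʳ (fromMaybe l) (Ordered3-++⁺-Before-∈ o1 (here refl)))))
      ... | inj₂ (inj₂ (inj₁ (xp , o2))) = ≮⇒≥ (λ lt → no-left-conflict (inj₂ (m1 xp)) o2 lt)
      ... | inj₂ (inj₂ (inj₂ o2)) = N2 (Ordered3-++⁺ʳ (fromMaybe (just v0)) (Ordered3-++⁺ˡ o2))
      inner (inj₂ (inj₁ (o′ , yr))) with Before-++⁻ π1 {π2} o′
      ... | inj₁ o1 = ≮⇒≥ (λ lt → <⇒≱ (CR (m1 (Before⇒∈ˡ o1)) (m1 (Before⇒∈ʳ o1)) (inj₂ yr) lt)
                                         (N1 (Ordered3-++⁺ʳ (fromMaybe l) (Ordered3-++⁺-Before-∈ o1 (here refl)))))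
      ... | inj₂ (inj₁ (xp , zq)) = FR (∈-fromMaybe⁻ yr) (m1 xp) (m2 zq)
      ... | inj₂ (inj₂ o2) = N2 (Ordered3-++⁺ʳ (fromMaybe (just v0)) (Ordered3-++⁺-Before-∈ o2 yr))
      inner (inj₂ (inj₂ (inj₁ (_ , o′)))) = ⊥-elim (¬Before-fromMaybe {m = r} o′)
      inner (inj₂ (inj₂ (inj₂ o′))) = ⊥-elim (¬Ordered3-fromMaybe {m = r} o′)
    ... | inj₂ (inj₂ (inj₁ (xl , o))) with Before-++⁻ (π1 ++ π2) {fromMaybe r} o
    ...   | inj₂ (inj₂ o′) = ⊥-elim (¬Before-fromMaybe {m = r} o′)
    ...   | inj₂ (inj₁ (zpq , yr)) = Inv (∈-fromMaybe⁻ xl) (∈-fromMaybe⁻ yr) (mPQ zpq)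
    ...   | inj₁ o′ with Before-++⁻ π1 {π2} o′
    ...     | inj₁ o1 = N1 (Ordered3-++⁺-∈-Before xl (Before-++⁺ˡ o1))
    ...     | inj₂ (inj₁ (zp , yq)) = FL (∈-fromMaybe⁻ xl) (m1 zp) (m2 yq)
    ...     | inj₂ (inj₂ o2) = ≮⇒≥ (λ lt → no-left-conflict (inj₁ xl) o2 lt)

module ListSearch {A : Set} where

  open import Data.List using (List; []; _∷_)
  open import Data.List.Membership.Propositional using (_∈_)
  open import Data.List.Relation.Unary.Any using (here; there)
  open import Data.Nat using (ℕ; _≤_)
  open import Data.Nat.Properties using (≤-refl; ≤-trans; <⇒≤; ≰⇒>; _≤?_)
  open import Data.Product using (Σ; _×_; _,_; proj₁; proj₂)
  open import Data.Sum using (_⊎_; inj₁; inj₂)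
  open import Relation.Nullary using (¬_; Dec; yes; no)
  open import Relation.Binary.PropositionalEquality using (refl)

  all-or-counterexample : {P : A → Set} → (∀ x → Dec (P x)) → (xs : List A) → (∀ {x} → x ∈ xs → P x) ⊎ (Σ A λ x → x ∈ xs × ¬ P x)
  all-or-counterexample d [] = inj₁ (λ ())
  all-or-counterexample d (a ∷ xs) with d a | all-or-counterexample d xs
  ... | no np | _ = inj₂ (a , here refl , np)
  ... | yes p | inj₂ (x , m , np) = inj₂ (x , there m , np)
  ... | yes p | inj₁ f = inj₁ λ { (here refl) → p ; (there m) → f m }

  argmax : (g : A → ℕ) (a : A) (xs : List A) → Σ A λ x₀ → x₀ ∈ (a ∷ xs) × (∀ {x} → x ∈ (a ∷ xs) → g x ≤ g x₀)
  argmax g a [] = a , here refl , λ { (here refl) → ≤-refl }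
  argmax g a (b ∷ xs) with argmax g b xs
  ... | (x1 , m1 , f1) with g a ≤? g x1
  ...   | yes le = x1 , there m1 , λ { (here refl) → le ; (there m) → f1 m }
  ...   | no nle = a , here refl , λ { (here refl) → ≤-refl ; (there m) → ≤-trans (f1 m) (<⇒≤ (≰⇒> nle)) }

  Argmax₂ : (A → A → ℕ) → List A → List A → Set
  Argmax₂ f xs ws = Σ A λ x₀ → Σ A λ w₀ → x₀ ∈ xs × w₀ ∈ ws × (∀ {x w} → x ∈ xs → w ∈ ws → f x w ≤ f x₀ w₀)

  argmax₂ : (f : A → A → ℕ) (xs ws : List A) → ∀ {a b} → a ∈ xs → b ∈ ws → Argmax₂ f xs ws
  argmax₂ f (a ∷ xs) (b ∷ ws) _ _ =
    let bw = λ x → argmax (f x) b ws in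
    let (x₀ , m0 , F0) = argmax (λ x → f x (proj₁ (bw x))) a xs in
    x₀ , proj₁ (bw x₀) , m0 , proj₁ (proj₂ (bw x₀)) ,
    λ {x} {w} mx mw → ≤-trans (proj₂ (proj₂ (bw x)) mw) (F0 mx)

  all₂-or-counterexample : {_R_ : A → A → Set} → (∀ x y → Dec (x R y)) → (xs ys : List A)
          → (∀ {x y} → x ∈ xs → y ∈ ys → x R y) ⊎ (Σ A λ x → Σ A λ y → x ∈ xs × y ∈ ys × ¬ x R y)
  all₂-or-counterexample d [] ys = inj₁ (λ ())
  all₂-or-counterexample d (a ∷ xs) ys with all-or-counterexample (d a) ys | all₂-or-counterexample d xs ys
  ... | inj₂ (y , m , np) | _ = inj₂ (a , y , here refl , m , np)
  ... | inj₁ f | inj₂ (x , y , mx , my , np) = inj₂ (x , y , there mx , my , np)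
  ... | inj₁ f | inj₁ g = inj₁ λ { (here refl) my → f my ; (there mx) my → g mx my }

module LcaDepths {n : ℕ} (L R : Tree (Fin n)) (uL : Unique (leaves L)) (uR : Unique (leaves R))
  (allL : ∀ x → x ∈ leaves L) (allR : ∀ x → x ∈ leaves R) where

  open LeafAddress
  open import Data.Fin.Properties using (_≟_; any?)
  open import Data.Nat.Properties using (_<?_)
  open import Relation.Nullary using (Dec; ¬?)
  open import Relation.Nullary.Decidable using (_×-dec_; _⊎-dec_)

  hL hR : Fin n → Fin n → ℕ
  hL = lcaDepth L
  hR = lcaDepth R

  hL-comm : ∀ x y → hL x y ≡ hL y x
  hL-comm = lcaDepth-comm L

  hR-comm : ∀ x y → hR x y ≡ hR y x
  hR-comm = lcaDepth-comm R

  hR-threePoint : ∀ {x y z} → x ≢ y → x ≢ z → y ≢ z → ThreePoint (hR x y) (hR x z) (hR y z)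
  hR-threePoint = lcaDepth-threePoint R uR allR

  module OnL = ThreePointCondition hL hL-comm (lcaDepth-threePoint L uL allL)
  module OnR = ThreePointCondition hR hR-comm hR-threePoint

  open Quartet hL hR hL-comm hR-comm hR-threePoint public

  distinct4? : ∀ a b c d → Dec (Distinct4 a b c d)
  distinct4? a b c d = ¬? (a ≟ b) ×-dec ¬? (a ≟ c) ×-dec ¬? (a ≟ d) ×-dec ¬? (b ≟ c) ×-dec ¬? (b ≟ d) ×-dec ¬? (c ≟ d)

  balancedQuartet? : ∀ a b c d → Dec (BalancedQuartet a b c d)
  balancedQuartet? a b c d =
    distinct4? a b c d ×-dec hL a c <? hL a b ×-dec hL a c <? hL c d ×-dec hR a b <? hR a c ×-dec hR a b <? hR b d

  caterpillarQuartet? : ∀ a b c d → Dec (CaterpillarQuartet a b c d)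
  caterpillarQuartet? a b c d =
    distinct4? a b c d ×-dec hL a c <? hL a b ×-dec hL a d <? hL a c ×-dec hR a c <? hR a d ×-dec hR a b <? hR a c

  nonPlanarQuartet? : Dec NonPlanarQuartet
  nonPlanarQuartet? = any? λ a → any? λ b → any? λ c → any? λ d → balancedQuartet? a b c d ⊎-dec caterpillarQuartet? a b c d

module ConsistentArrangement {n : ℕ} (L R : Tree (Fin n)) (uL : Unique (leaves L)) (uR : Unique (leaves R))
  (allL : ∀ x → x ∈ leaves L) (allR : ∀ x → x ∈ leaves R) where
  open Address
  open LeafAddress
  open import Data.Bool using (true; false)
  open import Data.Empty using (⊥; ⊥-elim)
  open import Data.List using (List; []; _∷_; _++_; [_]; length; fromMaybe)
  open import Data.List.Membership.Propositional using (_∉_)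
  open import Data.List.Membership.Propositional.Properties using (∈-++⁻; ∈-++⁺ˡ; ∈-++⁺ʳ)
  open import Data.List.Properties using (++-assoc; ++-identityʳ)
  open import Data.List.Relation.Unary.Any using (here)
  open import Data.Maybe using (Maybe; just; nothing)
  open import Data.Nat using (suc; _≤_; _<_)
  open import Data.Nat.Properties using (<⇒≱; ≰⇒>; _≤?_; module ≤-Reasoning)
  open import Data.Product using (_×_; _,_; proj₁; proj₂)
  open import Data.Sum using (_⊎_; inj₁; inj₂; [_,_]′)
  open import Function using (_∘_)
  import Data.Sum as Sum
  open import Data.Fin.Properties using (_≟_)
  open import Relation.Nullary using (yes; no)
  open import Relation.Binary.PropositionalEquality using (refl; sym; trans; cong; cong₂; subst; subst₂; ≢-sym)

  X : Set
  X = Fin n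

  open LcaDepths L R uL uR allL allR public
  open Consistency hR hR-comm hR-threePoint public
  open Ordered {X} public
  open ListSearch {X}

  some-leaf : ∀ (t : Tree X) → Σ X λ a → a ∈ leaves t
  some-leaf (leaf a) = a , here refl
  some-leaf (node l r) = let (a , m) = some-leaf l in a , ∈-++⁺ˡ m

  SubtreeAt : Tree X → Address → Set
  SubtreeAt A σ = (∀ {x} → x ∈ leaves A → addr L x ≡ σ ++ addr A x) × (∀ {x} → σ ⊑ addr L x → x ∈ leaves A)

  SubtreeAt-root : SubtreeAt L []
  SubtreeAt-root = (λ _ → refl) , (λ {x} _ → allL x)

  module SubtreeAtNode {A1 A2 : Tree X} {σ : Address} (u : Unique (leaves (node A1 A2))) (E : SubtreeAt (node A1 A2) σ) where
    A : Tree X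
    A = node A1 A2
    inA1 : ∀ {x} → x ∈ leaves A1 → x ∈ leaves A
    inA1 = ∈-node⁺ˡ {l = A1} {r = A2}
    inA2 : ∀ {x} → x ∈ leaves A2 → x ∈ leaves A
    inA2 = ∈-node⁺ʳ {l = A1} {r = A2}
    disj : ∀ {x} → x ∈ leaves A1 → x ∈ leaves A2 → ⊥
    disj = Unique-++⇒disjoint {xs = leaves A1} u
    a1 : ∀ {x} → x ∈ leaves A1 → addr L x ≡ σ ++ (false ∷ addr A1 x)
    a1 p = trans (proj₁ E (inA1 p)) (cong (σ ++_) (addr-nodeˡ {l = A1} {r = A2} p))
    a2 : ∀ {x} → x ∈ leaves A2 → addr L x ≡ σ ++ (true ∷ addr A2 x)
    a2 p = trans (proj₁ E (inA2 p)) (cong (σ ++_) (addr-nodeʳ {l = A1} {r = A2} (λ q → disj q p)))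
    left-subtree : SubtreeAt A1 (σ ++ [ false ])
    left-subtree = (λ p → trans (a1 p) (sym (++-assoc σ [ false ] _))) , back
      where
      back : ∀ {x} → (σ ++ [ false ]) ⊑ addr L x → x ∈ leaves A1
      back {x} p with ∈-node⁻ {l = A1} {r = A2} (proj₂ E (⊑-trans (⊑-++ σ [ false ]) p))
      ... | inj₁ q = q
      ... | inj₂ q with ⊑-++-[]⁻ σ (subst ((σ ++ [ false ]) ⊑_) (a2 q) p)
      ...   | ()
    right-subtree : SubtreeAt A2 (σ ++ [ true ])
    right-subtree = (λ p → trans (a2 p) (sym (++-assoc σ [ true ] _))) , back
      where
      back : ∀ {x} → (σ ++ [ true ]) ⊑ addr L x → x ∈ leaves A2
      back {x} p with ∈-node⁻ {l = A1} {r = A2} (proj₂ E (⊑-trans (⊑-++ σ [ true ]) p))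
      ... | inj₂ q = q
      ... | inj₁ q with ⊑-++-[]⁻ σ (subst ((σ ++ [ true ]) ⊑_) (a1 q) p)
      ...   | ()
    u1 : Unique (leaves A1)
    u1 = Unique-++⁻ˡ u
    u2 : Unique (leaves A2)
    u2 = Unique-++⁻ʳ {xs = leaves A1} u

    P Q O : X → Set
    P x = x ∈ leaves A1
    Q x = x ∈ leaves A2
    O x = x ∉ leaves A

    hPQ : ∀ {p q} → P p → Q q → hL p q ≡ length σ
    hPQ Pp Qq = trans (cong₂ lcpLength (a1 Pp) (a2 Qq)) (lcpLength-fork σ _ _)
    hPP : ∀ {p p′} → P p → P p′ → suc (length σ) ≤ hL p p′
    hPP Pp Pp′ = subst (suc (length σ) ≤_) (sym (cong₂ lcpLength (a1 Pp) (a1 Pp′))) (lcpLength-shared σ false _ _)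
    hQQ : ∀ {q q′} → Q q → Q q′ → suc (length σ) ≤ hL q q′
    hQQ Qq Qq′ = subst (suc (length σ) ≤_) (sym (cong₂ lcpLength (a2 Qq) (a2 Qq′))) (lcpLength-shared σ true _ _)
    hXO : ∀ {x o} → x ∈ leaves A → O o → hL x o < length σ
    hXO {x} {o} Ax Oo with length σ ≤? hL x o
    ... | no nle = ≰⇒> nle
    ... | yes le = ⊥-elim (Oo (proj₂ E (⊑-through-lcp (subst (σ ⊑_) (sym (proj₁ E Ax)) (⊑-++ σ _)) le)))

    split : Split P Q O
    split = record
      { P≢Q = λ Pp Qq e → disj Pp (subst (_∈ leaves A2) (sym e) Qq)
      ; P≢O = λ Pp Oo e → Oo (subst (_∈ leaves A) e (inA1 Pp))
      ; Q≢O = λ Qq Oo e → Oo (subst (_∈ leaves A) e (inA2 Qq))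
      ; P-cohesive = λ Pp Pp′ Qq → subst (_< hL _ _) (sym (hPQ Pp Qq)) (hPP Pp Pp′)
      ; Q-cohesive = λ Qq Qq′ Pp → subst (_< hL _ _) (trans (sym (hPQ Pp Qq)) (hL-comm _ _)) (hQQ Qq Qq′)
      ; P-separated = λ Pp Qq Oo → subst (hL _ _ <_) (sym (hPQ Pp Qq)) (hXO (inA1 Pp) Oo)
      ; Q-separated = λ Pp Qq Oo → subst (hL _ _ <_) (trans (sym (hPQ Pp Qq)) (hL-comm _ _)) (hXO (inA2 Qq) Oo)
      }

  module Fit (l r : Maybe X) (P Q : X → Set) where
    FitsRight FitsLeft : Set
    FitsRight = ∀ {b x y} → r ≡ just b → P x → Q y → hR x b ≤ hR x y
    FitsLeft = ∀ {a x y} → l ≡ just a → P x → Q y → hR a y ≤ hR a x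
    ClashRight ClashLeft : Set
    ClashRight = Σ X λ b → Σ X λ x → Σ X λ y → r ≡ just b × P x × Q y × hR x y < hR x b
    ClashLeft = Σ X λ a → Σ X λ x → Σ X λ y → l ≡ just a × P x × Q y × hR a x < hR a y

  fit? : (l r : Maybe X) (B1 B2 : Tree X)
       → (Fit.FitsRight l r (_∈ leaves B1) (_∈ leaves B2) × Fit.FitsLeft l r (_∈ leaves B1) (_∈ leaves B2))
         ⊎ (Fit.ClashRight l r (_∈ leaves B1) (_∈ leaves B2) ⊎ Fit.ClashLeft l r (_∈ leaves B1) (_∈ leaves B2))
  fit? l r B1 B2 with fitsRight? r | fitsLeft? l
    where
    fitsRight? : (r : Maybe X) → Fit.FitsRight l r (_∈ leaves B1) (_∈ leaves B2) ⊎ Fit.ClashRight l r (_∈ leaves B1) (_∈ leaves B2)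
    fitsRight? nothing = inj₁ (λ ())
    fitsRight? (just b) with all₂-or-counterexample (λ x y → hR x b ≤? hR x y) (leaves B1) (leaves B2)
    ... | inj₁ f = inj₁ (λ { refl mx my → f mx my })
    ... | inj₂ (x , y , mx , my , np) = inj₂ (b , x , y , refl , mx , my , ≰⇒> np)
    fitsLeft? : (l : Maybe X) → Fit.FitsLeft l r (_∈ leaves B1) (_∈ leaves B2) ⊎ Fit.ClashLeft l r (_∈ leaves B1) (_∈ leaves B2)
    fitsLeft? nothing = inj₁ (λ ())
    fitsLeft? (just a) with all₂-or-counterexample (λ x y → hR a y ≤? hR a x) (leaves B1) (leaves B2)
    ... | inj₁ f = inj₁ (λ { refl mx my → f mx my })
    ... | inj₂ (x , y , mx , my , np) = inj₂ (a , x , y , refl , mx , my , ≰⇒> np)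
  ... | inj₁ fr | inj₁ fl = inj₁ (fr , fl)
  ... | inj₂ e | _ = inj₂ (inj₁ e)
  ... | inj₁ _ | inj₂ e = inj₂ (inj₂ e)

  just-unique : ∀ {m : Maybe X} {a b} → m ≡ just a → m ≡ just b → a ≡ b
  just-unique refl refl = refl

  module NoQuartet (noQuartet : ¬ NonPlanarQuartet) where

    module BothOrdersClash {P Q O : X → Set} (split : Split P Q O) {l r : Maybe X}
      (outl : ∀ {x} → x ∈ fromMaybe l → O x) (outr : ∀ {x} → x ∈ fromMaybe r → O x)
      (dlr : ∀ {a b} → l ≡ just a → r ≡ just b → a ≢ b)
      (inv : ∀ {a b z} → l ≡ just a → r ≡ just b → P z ⊎ Q z → hR a b ≤ hR a z) where
      open Split split
      O∈ : ∀ {m : Maybe X} {a} → (∀ {x} → x ∈ fromMaybe m → O x) → m ≡ just a → O a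
      O∈ f refl = f (here refl)

      impossible : Fit.ClashRight l r P Q ⊎ Fit.ClashLeft l r P Q → Fit.ClashRight l r Q P ⊎ Fit.ClashLeft l r Q P → ⊥
      impossible (inj₁ (b , x1 , y1 , eb , P1 , Q1 , H1)) (inj₁ (b′ , x2 , y2 , eb′ , Q2 , P2 , H2)) with just-unique eb eb′
      ... | refl = noQuartet (RightConflicts.quartet split P1 Q1 Q2 P2 (O∈ outr eb) H1 H2)
      impossible (inj₂ (a , x1 , y1 , ea , P1 , Q1 , H1)) (inj₂ (a′ , x2 , y2 , ea′ , Q2 , P2 , H2)) with just-unique ea ea′
      ... | refl = noQuartet (RightConflicts.quartet (Split-swap split) Q1 P1 P2 Q2 Oa
                    (h-xy<xz⇒zy<zx (≢-sym (P≢O P1 Oa)) (≢-sym (Q≢O Q1 Oa)) (P≢Q P1 Q1) H1)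
                    (h-xy<xz⇒zy<zx (≢-sym (Q≢O Q2 Oa)) (≢-sym (P≢O P2 Oa)) (≢-sym (P≢Q P2 Q2)) H2))
        where Oa : O a
              Oa = O∈ outl ea
      impossible (inj₁ (b , x1 , y1 , eb , P1 , Q1 , H1)) (inj₂ (a , x2 , y2 , ea , Q2 , P2 , H2)) =
        noQuartet (CrossedConflicts.quartet split P1 Q1 P2 Q2 Oa Ob (dlr ea eb) (inv ea eb) H1
          (h-xy<xz⇒zy<zx (≢-sym (Q≢O Q2 Oa)) (≢-sym (P≢O P2 Oa)) (≢-sym (P≢Q P2 Q2)) H2))
        where Oa : O a
              Oa = O∈ outl ea
              Ob : O b
              Ob = O∈ outr eb
      impossible (inj₂ (a , x1 , y1 , ea , P1 , Q1 , H1)) (inj₁ (b , x2 , y2 , eb , Q2 , P2 , H2)) =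
        noQuartet (CrossedConflicts.quartet (Split-swap split) Q2 P2 Q1 P1 Oa Ob (dlr ea eb) (λ pz → inv ea eb (Sum.swap pz)) H2
          (h-xy<xz⇒zy<zx (≢-sym (P≢O P1 Oa)) (≢-sym (Q≢O Q1 Oa)) (P≢Q P1 Q1) H1))
        where Oa : O a
              Oa = O∈ outl ea
              Ob : O b
              Ob = O∈ outr eb

    -- B1 is arranged between l and w0 and B2 between v0 and r, where (x0, w0)
    -- maximises hR on B1 × (B2 ∪ r) and (y0, v0) on B2 × (l ∪ B1): by argmax-absorbs these single
    -- leaves constrain each block exactly as the whole neighbouring block does.
    module Arrange (B1 B2 : Tree X) {O : X → Set} (split : Split (_∈ leaves B1) (_∈ leaves B2) O) {l r : Maybe X}
      (outl : ∀ {x} → x ∈ fromMaybe l → O x) (outr : ∀ {x} → x ∈ fromMaybe r → O x)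
      (dlr : ∀ {a b} → l ≡ just a → r ≡ just b → a ≢ b)
      (inv : ∀ {a b z} → l ≡ just a → r ≡ just b → z ∈ leaves B1 ⊎ z ∈ leaves B2 → hR a b ≤ hR a z)
      (fr : Fit.FitsRight l r (_∈ leaves B1) (_∈ leaves B2)) (fl : Fit.FitsLeft l r (_∈ leaves B1) (_∈ leaves B2)) where
      open Split split
      P Q : X → Set
      P = _∈ leaves B1
      Q = _∈ leaves B2

      W1 V2 : List X
      W1 = leaves B2 ++ fromMaybe r
      V2 = fromMaybe l ++ leaves B1

      am1 : Argmax₂ hR (leaves B1) W1
      am1 = argmax₂ hR (leaves B1) W1 (proj₂ (some-leaf B1)) (∈-++⁺ˡ (proj₂ (some-leaf B2)))
      x0 w0 : X
      x0 = proj₁ am1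
      w0 = proj₁ (proj₂ am1)
      mx0 : P x0
      mx0 = proj₁ (proj₂ (proj₂ am1))
      w0W : Q w0 ⊎ w0 ∈ fromMaybe r
      w0W = ∈-++⁻ (leaves B2) (proj₁ (proj₂ (proj₂ (proj₂ am1))))
      max1 : ∀ {x w} → P x → Q w ⊎ w ∈ fromMaybe r → hR x w ≤ hR x0 w0
      max1 Px (inj₁ Qw) = proj₂ (proj₂ (proj₂ (proj₂ am1))) Px (∈-++⁺ˡ Qw)
      max1 Px (inj₂ wr) = proj₂ (proj₂ (proj₂ (proj₂ am1))) Px (∈-++⁺ʳ (leaves B2) wr)

      am2 : Argmax₂ hR V2 (leaves B2)
      am2 = argmax₂ hR V2 (leaves B2) (∈-++⁺ʳ (fromMaybe l) (proj₂ (some-leaf B1))) (proj₂ (some-leaf B2))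
      v0 y0 : X
      v0 = proj₁ am2
      y0 = proj₁ (proj₂ am2)
      v0V : v0 ∈ fromMaybe l ⊎ P v0
      v0V = ∈-++⁻ (fromMaybe l) (proj₁ (proj₂ (proj₂ am2)))
      my0 : Q y0
      my0 = proj₁ (proj₂ (proj₂ (proj₂ am2)))
      max2 : ∀ {y v} → Q y → v ∈ fromMaybe l ⊎ P v → hR y v ≤ hR y0 v0
      max2 {y} {v} Qy Vv = subst₂ _≤_ (hR-comm v y) (hR-comm v0 y0) (proj₂ (proj₂ (proj₂ (proj₂ am2))) (toV Vv) Qy)
        where toV : v ∈ fromMaybe l ⊎ P v → v ∈ V2
              toV (inj₁ a) = ∈-++⁺ˡ a
              toV (inj₂ b) = ∈-++⁺ʳ (fromMaybe l) b

      outl1 : ∀ {x} → x ∈ fromMaybe l → x ∉ leaves B1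
      outl1 xl Px = P≢O Px (outl xl) refl
      outr1 : ∀ {x} → x ∈ fromMaybe (just w0) → x ∉ leaves B1
      outr1 (here refl) Px with w0W
      ... | inj₁ Qw = P≢Q Px Qw refl
      ... | inj₂ wr = P≢O Px (outr wr) refl
      d1 : ∀ {a b} → l ≡ just a → just w0 ≡ just b → a ≢ b
      d1 {a} el refl e with w0W
      ... | inj₁ Qw = Q≢O Qw (outl (subst (λ m → a ∈ fromMaybe m) (sym el) (here refl))) (sym e)
      ... | inj₂ wr = dlr el (∈-fromMaybe⁻ wr) e
      inv1 : ∀ {a b z} → l ≡ just a → just w0 ≡ just b → z ∈ leaves B1 → hR a b ≤ hR a z
      inv1 el refl Pz with w0W
      ... | inj₁ Qw = fl el Pz Qw
      ... | inj₂ wr = inv el (∈-fromMaybe⁻ wr) (inj₁ Pz)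

      outl2 : ∀ {x} → x ∈ fromMaybe (just v0) → x ∉ leaves B2
      outl2 (here refl) Qx with v0V
      ... | inj₁ vl = Q≢O Qx (outl vl) refl
      ... | inj₂ Pv = P≢Q Pv Qx refl
      outr2 : ∀ {x} → x ∈ fromMaybe r → x ∉ leaves B2
      outr2 xr Qx = Q≢O Qx (outr xr) refl
      d2 : ∀ {a b} → just v0 ≡ just a → r ≡ just b → a ≢ b
      d2 {a} {b} refl er e with v0V
      ... | inj₁ vl = dlr (∈-fromMaybe⁻ vl) er e
      ... | inj₂ Pv = P≢O Pv (outr (subst (λ m → b ∈ fromMaybe m) (sym er) (here refl))) e
      inv2 : ∀ {a b z} → just v0 ≡ just a → r ≡ just b → z ∈ leaves B2 → hR a b ≤ hR a z
      inv2 refl er Qz with v0V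
      ... | inj₁ vl = inv (∈-fromMaybe⁻ vl) er (inj₂ Qz)
      ... | inj₂ Pv = fr er Pv Qz

      dPW : ∀ {x w} → P x → Q w ⊎ w ∈ fromMaybe r → x ≢ w
      dPW Px (inj₁ Qw) = P≢Q Px Qw
      dPW Px (inj₂ wr) = P≢O Px (outr wr)

      badR : ∀ {x w} → P x → Q w ⊎ w ∈ fromMaybe r → x ≢ x0 → w ≢ w0 → hR x x0 < hR x w → hR x x0 < hR x0 w0
           → hR x0 w ≡ hR x x0 → hR x w0 ≡ hR x x0 → hR w w0 ≡ hR x x0 → ⊥
      badR {x} {w} Px (inj₁ Qw) xx0 ww0 b1 b2 b3 b4 b5 with w0W
      ... | inj₁ Qw0 = noQuartet (split-balanced split Px mx0 Qw Qw0 xx0 ww0 b1 b2)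
      ... | inj₂ w0r = <⇒≱ (subst (_< hR x0 w0) (sym b3) b2) (fr (∈-fromMaybe⁻ w0r) mx0 Qw)
      badR {x} {w} Px (inj₂ wr) xx0 ww0 b1 b2 b3 b4 b5 with w0W
      ... | inj₁ Qw0 = <⇒≱ (subst (_< hR x w) (sym b4) b1) (fr (∈-fromMaybe⁻ wr) Px Qw0)
      ... | inj₂ w0r = ww0 (just-unique (∈-fromMaybe⁻ wr) (∈-fromMaybe⁻ w0r))

      absorbs-right : ∀ {x z w} → P x → P z → Q w ⊎ w ∈ fromMaybe r → hR x z < hR x w → hR x z < hR x w0
      absorbs-right = argmax-absorbs _≟_ dPW mx0 w0W max1 badR

      dQV : ∀ {y v} → Q y → v ∈ fromMaybe l ⊎ P v → y ≢ v
      dQV Qy (inj₁ vl) = Q≢O Qy (outl vl)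
      dQV Qy (inj₂ Pv) e = P≢Q Pv Qy (sym e)

      badL : ∀ {x w} → Q x → w ∈ fromMaybe l ⊎ P w → x ≢ y0 → w ≢ v0 → hR x y0 < hR x w → hR x y0 < hR y0 v0
           → hR y0 w ≡ hR x y0 → hR x v0 ≡ hR x y0 → hR w v0 ≡ hR x y0 → ⊥
      badL {x} {w} Qx (inj₂ Pw) xy0 wv0 b1 b2 b3 b4 b5 with v0V
      ... | inj₂ Pv0 = noQuartet (split-balanced (Split-swap split) Qx my0 Pw Pv0 xy0 wv0 b1 b2)
      ... | inj₁ v0l = <⇒≱ c (fl (∈-fromMaybe⁻ v0l) Pw my0)
        where
        open ≤-Reasoning
        c : hR v0 w < hR v0 y0
        c = begin-strict hR v0 w ≡⟨ hR-comm v0 w ⟩ hR w v0 ≡⟨ b5 ⟩ hR x y0 <⟨ b2 ⟩ hR y0 v0 ≡⟨ hR-comm y0 v0 ⟩ hR v0 y0 ∎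
      badL {x} {w} Qx (inj₁ wl) xy0 wv0 b1 b2 b3 b4 b5 with v0V
      ... | inj₁ v0l = wv0 (just-unique (∈-fromMaybe⁻ wl) (∈-fromMaybe⁻ v0l))
      ... | inj₂ Pv0 = <⇒≱ c (fl (∈-fromMaybe⁻ wl) Pv0 Qx)
        where
        open ≤-Reasoning
        c : hR w v0 < hR w x
        c = begin-strict hR w v0 ≡⟨ b5 ⟩ hR x y0 <⟨ b1 ⟩ hR x w ≡⟨ hR-comm x w ⟩ hR w x ∎

      absorbs-left : ∀ {y z v} → Q y → Q z → v ∈ fromMaybe l ⊎ P v → hR y z < hR y v → hR y z < hR y v0
      absorbs-left = argmax-absorbs _≟_ dQV my0 v0V max2 badL

      consistent-++ : ∀ {π1 π2} → (∀ {x} → x ∈ π1 → P x) → (∀ {x} → x ∈ π2 → Q x)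
           → Consistent (framed l π1 (just w0)) → Consistent (framed (just v0) π2 r) → Consistent (framed l (π1 ++ π2) r)
      consistent-++ m1 m2 N1 N2 = ConsistentConcat.consistent m1 m2 outl′ outr′ P≢Q inv fr fl v0V absorbs-right absorbs-left N1 N2
        where
        outl′ : ∀ {x} → x ∈ fromMaybe l → P x ⊎ Q x → ⊥
        outl′ xl (inj₁ Px) = P≢O Px (outl xl) refl
        outl′ xl (inj₂ Qx) = Q≢O Qx (outl xl) refl
        outr′ : ∀ {x} → x ∈ fromMaybe r → P x ⊎ Q x → ⊥
        outr′ xr (inj₁ Px) = P≢O Px (outr xr) refl
        outr′ xr (inj₂ Qx) = Q≢O Qx (outr xr) refl

    Untangled : Tree X → Maybe X → Maybe X → Set
    Untangled A l r = Σ (Tree X) λ A′ → (A ~ A′) × Consistent (framed l (leaves A′) r)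

    consistent-leaf : ∀ {l r : Maybe X} {a} → (∀ {b c} → l ≡ just b → r ≡ just c → hR b c ≤ hR b a)
               → Consistent (framed l (a ∷ []) r)
    consistent-leaf {l} {r} {a} inv occ with Ordered3-++⁻ (fromMaybe l) {(a ∷ []) ++ fromMaybe r} occ
    ... | inj₁ o = ⊥-elim (¬Ordered3-fromMaybe {m = l} o)
    ... | inj₂ (inj₁ (o , _)) = ⊥-elim (¬Before-fromMaybe {m = l} o)
    ... | inj₂ (inj₂ (inj₁ (xl , o))) with Before-++⁻ (a ∷ []) {fromMaybe r} o
    ...   | inj₁ o′ = ⊥-elim (¬Before-fromMaybe {m = just a} o′)
    ...   | inj₂ (inj₁ (here refl , yr)) = inv (∈-fromMaybe⁻ xl) (∈-fromMaybe⁻ yr)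
    ...   | inj₂ (inj₂ o′) = ⊥-elim (¬Before-fromMaybe {m = r} o′)
    consistent-leaf {l} {r} {a} inv occ | inj₂ (inj₂ (inj₂ o)) with Ordered3-++⁻ (a ∷ []) {fromMaybe r} o
    ... | inj₁ o′ = ⊥-elim (¬Ordered3-fromMaybe {m = just a} o′)
    ... | inj₂ (inj₁ (o′ , _)) = ⊥-elim (¬Before-fromMaybe {m = just a} o′)
    ... | inj₂ (inj₂ (inj₁ (_ , o′))) = ⊥-elim (¬Before-fromMaybe {m = r} o′)
    ... | inj₂ (inj₂ (inj₂ o′)) = ⊥-elim (¬Ordered3-fromMaybe {m = r} o′)

    -- The leaves of A will lie between l and r in the final order; with no non-planar quartet
    -- one of the two orders of the children of A always fits them.
    untangle : (A : Tree X) (σ : Address) → Unique (leaves A) → SubtreeAt A σ → (l r : Maybe X)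
          → (∀ {x} → x ∈ fromMaybe l → x ∉ leaves A) → (∀ {x} → x ∈ fromMaybe r → x ∉ leaves A)
          → (∀ {a b} → l ≡ just a → r ≡ just b → a ≢ b)
          → (∀ {a b z} → l ≡ just a → r ≡ just b → z ∈ leaves A → hR a b ≤ hR a z)
          → Untangled A l r
    untangle (leaf a) σ u E l r outl outr dlr inv = leaf a , leaf~ , consistent-leaf (λ el er → inv el er (here refl))
    untangle (node A1 A2) σ u E l r outl outr dlr inv with fit? l r A1 A2 | fit? l r A2 A1
    ... | inj₁ (fr , fl) | _ = node (proj₁ r1) (proj₁ r2) , keep (proj₁ (proj₂ r1)) (proj₁ (proj₂ r2)) ,
            M.consistent-++ (∈-~⁻ (proj₁ (proj₂ r1))) (∈-~⁻ (proj₁ (proj₂ r2))) (proj₂ (proj₂ r1)) (proj₂ (proj₂ r2))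
      where
      module EN = SubtreeAtNode u E
      module M = Arrange A1 A2 EN.split outl outr dlr (λ el er → [ inv el er ∘ EN.inA1 , inv el er ∘ EN.inA2 ]′) fr fl
      r1 : Untangled A1 l (just M.w0)
      r1 = untangle A1 (σ ++ [ false ]) EN.u1 EN.left-subtree l (just M.w0) M.outl1 M.outr1 M.d1 M.inv1
      r2 : Untangled A2 (just M.v0) r
      r2 = untangle A2 (σ ++ [ true ]) EN.u2 EN.right-subtree (just M.v0) r M.outl2 M.outr2 M.d2 M.inv2
    ... | inj₂ _ | inj₁ (fr , fl) = node (proj₁ r1) (proj₁ r2) , swap (proj₁ (proj₂ r2)) (proj₁ (proj₂ r1)) ,
            M.consistent-++ (∈-~⁻ (proj₁ (proj₂ r1))) (∈-~⁻ (proj₁ (proj₂ r2))) (proj₂ (proj₂ r1)) (proj₂ (proj₂ r2))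
      where
      module EN = SubtreeAtNode u E
      module M = Arrange A2 A1 (Split-swap EN.split) outl outr dlr (λ el er → [ inv el er ∘ EN.inA2 , inv el er ∘ EN.inA1 ]′) fr fl
      r1 : Untangled A2 l (just M.w0)
      r1 = untangle A2 (σ ++ [ true ]) EN.u2 EN.right-subtree l (just M.w0) M.outl1 M.outr1 M.d1 M.inv1
      r2 : Untangled A1 (just M.v0) r
      r2 = untangle A1 (σ ++ [ false ]) EN.u1 EN.left-subtree (just M.v0) r M.outl2 M.outr2 M.d2 M.inv2
    ... | inj₂ clash₁₂ | inj₂ clash₂₁ =
            ⊥-elim (BothOrdersClash.impossible EN.split outl outr dlr (λ el er → [ inv el er ∘ EN.inA1 , inv el er ∘ EN.inA2 ]′) clash₁₂ clash₂₁)
      where module EN = SubtreeAtNode u E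

    untangled-L : Σ (Tree X) λ L′ → (L ~ L′) × Consistent (leaves L′)
    untangled-L with untangle L [] uL SubtreeAt-root nothing nothing (λ ()) (λ ()) (λ ()) (λ ())
    ... | L′ , e , N = L′ , e , subst Consistent (++-identityʳ (leaves L′)) N

module Planarity {n : ℕ} (L R : Tree (Fin n)) (uL : Unique (leaves L)) (uR : Unique (leaves R))
  (allL : ∀ x → x ∈ leaves L) (allR : ∀ x → x ∈ leaves R) where
  open Address
  open LeafAddress
  open ConsistentArrangement L R uL uR allL allR
  open import Data.Bool using (true; false)
  open import Data.Empty using (⊥; ⊥-elim)
  open import Data.Fin.Properties using (_≟_)
  open import Data.List using (List; []; _∷_; _++_; [_]; length)
  open import Data.List.Membership.DecPropositional (_≟_ {n}) using (_∈?_)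
  open import Data.List.Membership.Propositional.Properties using (∈-++⁻; ∈-++⁺ˡ; ∈-++⁺ʳ)
  open import Data.List.Properties using (++-assoc)
  open import Data.List.Relation.Unary.All using (_∷_; lookup)
  open import Data.List.Relation.Unary.AllPairs using (_∷_)
  open import Data.List.Relation.Unary.Any using (here; there)
  open import Data.Nat using (suc; _≤_; _<_)
  open import Data.Nat.Properties using (<⇒≱)
  open import Data.Product using (_×_; _,_; proj₁; proj₂)
  open import Data.Sum using (_⊎_; inj₁; inj₂; [_,_]′)
  open import Function using (id)
  open import Relation.Nullary using (¬_)
  open import Relation.Binary.PropositionalEquality using (refl; sym; trans; cong; cong₂; subst)

  SubtreeAtR : Tree X → Address → Set
  SubtreeAtR t τ = ∀ {x} → x ∈ leaves t → addr R x ≡ τ ++ addr t x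

  Realization : Tree X → List X → Set
  Realization t π = Σ (Tree X) λ t′ → (t ~ t′) × leaves t′ ≡ π

  module SplitOfR {l r : Tree X} {τ : Address} (ut : Unique (leaves (node l r))) (E : SubtreeAtR (node l r) τ) where

    disj : ∀ {x} → x ∈ leaves l → x ∈ leaves r → ⊥
    disj = Unique-++⇒disjoint {xs = leaves l} ut

    addrˡ : ∀ {a} → a ∈ leaves l → addr R a ≡ τ ++ false ∷ addr l a
    addrˡ la = trans (E (∈-node⁺ˡ {l = l} {r = r} la)) (cong (τ ++_) (addr-nodeˡ {l = l} {r = r} la))
    addrʳ : ∀ {b} → b ∈ leaves r → addr R b ≡ τ ++ true ∷ addr r b
    addrʳ rb = trans (E (∈-node⁺ʳ {l = l} {r = r} rb)) (cong (τ ++_) (addr-nodeʳ {l = l} {r = r} (λ q → disj q rb)))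

    subtreeˡ : SubtreeAtR l (τ ++ [ false ])
    subtreeˡ la = trans (addrˡ la) (sym (++-assoc τ [ false ] _))
    subtreeʳ : SubtreeAtR r (τ ++ [ true ])
    subtreeʳ rb = trans (addrʳ rb) (sym (++-assoc τ [ true ] _))

    hR-lr : ∀ {a b} → a ∈ leaves l → b ∈ leaves r → hR a b ≡ length τ
    hR-lr la rb = trans (cong₂ lcpLength (addrˡ la) (addrʳ rb)) (lcpLength-fork τ _ _)
    hR-ll : ∀ {a b} → a ∈ leaves l → b ∈ leaves l → suc (length τ) ≤ hR a b
    hR-ll la lb = subst (suc (length τ) ≤_) (sym (cong₂ lcpLength (addrˡ la) (addrˡ lb))) (lcpLength-shared τ false _ _)
    hR-rr : ∀ {a b} → a ∈ leaves r → b ∈ leaves r → suc (length τ) ≤ hR a b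
    hR-rr ra rb = subst (suc (length τ) ≤_) (sym (cong₂ lcpLength (addrʳ ra) (addrʳ rb))) (lcpLength-shared τ true _ _)

    interleaved-inconsistent : ∀ {π} → (∀ {x} → x ∈ π → x ∈ leaves (node l r)) →
                               Interleaved (λ x → x ∈? leaves l) π → ¬ Consistent π
    interleaved-inconsistent f (x , z , y , o , c) N = <⇒≱ (closer c) (N o)
      where
      in-r : ∀ {w} → w ∈ leaves (node l r) → ¬ (w ∈ leaves l) → w ∈ leaves r
      in-r = ∈-node⁻ʳ {l = l} {r = r}
      closer : (x ∈ leaves l × y ∈ leaves l × ¬ z ∈ leaves l) ⊎ (¬ x ∈ leaves l × ¬ y ∈ leaves l × z ∈ leaves l) →
               hR x z < hR x y
      closer (inj₁ (lx , ly , nz)) = subst (_< hR x y) (sym (hR-lr lx (in-r (f (Ordered3⇒∈₂ o)) nz))) (hR-ll lx ly)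
      closer (inj₂ (nx , ny , lz)) = subst (_< hR x y) (sym (trans (hR-comm x z) (hR-lr lz (in-r (f (Ordered3⇒∈₁ o)) nx))))
                                       (hR-rr (in-r (f (Ordered3⇒∈₁ o)) nx) (in-r (f (Ordered3⇒∈₃ o)) ny))

  -- Consistency forces the leaves of the two children of each vertex of t into contiguous blocks,
  -- so a consistent arrangement of the leaves of a subtree t of R is the leaf sequence of a switching of t.
  realize : (t : Tree X) (τ : Address) → Unique (leaves t) → SubtreeAtR t τ → (π : List X) → Unique π
          → (∀ {x} → x ∈ π → x ∈ leaves t) → (∀ {x} → x ∈ leaves t → x ∈ π) → Consistent π
          → Realization t π
  realize (leaf a) τ ut E [] uπ f g N with g (here refl)
  ... | ()
  realize (leaf a) τ ut E (b ∷ []) uπ f g N with f (here refl)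
  ... | here refl = leaf a , leaf~ , refl
  realize (leaf a) τ ut E (b ∷ c ∷ π) ((b≢c ∷ _) ∷ _) f g N with f (here refl) | f (there (here refl))
  ... | here refl | here refl = ⊥-elim (b≢c refl)
  realize (node l r) τ ut E π uπ f g N with blocks (λ x → x ∈? leaves l) π
  ... | inj₁ (α , β , refl , pa , nb) = node (proj₁ R1) (proj₁ R2) , keep (proj₁ (proj₂ R1)) (proj₁ (proj₂ R2)) ,
          cong₂ _++_ (proj₂ (proj₂ R1)) (proj₂ (proj₂ R2))
    where
    open SplitOfR {l} {r} {τ} ut E
    R1 : Realization l α
    R1 = realize l (τ ++ [ false ]) (Unique-++⁻ˡ ut) subtreeˡ α (Unique-++⁻ˡ uπ) (lookup pa)
           (λ m → [ id , (λ b → ⊥-elim (lookup nb b m)) ]′ (∈-++⁻ α (g (∈-node⁺ˡ {l = l} {r = r} m))))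
           (Consistent-++⁻ˡ N)
    R2 : Realization r β
    R2 = realize r (τ ++ [ true ]) (Unique-++⁻ʳ {xs = leaves l} ut) subtreeʳ β (Unique-++⁻ʳ {xs = α} uπ)
           (λ m → ∈-node⁻ʳ {l = l} {r = r} (f (∈-++⁺ʳ α m)) (lookup nb m))
           (λ m → [ (λ a → ⊥-elim (disj (lookup pa a) m)) , id ]′ (∈-++⁻ α (g (∈-node⁺ʳ {l = l} {r = r} m))))
           (Consistent-++⁻ʳ {α} N)
  ... | inj₂ (inj₁ (α , β , refl , na , pb)) = node (proj₁ R1) (proj₁ R2) , swap (proj₁ (proj₂ R2)) (proj₁ (proj₂ R1)) ,
          cong₂ _++_ (proj₂ (proj₂ R1)) (proj₂ (proj₂ R2))
    where
    open SplitOfR {l} {r} {τ} ut E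
    R1 : Realization r α
    R1 = realize r (τ ++ [ true ]) (Unique-++⁻ʳ {xs = leaves l} ut) subtreeʳ α (Unique-++⁻ˡ uπ)
           (λ m → ∈-node⁻ʳ {l = l} {r = r} (f (∈-++⁺ˡ m)) (lookup na m))
           (λ m → [ id , (λ b → ⊥-elim (disj (lookup pb b) m)) ]′ (∈-++⁻ α (g (∈-node⁺ʳ {l = l} {r = r} m))))
           (Consistent-++⁻ˡ N)
    R2 : Realization l β
    R2 = realize l (τ ++ [ false ]) (Unique-++⁻ˡ ut) subtreeˡ β (Unique-++⁻ʳ {xs = α} uπ) (lookup pb)
           (λ m → [ (λ a → ⊥-elim (lookup na a m)) , id ]′ (∈-++⁻ α (g (∈-node⁺ˡ {l = l} {r = r} m))))
           (Consistent-++⁻ʳ {α} N)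
  ... | inj₂ (inj₂ mixed) = ⊥-elim (SplitOfR.interleaved-inconsistent {l} {r} {τ} ut E f mixed N)

  planar-if-no-quartet : ¬ NonPlanarQuartet → Planar L R
  planar-if-no-quartet noQuartet with NoQuartet.untangled-L noQuartet
  ... | L′ , e , N with realize R [] uR (λ _ → refl) (leaves L′) (Unique-~ e uL) (λ {x} _ → allR x) (λ {x} _ → ∈-~ e (allL x)) N
  ...   | R′ , e′ , eq = L′ , R′ , e , e′ , sym eq

module Segment where

  open import Data.Nat using (ℕ; zero; suc; _≤_; _<_; s≤s; _+_; _∸_)
  open import Data.Nat.Properties using (≤-refl; ≤-trans; ≤-reflexive; m≤m+n; n≤1+n; +-identityʳ; +-suc; <⇒≢; m+[n∸m]≡n)
  open import Data.List using (List; []; _∷_; _++_)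
  open import Data.List.Membership.Propositional using (_∈_)
  open import Data.List.Relation.Unary.Any using (here; there)
  open import Data.List.Relation.Unary.AllPairs using ([]; _∷_)
  open import Data.List.Relation.Unary.All using (tabulate)
  open import Data.List.Relation.Unary.Unique.Propositional using (Unique)
  open import Data.List.Relation.Unary.Linked using (Linked; _∷_)
  open import Data.Product using (Σ; _×_; _,_)
  open import Relation.Binary.PropositionalEquality using (_≡_; _≢_; refl; sym; trans; cong; subst)

  module _ {A : Set} (f : ℕ → A) where

    descent : ℕ → ℕ → List A
    descent e zero = []
    descent e (suc d) = f e ∷ descent (suc e) d

    ascent : ℕ → ℕ → List A
    ascent e zero = []
    ascent e (suc d) = f (e + d) ∷ ascent e d

    ∈-descent⁻ : ∀ {v} e d → v ∈ descent e d → Σ ℕ λ k → e ≤ k × k < e + d × v ≡ f k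
    ∈-descent⁻ e (suc d) (here refl) = e , ≤-refl , subst (e <_) (sym (+-suc e d)) (s≤s (m≤m+n e d)) , refl
    ∈-descent⁻ e (suc d) (there m) with ∈-descent⁻ (suc e) d m
    ... | k , a , b , c = k , ≤-trans (n≤1+n e) a , subst (k <_) (sym (+-suc e d)) b , c

    ∈-ascent⁻ : ∀ {v} e d → v ∈ ascent e d → Σ ℕ λ k → e ≤ k × k < e + d × v ≡ f k
    ∈-ascent⁻ e (suc d) (here refl) = e + d , m≤m+n e d , subst (e + d <_) (sym (+-suc e d)) ≤-refl , refl
    ∈-ascent⁻ e (suc d) (there m) with ∈-ascent⁻ e d m
    ... | k , a , b , c = k , a , subst (k <_) (sym (+-suc e d)) (≤-trans b (n≤1+n _)) , c

    module _ {P : A → Set} {e d : ℕ} (P-range : ∀ {k} → e ≤ k → k < e + d → P (f k)) where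

      descent-all : ∀ {v} → v ∈ descent e d → P v
      descent-all m with ∈-descent⁻ e d m
      ... | k , a , b , refl = P-range a b

      ascent-all : ∀ {v} → v ∈ ascent e d → P v
      ascent-all m with ∈-ascent⁻ e d m
      ... | k , a , b , refl = P-range a b

    -- g reads the index back off the values, which makes f injective on the range.
    module _ (g : A → ℕ) where

      descent-unique : ∀ e d → (∀ k → e ≤ k → k < e + d → g (f k) ≡ k) → Unique (descent e d)
      descent-unique e zero G = []
      descent-unique e (suc d) G = tabulate (descent-all fresh) ∷ descent-unique (suc e) d G′
        where
        G′ : ∀ k → suc e ≤ k → k < suc e + d → g (f k) ≡ k
        G′ k a b = G k (≤-trans (n≤1+n e) a) (subst (k <_) (sym (+-suc e d)) b)
        fresh : ∀ {k} → suc e ≤ k → k < suc e + d → f e ≢ f k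
        fresh {k} a b eq = <⇒≢ a (trans (sym (G e ≤-refl (subst (e <_) (sym (+-suc e d)) (s≤s (m≤m+n e d)))))
                                         (trans (cong g eq) (G′ k a b)))

      ascent-unique : ∀ e d → (∀ k → e ≤ k → k < e + d → g (f k) ≡ k) → Unique (ascent e d)
      ascent-unique e zero G = []
      ascent-unique e (suc d) G = tabulate (ascent-all fresh) ∷ ascent-unique e d G′
        where
        G′ : ∀ k → e ≤ k → k < e + d → g (f k) ≡ k
        G′ k a b = G k a (subst (k <_) (sym (+-suc e d)) (≤-trans b (n≤1+n _)))
        fresh : ∀ {k} → e ≤ k → k < e + d → f (e + d) ≢ f k
        fresh {k} a b eq = <⇒≢ b (trans (sym (G′ k a b))
                                         (trans (cong g (sym eq)) (G (e + d) (m≤m+n e d) (subst (e + d <_) (sym (+-suc e d)) ≤-refl))))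

    module _ {R : A → A → Set} where

      descent-linked : ∀ i d {rest} → (∀ k → i ≤ k → k < i + d → R (f k) (f (suc k))) →
                       Linked R (f (i + d) ∷ rest) → Linked R (f i ∷ (descent (suc i) d ++ rest))
      descent-linked i zero {rest} E N = subst (λ z → Linked R (f z ∷ rest)) (+-identityʳ i) N
      descent-linked i (suc d) {rest} E N =
        E i ≤-refl (subst (i <_) (sym (+-suc i d)) (s≤s (m≤m+n i d)))
        ∷ descent-linked (suc i) d (λ k a b → E k (≤-trans (n≤1+n i) a) (subst (k <_) (sym (+-suc i d)) b))
                  (subst (λ z → Linked R (f z ∷ rest)) (+-suc i d) N)

      ascent-linked : ∀ e d {rest} → (∀ k → e ≤ k → k < e + d → R (f (suc k)) (f k)) →
                      Linked R (f e ∷ rest) → Linked R (f (e + d) ∷ (ascent e d ++ rest))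
      ascent-linked e zero {rest} E N = subst (λ z → Linked R (f z ∷ rest)) (sym (+-identityʳ e)) N
      ascent-linked e (suc d) {rest} E N =
        subst (λ z → R (f z) (f (e + d))) (sym (+-suc e d)) (E (e + d) (m≤m+n e d) (subst (e + d <_) (sym (+-suc e d)) ≤-refl))
        ∷ ascent-linked e d (λ k a b → E k a (subst (k <_) (sym (+-suc e d)) (≤-trans b (n≤1+n _)))) N

  range-tail : ∀ {e t k} → suc e ≤ k → k < suc e + (t ∸ e) → e ≤ t → e < k × k ≤ t
  range-tail {e} {t} {k} a (s≤s b) le = a , subst (k ≤_) (m+[n∸m]≡n le) b

  range-inner : ∀ {j i k} → suc j ≤ k → k < suc j + (i ∸ suc j) → j < i → j < k × k < i
  range-inner {j} {i} {k} a b lt = a , subst (k <_) (m+[n∸m]≡n lt) b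

  inner-bound : ∀ {j i s} → j < i → i ≤ s → suc j + (i ∸ suc j) ≤ suc s
  inner-bound j<i i≤s = ≤-trans (≤-reflexive (m+[n∸m]≡n j<i)) (≤-trans i≤s (n≤1+n _))

  tail-bound : ∀ {e t} → e ≤ t → suc e + (t ∸ e) ≤ suc t
  tail-bound e≤t = s≤s (≤-reflexive (m+[n∸m]≡n e≤t))

module Chains {V : Set} (Adj : V → V → Set) where

  open Segment
  open import Data.Nat using (ℕ; zero; suc; _≤_; _<_; _+_; _∸_; s≤s)
  open import Data.Nat.Properties using (≤-trans; n≤1+n; m+[n∸m]≡n)
  open import Data.List using (List; _∷_; _++_; [_])
  open import Data.List.Properties using (++-assoc)
  open import Data.List.Relation.Unary.Linked using (Linked; [-]; _∷_)
  open import Relation.Binary.PropositionalEquality using (_≡_; refl; sym; subst)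

  Walk : List V → Set
  Walk = Linked Adj

  record Chain : Set where
    field
      vertex : ℕ → V
      length : ℕ
      step   : ∀ k → suc k ≤ length → Adj (vertex k) (vertex (suc k))
      step⁻  : ∀ k → suc k ≤ length → Adj (vertex (suc k)) (vertex k)

  bottom : Chain → V
  bottom c = Chain.vertex c (Chain.length c)

  private
    ∸-suc : ∀ {j r} → j < r → r ∸ j ≡ suc (r ∸ suc j)
    ∸-suc {zero} {suc r} _ = refl
    ∸-suc {suc j} {suc r} (s≤s lt) = ∸-suc {j} {r} lt

    below : ∀ {e t k} → e ≤ t → k < e + (t ∸ e) → k < t
    below le lt = subst (_ <_) (m+[n∸m]≡n le) lt

  module _ (c : Chain) where
    open Chain c

    walk-up : ∀ i j → j < i → i ≤ length → Walk (vertex i ∷ ascent vertex (suc j) (i ∸ suc j) ++ [ vertex j ])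
    walk-up i j j<i i≤ = subst (λ z → Walk (vertex z ∷ ascent vertex (suc j) (i ∸ suc j) ++ [ vertex j ])) (m+[n∸m]≡n j<i)
      (ascent-linked vertex (suc j) (i ∸ suc j) (λ k _ b → step⁻ k (≤-trans (below j<i b) i≤)) (step⁻ j (≤-trans j<i i≤) ∷ [-]))

    walk-down : ∀ j i → j < i → i ≤ length → Walk (vertex j ∷ descent vertex (suc j) (i ∸ suc j) ++ [ vertex i ])
    walk-down j i j<i i≤ = descent-linked vertex j (i ∸ suc j) (λ k _ b → step k (≤-trans b (≤-trans (n≤1+n _) top)))
      (subst (λ z → Walk (vertex (j + (i ∸ suc j)) ∷ [ vertex z ])) (m+[n∸m]≡n j<i) (step (j + (i ∸ suc j)) top ∷ [-]))
      where
      top : suc (j + (i ∸ suc j)) ≤ length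
      top = subst (_≤ length) (sym (m+[n∸m]≡n j<i)) i≤

  module _ (c₁ c₂ : Chain) where
    private
      module C₁ = Chain c₁
      module C₂ = Chain c₂

    walk-across : Adj (bottom c₁) (bottom c₂) → ∀ i j → i ≤ C₁.length → j < C₂.length →
                  Walk (C₁.vertex i ∷ (descent C₁.vertex (suc i) (C₁.length ∸ i) ++ ascent C₂.vertex (suc j) (C₂.length ∸ j))
                                    ++ [ C₂.vertex j ])
    walk-across match i j i≤ j< rewrite ++-assoc (descent C₁.vertex (suc i) (C₁.length ∸ i)) (ascent C₂.vertex (suc j) (C₂.length ∸ j)) [ C₂.vertex j ] =
      descent-linked C₁.vertex i (C₁.length ∸ i) (λ k _ b → C₁.step k (below i≤ b))
        (subst (λ z → Walk (C₁.vertex z ∷ ascent C₂.vertex (suc j) (C₂.length ∸ j) ++ [ C₂.vertex j ])) (sym (m+[n∸m]≡n i≤)) rest)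
      where
      rest : Walk (bottom c₁ ∷ ascent C₂.vertex (suc j) (C₂.length ∸ j) ++ [ C₂.vertex j ])
      rest rewrite ∸-suc j< =
        subst (λ z → Adj (bottom c₁) (C₂.vertex z)) (sym (m+[n∸m]≡n j<)) match
        ∷ ascent-linked C₂.vertex (suc j) (C₂.length ∸ suc j) (λ k _ b → C₂.step⁻ k (below j< b)) (C₂.step⁻ j j< ∷ [-])

    walk-over-tops : Adj (C₁.vertex 0) (C₂.vertex 0) → ∀ i j → i ≤ C₁.length → j ≤ C₂.length →
                     Walk (C₁.vertex i ∷ (ascent C₁.vertex 0 i ++ descent C₂.vertex 0 j) ++ [ C₂.vertex j ])
    walk-over-tops tops i j i≤ j≤ rewrite ++-assoc (ascent C₁.vertex 0 i) (descent C₂.vertex 0 j) [ C₂.vertex j ] =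
      ascent-linked C₁.vertex 0 i (λ k _ b → C₁.step⁻ k (≤-trans b i≤)) (down j j≤)
      where
      down : ∀ j → j ≤ C₂.length → Walk (C₁.vertex 0 ∷ descent C₂.vertex 0 j ++ [ C₂.vertex j ])
      down zero _ = tops ∷ [-]
      down (suc j) j≤ = tops ∷ descent-linked C₂.vertex 0 j (λ k _ b → C₂.step k (≤-trans b (≤-trans (n≤1+n _) j≤))) (C₂.step j j≤ ∷ [-])

module TanglegramGraph {n : ℕ} (L R : Tree (Fin n)) (uL : Unique (leaves L)) (uR : Unique (leaves R))
  (allL : ∀ x → x ∈ leaves L) (allR : ∀ x → x ∈ leaves R) where

  open Address
  open LeafAddress
  open Segment
  open import Data.Nat using (suc; _≤_; _<_; _+_)
  open import Data.Nat.Properties using (≤-trans; ≤-refl; ≤-pred)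
  open import Data.List using (List; _++_; length; take)
  open import Data.List.Properties using (take-all)
  open import Data.List.Relation.Unary.Unique.Propositional.Properties using (++⁺)
  open import Data.Product using (Σ; _,_)
  open import Data.Sum using (inj₁; inj₂)
  open import Data.Empty using (⊥)
  open import Relation.Binary.PropositionalEquality using (_≡_; _≢_; refl; sym; trans; cong; subst; subst₂)

  V : Set
  V = TV L R

  Adj : V → V → Set
  Adj = TAdj L R

  open Chains Adj public

  depth : V → ℕ
  depth (inj₁ p) = length (posAddress p)
  depth (inj₂ q) = length (posAddress q)

  module Side (T : Tree (Fin n)) (uT : Unique (leaves T)) (allT : ∀ x → x ∈ leaves T)
    (ι : Pos T → V) (lift : ∀ {p q} → TreeEdge p q → TEdge L R (ι p) (ι q))
    (depth-ι : ∀ p → depth (ι p) ≡ length (posAddress p)) where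

    len : Fin n → ℕ
    len x = length (addr T x)

    vertex : Fin n → ℕ → V
    vertex x k = ι (posAt T (take k (addr T x)))

    chain : Fin n → Chain
    chain x = record
      { vertex = vertex x
      ; length = len x
      ; step = λ k le → inj₁ (lift (edgeAlong-addr T k (allT x) le))
      ; step⁻ = λ k le → inj₂ (lift (edgeAlong-addr T k (allT x) le))
      }

    vertex-top : ∀ x → vertex x 0 ≡ ι here
    vertex-top x = cong ι (posAt-[] T)

    vertex-bottom : ∀ x → LeafAt (posAt T (take (len x) (addr T x))) x
    vertex-bottom x = subst (λ β → LeafAt (posAt T β) x) (sym (take-all (len x) (addr T x) ≤-refl)) (leafAt-addr T (allT x))

    vertex-shared : ∀ {x y k} → k ≤ lcaDepth T x y → vertex x k ≡ vertex y k
    vertex-shared {x} {y} le = cong (λ β → ι (posAt T β)) (take-≤lcpLength (addr T x) (addr T y) le)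

    posAddress-vertex : ∀ x k → posAddress (posAt T (take k (addr T x))) ≡ take k (addr T x)
    posAddress-vertex x k = posAddress-posAt T (allT x) (take-⊑ k (addr T x))

    depth-vertex : ∀ {x k} → k ≤ len x → depth (vertex x k) ≡ k
    depth-vertex {x} {k} le = trans (depth-ι _) (trans (cong length (posAddress-vertex x k)) (length-take-≤ k (addr T x) le))

    lca<len : ∀ {x y} → x ≢ y → lcaDepth T x y < len x
    lca<len = lcaDepth<length T uT allT

    descent-unique-on : ∀ x e d → e + d ≤ suc (len x) → Unique (descent (vertex x) e d)
    descent-unique-on x e d le = descent-unique (vertex x) depth e d (λ k _ b → depth-vertex (≤-pred (≤-trans b le)))

    ascent-unique-on : ∀ x e d → e + d ≤ suc (len x) → Unique (ascent (vertex x) e d)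
    ascent-unique-on x e d le = ascent-unique (vertex x) depth e d (λ k _ b → depth-vertex (≤-pred (≤-trans b le)))

    OnSide : V → Set
    OnSide v = Σ (Pos T) λ p → v ≡ ι p

    descent-on-side : ∀ {x e d v} → v ∈ descent (vertex x) e d → OnSide v
    descent-on-side = descent-all _ {P = OnSide} (λ _ _ → _ , refl)

    ascent-on-side : ∀ {x e d v} → v ∈ ascent (vertex x) e d → OnSide v
    ascent-on-side = ascent-all _ {P = OnSide} (λ _ _ → _ , refl)

  module Left = Side L uL allL inj₁ edgeL (λ _ → refl)
  module Right = Side R uR allR inj₂ edgeR (λ _ → refl)

  matching-LR : ∀ x → Adj (bottom (Left.chain x)) (bottom (Right.chain x))
  matching-LR x = inj₁ (matching (Left.vertex-bottom x) (Right.vertex-bottom x))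

  matching-RL : ∀ x → Adj (bottom (Right.chain x)) (bottom (Left.chain x))
  matching-RL x = inj₂ (matching (Left.vertex-bottom x) (Right.vertex-bottom x))

  roots-LR : ∀ x y → Adj (Left.vertex x 0) (Right.vertex y 0)
  roots-LR x y = inj₁ (subst₂ (TEdge L R) (sym (Left.vertex-top x)) (sym (Right.vertex-top y)) rootEdge)

  roots-RL : ∀ x y → Adj (Right.vertex x 0) (Left.vertex y 0)
  roots-RL x y = inj₂ (subst₂ (TEdge L R) (sym (Left.vertex-top y)) (sym (Right.vertex-top x)) rootEdge)

  apart : ∀ {v} → Left.OnSide v → Right.OnSide v → ⊥
  apart (_ , refl) (_ , ())

  unique-across : ∀ {α β : List V} → Unique α → Unique β →
                  (∀ {v} → v ∈ α → Left.OnSide v) → (∀ {v} → v ∈ β → Right.OnSide v) → Unique (α ++ β)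
  unique-across uα uβ onL onR = ++⁺ uα uβ λ (vα , vβ) → apart (onL vα) (onR vβ)

  unique-across′ : ∀ {α β : List V} → Unique α → Unique β →
                   (∀ {v} → v ∈ α → Right.OnSide v) → (∀ {v} → v ∈ β → Left.OnSide v) → Unique (α ++ β)
  unique-across′ uα uβ onR onL = ++⁺ uα uβ λ (vα , vβ) → apart (onL vβ) (onR vα)

module QuartetShape where

  open Address
  open import Data.Bool using (Bool; true; false; if_then_else_)
  open import Data.List using (length; take)
  open import Data.Nat using (ℕ; _≤_; _<_; _≟_; _≡ᵇ_)
  open import Data.Nat.Properties using (≤-trans; <⇒≤; ≤-reflexive; <-trans; <⇒≢)
  open import Relation.Nullary using (does)
  open import Relation.Nullary.Decidable using (dec-true; dec-false)
  open import Relation.Binary.PropositionalEquality using (_≡_; _≢_; refl; sym; subst)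

  ⊑?-take-self : ∀ {k} α → does (take k α ⊑? α) ≡ true
  ⊑?-take-self {k} α = dec-true (take k α ⊑? α) (take-⊑ k α)

  ⊑?-take-within : ∀ {k} α β → k ≤ lcpLength α β → does (take k α ⊑? β) ≡ true
  ⊑?-take-within {k} α β le = dec-true (take k α ⊑? β) (take-⊑-through-lcp α β le)

  ⊑?-take-beyond : ∀ {k} α β → lcpLength α β < k → k ≤ length α → does (take k α ⊑? β) ≡ false
  ⊑?-take-beyond {k} α β lt le = dec-false (take k α ⊑? β) (take-⋢-beyond-lcp α β lt le)

  lcpLength-<-comm : ∀ {k} α β → lcpLength α β < k → lcpLength β α < k
  lcpLength-<-comm α β lt = subst (_< _) (lcpLength-comm α β) lt

  ≡ᵇ-refl : ∀ k → (k ≡ᵇ k) ≡ true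
  ≡ᵇ-refl k = dec-true (k ≟ k) refl

  ≢⇒≡ᵇ-false : ∀ {a b} → a ≢ b → (a ≡ᵇ b) ≡ false
  ≢⇒≡ᵇ-false {a} {b} ne = dec-false (a ≟ b) ne

  ≡ᵇ-length-take : ∀ {k} α → k ≤ length α → (length (take k α) ≡ᵇ k) ≡ true
  ≡ᵇ-length-take {k} α le = subst (λ j → (j ≡ᵇ k) ≡ true) (sym (length-take-≤ k α le)) (≡ᵇ-refl k)

  ≢⇒≡ᵇ-length-take : ∀ {k m} α → k ≤ length α → k ≢ m → (length (take k α) ≡ᵇ m) ≡ false
  ≢⇒≡ᵇ-length-take {k} {m} α le ne = subst (λ j → (j ≡ᵇ m) ≡ false) (sym (length-take-≤ k α le)) (≢⇒≡ᵇ-false ne)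

  -- A vertex of the tree ((p,q),(r,s)) is classified by the leaves below it and, when two or more
  -- of them are, by whether it is their lowest common ancestor (depth m, u or v).
  data BalancedPart : Set where
    bStem bRoot bInPQ bPQ bInRS bRS bLegP bLegQ bLegR bLegS bOther : BalancedPart

  balancedPart : Bool → Bool → Bool → Bool → Bool → Bool → Bool → BalancedPart
  balancedPart true true true true e1 _ _ = if e1 then bRoot else bStem
  balancedPart true true false false _ e2 _ = if e2 then bPQ else bInPQ
  balancedPart false false true true _ _ e3 = if e3 then bRS else bInRS
  balancedPart true false false false _ _ _ = bLegP
  balancedPart false true false false _ _ _ = bLegQ
  balancedPart false false true false _ _ _ = bLegR
  balancedPart false false false true _ _ _ = bLegS
  balancedPart _ _ _ _ _ _ _ = bOther

  module Balanced (αp αq αr αs : Address) (m u v : ℕ)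
    (hpr : lcpLength αp αr ≡ m) (hps : lcpLength αp αs ≡ m) (hqr : lcpLength αq αr ≡ m) (hqs : lcpLength αq αs ≡ m)
    (hpq : lcpLength αp αq ≡ u) (hrs : lcpLength αr αs ≡ v) (mu : m < u) (mv : m < v)
    (up : u < length αp) (uq : u < length αq) (vr : v < length αr) (vs : v < length αs) where

    classify : Address → BalancedPart
    classify σ = balancedPart (does (σ ⊑? αp)) (does (σ ⊑? αq)) (does (σ ⊑? αr)) (does (σ ⊑? αs)) ((length σ ≡ᵇ m)) ((length σ ≡ᵇ u)) ((length σ ≡ᵇ v))

    stemL : ∀ {k} → k < m → classify (take k αp) ≡ bStem
    stemL {k} lt = by-length (≤-trans (<⇒≤ (<-trans lt mu)) (<⇒≤ up))
      where
      by-length : k ≤ length αp → classify (take k αp) ≡ bStem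
      by-length kp rewrite ⊑?-take-self {k} αp | ⊑?-take-within {k} αp αq (subst (k ≤_) (sym hpq) (<⇒≤ (<-trans lt mu)))
            | ⊑?-take-within {k} αp αr (subst (k ≤_) (sym hpr) (<⇒≤ lt)) | ⊑?-take-within {k} αp αs (subst (k ≤_) (sym hps) (<⇒≤ lt))
            | ≢⇒≡ᵇ-length-take αp kp (<⇒≢ lt) = refl

    rootL : classify (take m αp) ≡ bRoot
    rootL = by-length (≤-trans (<⇒≤ mu) (<⇒≤ up))
      where
      by-length : m ≤ length αp → classify (take m αp) ≡ bRoot
      by-length kp rewrite ⊑?-take-self {m} αp | ⊑?-take-within {m} αp αq (subst (m ≤_) (sym hpq) (<⇒≤ mu))
            | ⊑?-take-within {m} αp αr (≤-reflexive (sym hpr)) | ⊑?-take-within {m} αp αs (≤-reflexive (sym hps))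
            | ≡ᵇ-length-take {m} αp kp = refl

    inPQL : ∀ {k} → m < k → k < u → classify (take k αp) ≡ bInPQ
    inPQL {k} a b = by-length (≤-trans (<⇒≤ b) (<⇒≤ up))
      where
      by-length : k ≤ length αp → classify (take k αp) ≡ bInPQ
      by-length kp rewrite ⊑?-take-self {k} αp | ⊑?-take-within {k} αp αq (subst (k ≤_) (sym hpq) (<⇒≤ b))
            | ⊑?-take-beyond {k} αp αr (subst (_< k) (sym hpr) a) kp | ⊑?-take-beyond {k} αp αs (subst (_< k) (sym hps) a) kp
            | ≢⇒≡ᵇ-length-take αp kp (<⇒≢ b) = refl

    pqL : classify (take u αp) ≡ bPQ
    pqL = by-length (<⇒≤ up)
      where
      by-length : u ≤ length αp → classify (take u αp) ≡ bPQ
      by-length kp rewrite ⊑?-take-self {u} αp | ⊑?-take-within {u} αp αq (≤-reflexive (sym hpq))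
            | ⊑?-take-beyond {u} αp αr (subst (_< u) (sym hpr) mu) kp | ⊑?-take-beyond {u} αp αs (subst (_< u) (sym hps) mu) kp
            | ≡ᵇ-length-take {u} αp kp = refl

    inRSL : ∀ {k} → m < k → k < v → classify (take k αr) ≡ bInRS
    inRSL {k} a b = by-length (≤-trans (<⇒≤ b) (<⇒≤ vr))
      where
      by-length : k ≤ length αr → classify (take k αr) ≡ bInRS
      by-length kp rewrite ⊑?-take-beyond {k} αr αp (lcpLength-<-comm αp αr (subst (_< k) (sym hpr) a)) kp
            | ⊑?-take-beyond {k} αr αq (lcpLength-<-comm αq αr (subst (_< k) (sym hqr) a)) kp | ⊑?-take-self {k} αr
            | ⊑?-take-within {k} αr αs (subst (k ≤_) (sym hrs) (<⇒≤ b))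
            | ≢⇒≡ᵇ-length-take αr kp (<⇒≢ b) = refl

    rsL : classify (take v αr) ≡ bRS
    rsL = by-length (<⇒≤ vr)
      where
      by-length : v ≤ length αr → classify (take v αr) ≡ bRS
      by-length kp rewrite ⊑?-take-beyond {v} αr αp (lcpLength-<-comm αp αr (subst (_< v) (sym hpr) mv)) kp
            | ⊑?-take-beyond {v} αr αq (lcpLength-<-comm αq αr (subst (_< v) (sym hqr) mv)) kp | ⊑?-take-self {v} αr
            | ⊑?-take-within {v} αr αs (≤-reflexive (sym hrs))
            | ≡ᵇ-length-take {v} αr kp = refl

    legPL : ∀ {k} → u < k → k ≤ length αp → classify (take k αp) ≡ bLegP
    legPL {k} a kp rewrite ⊑?-take-self {k} αp | ⊑?-take-beyond {k} αp αq (subst (_< k) (sym hpq) a) kp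
          | ⊑?-take-beyond {k} αp αr (subst (_< k) (sym hpr) (<-trans mu a)) kp | ⊑?-take-beyond {k} αp αs (subst (_< k) (sym hps) (<-trans mu a)) kp = refl

    legQL : ∀ {k} → u < k → k ≤ length αq → classify (take k αq) ≡ bLegQ
    legQL {k} a kp rewrite ⊑?-take-beyond {k} αq αp (lcpLength-<-comm αp αq (subst (_< k) (sym hpq) a)) kp | ⊑?-take-self {k} αq
          | ⊑?-take-beyond {k} αq αr (subst (_< k) (sym hqr) (<-trans mu a)) kp | ⊑?-take-beyond {k} αq αs (subst (_< k) (sym hqs) (<-trans mu a)) kp = refl

    legRL : ∀ {k} → v < k → k ≤ length αr → classify (take k αr) ≡ bLegR
    legRL {k} a kp rewrite ⊑?-take-beyond {k} αr αp (lcpLength-<-comm αp αr (subst (_< k) (sym hpr) (<-trans mv a))) kp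
          | ⊑?-take-beyond {k} αr αq (lcpLength-<-comm αq αr (subst (_< k) (sym hqr) (<-trans mv a))) kp | ⊑?-take-self {k} αr
          | ⊑?-take-beyond {k} αr αs (subst (_< k) (sym hrs) a) kp = refl

    legSL : ∀ {k} → v < k → k ≤ length αs → classify (take k αs) ≡ bLegS
    legSL {k} a kp rewrite ⊑?-take-beyond {k} αs αp (lcpLength-<-comm αp αs (subst (_< k) (sym hps) (<-trans mv a))) kp
          | ⊑?-take-beyond {k} αs αq (lcpLength-<-comm αq αs (subst (_< k) (sym hqs) (<-trans mv a))) kp
          | ⊑?-take-beyond {k} αs αr (lcpLength-<-comm αr αs (subst (_< k) (sym hrs) a)) kp | ⊑?-take-self {k} αs = refl

  -- The same for the tree (((p,q),r),s), with lowest common ancestors at depths w < v < u.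
  data CaterpillarPart : Set where
    cStem cRoot cIn1 cB2 cIn2 cB3 cLegP cLegQ cLegR cLegS cOther : CaterpillarPart

  caterpillarPart : Bool → Bool → Bool → Bool → Bool → Bool → Bool → CaterpillarPart
  caterpillarPart true true true true e1 _ _ = if e1 then cRoot else cStem
  caterpillarPart true true true false _ e2 _ = if e2 then cB2 else cIn1
  caterpillarPart true true false false _ _ e3 = if e3 then cB3 else cIn2
  caterpillarPart true false false false _ _ _ = cLegP
  caterpillarPart false true false false _ _ _ = cLegQ
  caterpillarPart false false true false _ _ _ = cLegR
  caterpillarPart false false false true _ _ _ = cLegS
  caterpillarPart _ _ _ _ _ _ _ = cOther

  module Caterpillar (αp αq αr αs : Address) (w v u : ℕ)
    (hpq : lcpLength αp αq ≡ u) (hpr : lcpLength αp αr ≡ v) (hqr : lcpLength αq αr ≡ v)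
    (hps : lcpLength αp αs ≡ w) (hqs : lcpLength αq αs ≡ w) (hrs : lcpLength αr αs ≡ w)
    (wv : w < v) (vu : v < u)
    (up : u < length αp) (uq : u < length αq) (vr : v < length αr) (ws : w < length αs) where

    classify : Address → CaterpillarPart
    classify σ = caterpillarPart (does (σ ⊑? αp)) (does (σ ⊑? αq)) (does (σ ⊑? αr)) (does (σ ⊑? αs)) ((length σ ≡ᵇ w)) ((length σ ≡ᵇ v)) ((length σ ≡ᵇ u))

    wu : w < u
    wu = <-trans wv vu

    stemC : ∀ {k} → k < w → classify (take k αp) ≡ cStem
    stemC {k} lt = by-length (≤-trans (<⇒≤ (<-trans lt wu)) (<⇒≤ up))
      where
      by-length : k ≤ length αp → classify (take k αp) ≡ cStem
      by-length kp rewrite ⊑?-take-self {k} αp | ⊑?-take-within {k} αp αq (subst (k ≤_) (sym hpq) (<⇒≤ (<-trans lt wu)))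
            | ⊑?-take-within {k} αp αr (subst (k ≤_) (sym hpr) (<⇒≤ (<-trans lt wv))) | ⊑?-take-within {k} αp αs (subst (k ≤_) (sym hps) (<⇒≤ lt))
            | ≢⇒≡ᵇ-length-take αp kp (<⇒≢ lt) = refl

    rootC : classify (take w αp) ≡ cRoot
    rootC = by-length (≤-trans (<⇒≤ wu) (<⇒≤ up))
      where
      by-length : w ≤ length αp → classify (take w αp) ≡ cRoot
      by-length kp rewrite ⊑?-take-self {w} αp | ⊑?-take-within {w} αp αq (subst (w ≤_) (sym hpq) (<⇒≤ wu))
            | ⊑?-take-within {w} αp αr (subst (w ≤_) (sym hpr) (<⇒≤ wv)) | ⊑?-take-within {w} αp αs (≤-reflexive (sym hps))
            | ≡ᵇ-length-take {w} αp kp = refl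

    in1C : ∀ {k} → w < k → k < v → classify (take k αp) ≡ cIn1
    in1C {k} a b = by-length (≤-trans (<⇒≤ (<-trans b vu)) (<⇒≤ up))
      where
      by-length : k ≤ length αp → classify (take k αp) ≡ cIn1
      by-length kp rewrite ⊑?-take-self {k} αp | ⊑?-take-within {k} αp αq (subst (k ≤_) (sym hpq) (<⇒≤ (<-trans b vu)))
            | ⊑?-take-within {k} αp αr (subst (k ≤_) (sym hpr) (<⇒≤ b)) | ⊑?-take-beyond {k} αp αs (subst (_< k) (sym hps) a) kp
            | ≢⇒≡ᵇ-length-take αp kp (<⇒≢ b) = refl

    b2C : classify (take v αp) ≡ cB2
    b2C = by-length (≤-trans (<⇒≤ vu) (<⇒≤ up))
      where
      by-length : v ≤ length αp → classify (take v αp) ≡ cB2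
      by-length kp rewrite ⊑?-take-self {v} αp | ⊑?-take-within {v} αp αq (subst (v ≤_) (sym hpq) (<⇒≤ vu))
            | ⊑?-take-within {v} αp αr (≤-reflexive (sym hpr)) | ⊑?-take-beyond {v} αp αs (subst (_< v) (sym hps) wv) kp
            | ≡ᵇ-length-take {v} αp kp = refl

    in2C : ∀ {k} → v < k → k < u → classify (take k αp) ≡ cIn2
    in2C {k} a b = by-length (≤-trans (<⇒≤ b) (<⇒≤ up))
      where
      by-length : k ≤ length αp → classify (take k αp) ≡ cIn2
      by-length kp rewrite ⊑?-take-self {k} αp | ⊑?-take-within {k} αp αq (subst (k ≤_) (sym hpq) (<⇒≤ b))
            | ⊑?-take-beyond {k} αp αr (subst (_< k) (sym hpr) a) kp | ⊑?-take-beyond {k} αp αs (subst (_< k) (sym hps) (<-trans wv a)) kp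
            | ≢⇒≡ᵇ-length-take αp kp (<⇒≢ b) = refl

    b3C : classify (take u αp) ≡ cB3
    b3C = by-length (<⇒≤ up)
      where
      by-length : u ≤ length αp → classify (take u αp) ≡ cB3
      by-length kp rewrite ⊑?-take-self {u} αp | ⊑?-take-within {u} αp αq (≤-reflexive (sym hpq))
            | ⊑?-take-beyond {u} αp αr (subst (_< u) (sym hpr) vu) kp | ⊑?-take-beyond {u} αp αs (subst (_< u) (sym hps) wu) kp
            | ≡ᵇ-length-take {u} αp kp = refl

    legPC : ∀ {k} → u < k → k ≤ length αp → classify (take k αp) ≡ cLegP
    legPC {k} a kp rewrite ⊑?-take-self {k} αp | ⊑?-take-beyond {k} αp αq (subst (_< k) (sym hpq) a) kp
          | ⊑?-take-beyond {k} αp αr (subst (_< k) (sym hpr) (<-trans vu a)) kp | ⊑?-take-beyond {k} αp αs (subst (_< k) (sym hps) (<-trans wu a)) kp = refl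

    legQC : ∀ {k} → u < k → k ≤ length αq → classify (take k αq) ≡ cLegQ
    legQC {k} a kp rewrite ⊑?-take-beyond {k} αq αp (lcpLength-<-comm αp αq (subst (_< k) (sym hpq) a)) kp | ⊑?-take-self {k} αq
          | ⊑?-take-beyond {k} αq αr (subst (_< k) (sym hqr) (<-trans vu a)) kp | ⊑?-take-beyond {k} αq αs (subst (_< k) (sym hqs) (<-trans wu a)) kp = refl

    legRC : ∀ {k} → v < k → k ≤ length αr → classify (take k αr) ≡ cLegR
    legRC {k} a kp rewrite ⊑?-take-beyond {k} αr αp (lcpLength-<-comm αp αr (subst (_< k) (sym hpr) a)) kp
          | ⊑?-take-beyond {k} αr αq (lcpLength-<-comm αq αr (subst (_< k) (sym hqr) a)) kp | ⊑?-take-self {k} αr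
          | ⊑?-take-beyond {k} αr αs (subst (_< k) (sym hrs) (<-trans wv a)) kp = refl

    legSC : ∀ {k} → w < k → k ≤ length αs → classify (take k αs) ≡ cLegS
    legSC {k} a kp rewrite ⊑?-take-beyond {k} αs αp (lcpLength-<-comm αp αs (subst (_< k) (sym hps) a)) kp
          | ⊑?-take-beyond {k} αs αq (lcpLength-<-comm αq αs (subst (_< k) (sym hqs) a)) kp
          | ⊑?-take-beyond {k} αs αr (lcpLength-<-comm αr αs (subst (_< k) (sym hrs) a)) kp | ⊑?-take-self {k} αs = refl

-- The paths of a K₃,₃ subdivision are told apart, and kept off the branch vertices,
-- by a labelling of the vertices with the edge of K₃,₃ they subdivide.
module K33Labelling {V : Set} {Adj : V → V → Set}
  (branch : Fin 6 → V) (branch-injective : ∀ i j → branch i ≡ branch j → i ≡ j)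
  (path : Fin 3 → Fin 3 → List V)
  (walk : ∀ i j → Linked Adj (branch (sideA i) ∷ path i j ++ [ branch (sideB j) ]))
  (path-unique : ∀ i j → Unique (path i j))
  (label : V → Maybe (Fin 3 × Fin 3))
  (label-path : ∀ i j {v} → v ∈ path i j → label v ≡ just (i , j))
  (label-branch : ∀ k → label (branch k) ≡ nothing) where

  open import Data.Fin using (zero; suc)
  open import Data.List.Membership.Propositional.Properties using (∈-++⁻)
  open import Data.List.Relation.Unary.All as All using (tabulate)
  open import Data.List.Relation.Unary.AllPairs using ([]; _∷_)
  open import Data.List.Relation.Unary.Any using (here)
  open import Data.List.Relation.Unary.Unique.Propositional.Properties using (++⁺)

  open import Data.Sum using (inj₁; inj₂)
  open import Relation.Binary.PropositionalEquality using (_≢_; refl; sym; trans)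

  sideA≢sideB : ∀ i j → sideA i ≢ sideB j
  sideA≢sideB zero j ()
  sideA≢sideB (suc zero) j ()
  sideA≢sideB (suc (suc zero)) j ()

  path-avoids-branch : ∀ i j k {v} → v ∈ path i j → v ≢ branch k
  path-avoids-branch i j k m refl with trans (sym (label-path i j m)) (label-branch k)
  ... | ()

  paths-disjoint : ∀ i j i′ j′ v → v ∈ path i j → v ∈ path i′ j′ → i ≡ i′ × j ≡ j′
  paths-disjoint i j i′ j′ v m m′ with trans (sym (label-path i j m)) (label-path i′ j′ m′)
  ... | refl = refl , refl

  simple : ∀ i j → Unique (branch (sideA i) ∷ path i j ++ [ branch (sideB j) ])
  simple i j = tabulate fresh ∷ ++⁺ (path-unique i j) (All.[] ∷ []) λ { (m , here e) → path-avoids-branch i j (sideB j) m e }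
    where
    fresh : ∀ {v} → v ∈ path i j ++ [ branch (sideB j) ] → branch (sideA i) ≢ v
    fresh m e with ∈-++⁻ (path i j) m
    ... | inj₁ mp = path-avoids-branch i j (sideA i) mp (sym e)
    ... | inj₂ (here refl) = sideA≢sideB i j (branch-injective _ _ e)

  subdivision : K33Subdivision V Adj
  subdivision = record
    { branch = branch ; branch-inj = branch-injective ; path = path ; walk = walk ; simple = simple
    ; avoid = λ i j k _ → path-avoids-branch i j k ; disjoint = paths-disjoint }

module BalancedK33 {n : ℕ} (L R : Tree (Fin n)) (uL : Unique (leaves L)) (uR : Unique (leaves R))
  (allL : ∀ x → x ∈ leaves L) (allR : ∀ x → x ∈ leaves R) where

  open Address
  open LeafAddress
  open Segment
  open QuartetShape
  open LcaDepths L R uL uR allL allR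
  open TanglegramGraph L R uL uR allL allR
  open import Data.Nat using (suc; _≤_; _<_; _+_; _∸_)
  open import Data.Nat.Properties using (≤-trans; ≤-reflexive; <⇒≤; n≤1+n; <-trans)
  open import Data.Fin using (zero; suc)
  open import Data.List using (List; _∷_; _++_; [_]; take)
  open import Data.List.Membership.Propositional.Properties using (∈-++⁻)
  open import Data.Maybe using (Maybe; just; nothing)
  open import Data.Product using (Σ; _×_; _,_)
  open import Data.Sum using (_⊎_; inj₁; inj₂; [_,_]′)
  open import Relation.Binary.PropositionalEquality using (_≡_; _≢_; refl; sym; trans; cong; subst; subst₂; ≢-sym)

  module Embedding {a b c d} (a≢b : a ≢ b) (a≢c : a ≢ c) (a≢d : a ≢ d) (b≢c : b ≢ c) (b≢d : b ≢ d) (c≢d : c ≢ d)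
    (l₁ : hL a c < hL a b) (l₂ : hL a c < hL c d) (r₁ : hR a b < hR a c) (r₂ : hR a b < hR b d) where

    m u v m′ u′ v′ : ℕ
    m = hL a c
    u = hL a b
    v = hL c d
    m′ = hR a b
    u′ = hR a c
    v′ = hR b d

    hL-ad : hL a d ≡ m
    hL-ad = trans (hL-comm a d) (trans (OnL.h-yz<xy⇒xz≡yz (≢-sym c≢d) (≢-sym a≢d) (≢-sym a≢c)
              (subst₂ _<_ (hL-comm a c) (hL-comm c d) l₂)) (hL-comm c a))
    hL-bc : hL b c ≡ m
    hL-bc = OnL.h-yz<xy⇒xz≡yz (≢-sym a≢b) b≢c a≢c (subst (hL a c <_) (hL-comm a b) l₁)
    hL-bd : hL b d ≡ m
    hL-bd = trans (hL-comm b d) (trans (OnL.h-yz<xy⇒xz≡yz (≢-sym c≢d) (≢-sym b≢d) (≢-sym b≢c)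
              (subst₂ _<_ (trans (sym hL-bc) (hL-comm b c)) (hL-comm c d) l₂)) (trans (hL-comm c b) hL-bc))

    hR-ad : hR a d ≡ m′
    hR-ad = trans (hR-comm a d) (trans (OnR.h-yz<xy⇒xz≡yz (≢-sym b≢d) (≢-sym a≢d) (≢-sym a≢b)
              (subst₂ _<_ (hR-comm a b) (hR-comm b d) r₂)) (hR-comm b a))
    hR-cb : hR c b ≡ m′
    hR-cb = OnR.h-yz<xy⇒xz≡yz (≢-sym a≢c) (≢-sym b≢c) a≢b (subst (hR a b <_) (hR-comm a c) r₁)
    hR-cd : hR c d ≡ m′
    hR-cd = trans (hR-comm c d) (trans (OnR.h-yz<xy⇒xz≡yz (≢-sym b≢d) (≢-sym c≢d) b≢c
              (subst₂ _<_ (trans (sym hR-cb) (hR-comm c b)) (hR-comm b d) r₂)) (trans (hR-comm b c) hR-cb))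

    u<La : u < Left.len a
    u<La = Left.lca<len a≢b
    u<Lb : u < Left.len b
    u<Lb = subst (_< Left.len b) (hL-comm b a) (Left.lca<len (≢-sym a≢b))
    v<Lc : v < Left.len c
    v<Lc = Left.lca<len c≢d
    v<Ld : v < Left.len d
    v<Ld = subst (_< Left.len d) (hL-comm d c) (Left.lca<len (≢-sym c≢d))
    u′<Ra : u′ < Right.len a
    u′<Ra = Right.lca<len a≢c
    u′<Rc : u′ < Right.len c
    u′<Rc = subst (_< Right.len c) (hR-comm c a) (Right.lca<len (≢-sym a≢c))
    v′<Rb : v′ < Right.len b
    v′<Rb = Right.lca<len b≢d
    v′<Rd : v′ < Right.len d
    v′<Rd = subst (_< Right.len d) (hR-comm d b) (Right.lca<len (≢-sym b≢d))

    module BL = Balanced (addr L a) (addr L b) (addr L c) (addr L d) m u v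
                  refl hL-ad hL-bc hL-bd refl refl l₁ l₂ u<La u<Lb v<Lc v<Ld
    module BR = Balanced (addr R a) (addr R c) (addr R b) (addr R d) m′ u′ v′
                  refl hR-ad hR-cb hR-cd refl refl r₁ r₂ u′<Ra u′<Rc v′<Rb v′<Rd

    -- Side A: U = lca_L(a,b), V = lca_L(c,d), Z = lca_R(a,b,c,d); side B: W = lca_L(a,b,c,d),
    -- X = lca_R(a,c), Y = lca_R(b,d). Paths from L to R pass through a leaf and its matching edge,
    -- and Z–W uses the edge between the roots.
    branch : Fin 6 → V
    branch zero = Left.vertex a u
    branch (suc zero) = Left.vertex c v
    branch (suc (suc zero)) = Right.vertex a m′
    branch (suc (suc (suc zero))) = Left.vertex a m
    branch (suc (suc (suc (suc zero)))) = Right.vertex a u′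
    branch (suc (suc (suc (suc (suc zero))))) = Right.vertex b v′

    path : Fin 3 → Fin 3 → List V
    path zero zero = ascent (Left.vertex a) (suc m) (u ∸ suc m)
    path zero (suc zero) = descent (Left.vertex a) (suc u) (Left.len a ∸ u) ++ ascent (Right.vertex a) (suc u′) (Right.len a ∸ u′)
    path zero (suc (suc zero)) = descent (Left.vertex b) (suc u) (Left.len b ∸ u) ++ ascent (Right.vertex b) (suc v′) (Right.len b ∸ v′)
    path (suc zero) zero = ascent (Left.vertex c) (suc m) (v ∸ suc m)
    path (suc zero) (suc zero) = descent (Left.vertex c) (suc v) (Left.len c ∸ v) ++ ascent (Right.vertex c) (suc u′) (Right.len c ∸ u′)
    path (suc zero) (suc (suc zero)) = descent (Left.vertex d) (suc v) (Left.len d ∸ v) ++ ascent (Right.vertex d) (suc v′) (Right.len d ∸ v′)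
    path (suc (suc zero)) zero = ascent (Right.vertex a) 0 m′ ++ descent (Left.vertex a) 0 m
    path (suc (suc zero)) (suc zero) = descent (Right.vertex a) (suc m′) (u′ ∸ suc m′)
    path (suc (suc zero)) (suc (suc zero)) = descent (Right.vertex b) (suc m′) (v′ ∸ suc m′)

    walk : ∀ i j → Walk (branch (sideA i) ∷ path i j ++ [ branch (sideB j) ])
    walk zero zero = walk-up (Left.chain a) u m l₁ (<⇒≤ u<La)
    walk zero (suc zero) = walk-across (Left.chain a) (Right.chain a) (matching-LR a) u u′ (<⇒≤ u<La) u′<Ra
    walk zero (suc (suc zero)) = subst (λ z → Walk (z ∷ path zero (suc (suc zero)) ++ [ branch (sideB (suc (suc zero))) ]))
      (Left.vertex-shared {b} {a} {u} (≤-reflexive (hL-comm a b)))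
      (walk-across (Left.chain b) (Right.chain b) (matching-LR b) u v′ (<⇒≤ u<Lb) v′<Rb)
    walk (suc zero) zero = subst (λ z → Walk (branch (sideA (suc zero)) ∷ path (suc zero) zero ++ [ z ]))
      (Left.vertex-shared {c} {a} {m} (≤-reflexive (hL-comm a c)))
      (walk-up (Left.chain c) v m l₂ (<⇒≤ v<Lc))
    walk (suc zero) (suc zero) = subst (λ z → Walk (branch (sideA (suc zero)) ∷ path (suc zero) (suc zero) ++ [ z ]))
      (Right.vertex-shared {c} {a} {u′} (≤-reflexive (hR-comm a c)))
      (walk-across (Left.chain c) (Right.chain c) (matching-LR c) v u′ (<⇒≤ v<Lc) u′<Rc)
    walk (suc zero) (suc (suc zero)) = subst₂ (λ y z → Walk (y ∷ path (suc zero) (suc (suc zero)) ++ [ z ]))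
      (Left.vertex-shared {d} {c} {v} (≤-reflexive (hL-comm c d))) (Right.vertex-shared {d} {b} {v′} (≤-reflexive (hR-comm b d)))
      (walk-across (Left.chain d) (Right.chain d) (matching-LR d) v v′ (<⇒≤ v<Ld) v′<Rd)
    walk (suc (suc zero)) zero =
      walk-over-tops (Right.chain a) (Left.chain a) (roots-RL a a) m′ m (<⇒≤ (<-trans r₁ u′<Ra)) (<⇒≤ (<-trans l₁ u<La))
    walk (suc (suc zero)) (suc zero) = walk-down (Right.chain a) m′ u′ r₁ (<⇒≤ u′<Ra)
    walk (suc (suc zero)) (suc (suc zero)) = subst (λ z → Walk (z ∷ path (suc (suc zero)) (suc (suc zero)) ++ [ branch (sideB (suc (suc zero))) ]))
      (Right.vertex-shared {b} {a} {m′} (≤-reflexive (hR-comm a b)))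
      (walk-down (Right.chain b) m′ v′ r₂ (<⇒≤ v′<Rb))

    path-unique : ∀ i j → Unique (path i j)
    path-unique zero zero = Left.ascent-unique-on a (suc m) (u ∸ suc m) (inner-bound l₁ (<⇒≤ u<La))
    path-unique zero (suc zero) = unique-across
      (Left.descent-unique-on a (suc u) (Left.len a ∸ u) (tail-bound (<⇒≤ u<La)))
      (Right.ascent-unique-on a (suc u′) (Right.len a ∸ u′) (tail-bound (<⇒≤ u′<Ra))) Left.descent-on-side Right.ascent-on-side
    path-unique zero (suc (suc zero)) = unique-across
      (Left.descent-unique-on b (suc u) (Left.len b ∸ u) (tail-bound (<⇒≤ u<Lb)))
      (Right.ascent-unique-on b (suc v′) (Right.len b ∸ v′) (tail-bound (<⇒≤ v′<Rb))) Left.descent-on-side Right.ascent-on-side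
    path-unique (suc zero) zero = Left.ascent-unique-on c (suc m) (v ∸ suc m) (inner-bound l₂ (<⇒≤ v<Lc))
    path-unique (suc zero) (suc zero) = unique-across
      (Left.descent-unique-on c (suc v) (Left.len c ∸ v) (tail-bound (<⇒≤ v<Lc)))
      (Right.ascent-unique-on c (suc u′) (Right.len c ∸ u′) (tail-bound (<⇒≤ u′<Rc))) Left.descent-on-side Right.ascent-on-side
    path-unique (suc zero) (suc (suc zero)) = unique-across
      (Left.descent-unique-on d (suc v) (Left.len d ∸ v) (tail-bound (<⇒≤ v<Ld)))
      (Right.ascent-unique-on d (suc v′) (Right.len d ∸ v′) (tail-bound (<⇒≤ v′<Rd))) Left.descent-on-side Right.ascent-on-side
    path-unique (suc (suc zero)) zero = unique-across′
      (Right.ascent-unique-on a 0 m′ (≤-trans (<⇒≤ (<-trans r₁ u′<Ra)) (n≤1+n _)))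
      (Left.descent-unique-on a 0 m (≤-trans (<⇒≤ (<-trans l₁ u<La)) (n≤1+n _))) Right.ascent-on-side Left.descent-on-side
    path-unique (suc (suc zero)) (suc zero) = Right.descent-unique-on a (suc m′) (u′ ∸ suc m′) (inner-bound r₁ (<⇒≤ u′<Ra))
    path-unique (suc (suc zero)) (suc (suc zero)) = Right.descent-unique-on b (suc m′) (v′ ∸ suc m′) (inner-bound r₂ (<⇒≤ v′<Rb))

    onL : BalancedPart → Maybe (Fin 3 × Fin 3)
    onL bInPQ = just (zero , zero)
    onL bLegP = just (zero , suc zero)
    onL bLegQ = just (zero , suc (suc zero))
    onL bInRS = just (suc zero , zero)
    onL bLegR = just (suc zero , suc zero)
    onL bLegS = just (suc zero , suc (suc zero))
    onL bStem = just (suc (suc zero) , zero)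
    onL _ = nothing

    onR : BalancedPart → Maybe (Fin 3 × Fin 3)
    onR bLegP = just (zero , suc zero)
    onR bLegR = just (zero , suc (suc zero))
    onR bLegQ = just (suc zero , suc zero)
    onR bLegS = just (suc zero , suc (suc zero))
    onR bStem = just (suc (suc zero) , zero)
    onR bInPQ = just (suc (suc zero) , suc zero)
    onR bInRS = just (suc (suc zero) , suc (suc zero))
    onR _ = nothing

    label : V → Maybe (Fin 3 × Fin 3)
    label (inj₁ p) = onL (BL.classify (posAddress p))
    label (inj₂ q) = onR (BR.classify (posAddress q))

    label-left : ∀ x k → label (Left.vertex x k) ≡ onL (BL.classify (take k (addr L x)))
    label-left x k = cong (λ σ → onL (BL.classify σ)) (Left.posAddress-vertex x k)

    label-right : ∀ x k → label (Right.vertex x k) ≡ onR (BR.classify (take k (addr R x)))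
    label-right x k = cong (λ σ → onR (BR.classify σ)) (Right.posAddress-vertex x k)

    on-descent : ∀ {i j} f {e d} → (∀ {k} → e ≤ k → k < e + d → label (f k) ≡ just (i , j)) →
                 ∀ {v} → v ∈ descent f e d → label v ≡ just (i , j)
    on-descent f = descent-all f

    on-ascent : ∀ {i j} f {e d} → (∀ {k} → e ≤ k → k < e + d → label (f k) ≡ just (i , j)) →
                ∀ {v} → v ∈ ascent f e d → label v ≡ just (i , j)
    on-ascent f = ascent-all f

    label-path : ∀ i j {v} → v ∈ path i j → label v ≡ just (i , j)
    label-path zero zero = on-ascent _ λ {k} p q →
      let (x , y) = range-inner p q l₁ in trans (label-left a k) (cong onL (BL.inPQL x y))
    label-path zero (suc zero) m = [ on-descent _ (λ {k} p q →
        let (x , y) = range-tail p q (<⇒≤ u<La) in trans (label-left a k) (cong onL (BL.legPL x y)))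
      , on-ascent _ (λ {k} p q →
        let (x , y) = range-tail p q (<⇒≤ u′<Ra) in trans (label-right a k) (cong onR (BR.legPL x y))) ]′ (∈-++⁻ (descent (Left.vertex a) (suc u) (Left.len a ∸ u)) m)
    label-path zero (suc (suc zero)) m = [ on-descent _ (λ {k} p q →
        let (x , y) = range-tail p q (<⇒≤ u<Lb) in trans (label-left b k) (cong onL (BL.legQL x y)))
      , on-ascent _ (λ {k} p q →
        let (x , y) = range-tail p q (<⇒≤ v′<Rb) in trans (label-right b k) (cong onR (BR.legRL x y))) ]′ (∈-++⁻ (descent (Left.vertex b) (suc u) (Left.len b ∸ u)) m)
    label-path (suc zero) zero = on-ascent _ λ {k} p q →
      let (x , y) = range-inner p q l₂ in trans (label-left c k) (cong onL (BL.inRSL x y))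
    label-path (suc zero) (suc zero) m = [ on-descent _ (λ {k} p q →
        let (x , y) = range-tail p q (<⇒≤ v<Lc) in trans (label-left c k) (cong onL (BL.legRL x y)))
      , on-ascent _ (λ {k} p q →
        let (x , y) = range-tail p q (<⇒≤ u′<Rc) in trans (label-right c k) (cong onR (BR.legQL x y))) ]′ (∈-++⁻ (descent (Left.vertex c) (suc v) (Left.len c ∸ v)) m)
    label-path (suc zero) (suc (suc zero)) m = [ on-descent _ (λ {k} p q →
        let (x , y) = range-tail p q (<⇒≤ v<Ld) in trans (label-left d k) (cong onL (BL.legSL x y)))
      , on-ascent _ (λ {k} p q →
        let (x , y) = range-tail p q (<⇒≤ v′<Rd) in trans (label-right d k) (cong onR (BR.legSL x y))) ]′ (∈-++⁻ (descent (Left.vertex d) (suc v) (Left.len d ∸ v)) m)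
    label-path (suc (suc zero)) zero m = [ on-ascent _ (λ {k} _ q → trans (label-right a k) (cong onR (BR.stemL q)))
      , on-descent _ (λ {k} _ q → trans (label-left a k) (cong onL (BL.stemL q))) ]′ (∈-++⁻ (ascent (Right.vertex a) 0 m′) m)
    label-path (suc (suc zero)) (suc zero) = on-descent _ λ {k} p q →
      let (x , y) = range-inner p q r₁ in trans (label-right a k) (cong onR (BR.inPQL x y))
    label-path (suc (suc zero)) (suc (suc zero)) = on-descent _ λ {k} p q →
      let (x , y) = range-inner p q r₂ in trans (label-right b k) (cong onR (BR.inRSL x y))

    label-branch : ∀ k → label (branch k) ≡ nothing
    label-branch zero = trans (label-left a u) (cong onL BL.pqL)
    label-branch (suc zero) = trans (label-left c v) (cong onL BL.rsL)
    label-branch (suc (suc zero)) = trans (label-right a m′) (cong onR BR.rootL)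
    label-branch (suc (suc (suc zero))) = trans (label-left a m) (cong onL BL.rootL)
    label-branch (suc (suc (suc (suc zero)))) = trans (label-right a u′) (cong onR BR.pqL)
    label-branch (suc (suc (suc (suc (suc zero))))) = trans (label-right b v′) (cong onR BR.rsL)

    part : V → BalancedPart ⊎ BalancedPart
    part (inj₁ p) = inj₁ (BL.classify (posAddress p))
    part (inj₂ q) = inj₂ (BR.classify (posAddress q))

    branch-index : BalancedPart ⊎ BalancedPart → Fin 6
    branch-index (inj₁ bPQ) = zero
    branch-index (inj₁ bRS) = suc zero
    branch-index (inj₂ bRoot) = suc (suc zero)
    branch-index (inj₁ bRoot) = suc (suc (suc zero))
    branch-index (inj₂ bPQ) = suc (suc (suc (suc zero)))
    branch-index (inj₂ bRS) = suc (suc (suc (suc (suc zero))))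
    branch-index _ = zero

    branch-index-branch : ∀ k → branch-index (part (branch k)) ≡ k
    branch-index-branch zero = cong branch-index (cong inj₁ (trans (cong BL.classify (Left.posAddress-vertex a u)) BL.pqL))
    branch-index-branch (suc zero) = cong branch-index (cong inj₁ (trans (cong BL.classify (Left.posAddress-vertex c v)) BL.rsL))
    branch-index-branch (suc (suc zero)) = cong branch-index (cong inj₂ (trans (cong BR.classify (Right.posAddress-vertex a m′)) BR.rootL))
    branch-index-branch (suc (suc (suc zero))) = cong branch-index (cong inj₁ (trans (cong BL.classify (Left.posAddress-vertex a m)) BL.rootL))
    branch-index-branch (suc (suc (suc (suc zero)))) = cong branch-index (cong inj₂ (trans (cong BR.classify (Right.posAddress-vertex a u′)) BR.pqL))
    branch-index-branch (suc (suc (suc (suc (suc zero))))) = cong branch-index (cong inj₂ (trans (cong BR.classify (Right.posAddress-vertex b v′)) BR.rsL))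

    branch-injective : ∀ i j → branch i ≡ branch j → i ≡ j
    branch-injective i j e = trans (sym (branch-index-branch i)) (trans (cong (λ z → branch-index (part z)) e) (branch-index-branch j))

  balanced-k33 : ∀ {a b c d} → BalancedQuartet a b c d → Σ (K33Subdivision V Adj) λ S → branchesInL S ≡ 3
  balanced-k33 ((a≢b , a≢c , a≢d , b≢c , b≢d , c≢d) , l₁ , l₂ , r₁ , r₂) = subdivision , refl
    where
    open Embedding a≢b a≢c a≢d b≢c b≢d c≢d l₁ l₂ r₁ r₂
    open K33Labelling branch branch-injective path walk path-unique label label-path label-branch

module CaterpillarK33 {n : ℕ} (L R : Tree (Fin n)) (uL : Unique (leaves L)) (uR : Unique (leaves R))
  (allL : ∀ x → x ∈ leaves L) (allR : ∀ x → x ∈ leaves R) where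

  open Address
  open LeafAddress
  open Segment
  open QuartetShape
  open LcaDepths L R uL uR allL allR
  open TanglegramGraph L R uL uR allL allR
  open import Data.Nat using (suc; _≤_; _<_; _+_; _∸_)
  open import Data.Nat.Properties using (≤-trans; ≤-reflexive; <⇒≤; n≤1+n; <-trans)
  open import Data.Fin using (zero; suc)
  open import Data.List using (List; _∷_; _++_; [_]; take)
  open import Data.List.Membership.Propositional.Properties using (∈-++⁻)
  open import Data.Maybe using (Maybe; just; nothing)
  open import Data.Product using (Σ; _×_; _,_)
  open import Data.Sum using (_⊎_; inj₁; inj₂; [_,_]′)
  open import Relation.Binary.PropositionalEquality using (_≡_; _≢_; refl; sym; trans; cong; subst; subst₂; ≢-sym)

  module Embedding {a b c d} (a≢b : a ≢ b) (a≢c : a ≢ c) (a≢d : a ≢ d) (b≢c : b ≢ c) (b≢d : b ≢ d) (c≢d : c ≢ d)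
    (l₁ : hL a c < hL a b) (l₂ : hL a d < hL a c) (r₁ : hR a c < hR a d) (r₂ : hR a b < hR a c) where

    u v w u′ v′ w′ : ℕ
    u = hL a b
    v = hL a c
    w = hL a d
    u′ = hR a d
    v′ = hR a c
    w′ = hR a b

    hL-bc : hL b c ≡ v
    hL-bc = OnL.h-yz<xy⇒xz≡yz (≢-sym a≢b) b≢c a≢c (subst (hL a c <_) (hL-comm a b) l₁)
    hL-bd : hL b d ≡ w
    hL-bd = OnL.h-yz<xy⇒xz≡yz (≢-sym a≢b) b≢d a≢d (subst (hL a d <_) (hL-comm a b) (<-trans l₂ l₁))
    hL-cd : hL c d ≡ w
    hL-cd = OnL.h-yz<xy⇒xz≡yz (≢-sym a≢c) c≢d a≢d (subst (hL a d <_) (hL-comm a c) l₂)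

    hR-dc : hR d c ≡ v′
    hR-dc = OnR.h-yz<xy⇒xz≡yz (≢-sym a≢d) (≢-sym c≢d) a≢c (subst (hR a c <_) (hR-comm a d) r₁)
    hR-db : hR d b ≡ w′
    hR-db = OnR.h-yz<xy⇒xz≡yz (≢-sym a≢d) (≢-sym b≢d) a≢b (subst (hR a b <_) (hR-comm a d) (<-trans r₂ r₁))
    hR-cb : hR c b ≡ w′
    hR-cb = OnR.h-yz<xy⇒xz≡yz (≢-sym a≢c) (≢-sym b≢c) a≢b (subst (hR a b <_) (hR-comm a c) r₂)

    u<La : u < Left.len a
    u<La = Left.lca<len a≢b
    u<Lb : u < Left.len b
    u<Lb = subst (_< Left.len b) (hL-comm b a) (Left.lca<len (≢-sym a≢b))
    v<Lc : v < Left.len c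
    v<Lc = subst (_< Left.len c) (hL-comm c a) (Left.lca<len (≢-sym a≢c))
    w<Ld : w < Left.len d
    w<Ld = subst (_< Left.len d) (hL-comm d a) (Left.lca<len (≢-sym a≢d))
    u′<Ra : u′ < Right.len a
    u′<Ra = Right.lca<len a≢d
    u′<Rd : u′ < Right.len d
    u′<Rd = subst (_< Right.len d) (hR-comm d a) (Right.lca<len (≢-sym a≢d))
    v′<Rc : v′ < Right.len c
    v′<Rc = subst (_< Right.len c) (hR-comm c a) (Right.lca<len (≢-sym a≢c))
    w′<Rb : w′ < Right.len b
    w′<Rb = subst (_< Right.len b) (hR-comm b a) (Right.lca<len (≢-sym a≢b))

    v≤La : v ≤ Left.len a
    v≤La = <⇒≤ (<-trans l₁ u<La)
    w≤La : w ≤ Left.len a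
    w≤La = <⇒≤ (<-trans l₂ (<-trans l₁ u<La))
    v′≤Ra : v′ ≤ Right.len a
    v′≤Ra = <⇒≤ (<-trans r₁ u′<Ra)
    w′≤Ra : w′ ≤ Right.len a
    w′≤Ra = <⇒≤ (<-trans r₂ (<-trans r₁ u′<Ra))

    module CL = Caterpillar (addr L a) (addr L b) (addr L c) (addr L d) w v u
                  refl refl hL-bc refl hL-bd hL-cd l₂ l₁ u<La u<Lb v<Lc w<Ld
    module CR = Caterpillar (addr R a) (addr R d) (addr R c) (addr R b) w′ v′ u′
                  refl refl hR-dc refl hR-db hR-cb r₂ r₁ u′<Ra u′<Rd v′<Rc w′<Rb

    -- Side A: U = lca_L(a,b), W = lca_L(a,b,c,d), Y = lca_R(a,c,d); side B: V = lca_L(a,b,c),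
    -- X = lca_R(a,d), Z = lca_R(a,b,c,d). Paths between L and R pass through a leaf and its
    -- matching edge, except W–Z, which uses the edge between the roots.
    branch : Fin 6 → V
    branch zero = Left.vertex a u
    branch (suc zero) = Left.vertex a w
    branch (suc (suc zero)) = Right.vertex a v′
    branch (suc (suc (suc zero))) = Left.vertex a v
    branch (suc (suc (suc (suc zero)))) = Right.vertex a u′
    branch (suc (suc (suc (suc (suc zero))))) = Right.vertex a w′

    path : Fin 3 → Fin 3 → List V
    path zero zero = ascent (Left.vertex a) (suc v) (u ∸ suc v)
    path zero (suc zero) = descent (Left.vertex a) (suc u) (Left.len a ∸ u) ++ ascent (Right.vertex a) (suc u′) (Right.len a ∸ u′)
    path zero (suc (suc zero)) = descent (Left.vertex b) (suc u) (Left.len b ∸ u) ++ ascent (Right.vertex b) (suc w′) (Right.len b ∸ w′)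
    path (suc zero) zero = descent (Left.vertex a) (suc w) (v ∸ suc w)
    path (suc zero) (suc zero) = descent (Left.vertex d) (suc w) (Left.len d ∸ w) ++ ascent (Right.vertex d) (suc u′) (Right.len d ∸ u′)
    path (suc zero) (suc (suc zero)) = ascent (Left.vertex a) 0 w ++ descent (Right.vertex a) 0 w′
    path (suc (suc zero)) zero = descent (Right.vertex c) (suc v′) (Right.len c ∸ v′) ++ ascent (Left.vertex c) (suc v) (Left.len c ∸ v)
    path (suc (suc zero)) (suc zero) = descent (Right.vertex a) (suc v′) (u′ ∸ suc v′)
    path (suc (suc zero)) (suc (suc zero)) = ascent (Right.vertex a) (suc w′) (v′ ∸ suc w′)

    walk : ∀ i j → Walk (branch (sideA i) ∷ path i j ++ [ branch (sideB j) ])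
    walk zero zero = walk-up (Left.chain a) u v l₁ (<⇒≤ u<La)
    walk zero (suc zero) = walk-across (Left.chain a) (Right.chain a) (matching-LR a) u u′ (<⇒≤ u<La) u′<Ra
    walk zero (suc (suc zero)) = subst₂ (λ y z → Walk (y ∷ path zero (suc (suc zero)) ++ [ z ]))
      (Left.vertex-shared {b} {a} {u} (≤-reflexive (hL-comm a b))) (Right.vertex-shared {b} {a} {w′} (≤-reflexive (hR-comm a b)))
      (walk-across (Left.chain b) (Right.chain b) (matching-LR b) u w′ (<⇒≤ u<Lb) w′<Rb)
    walk (suc zero) zero = walk-down (Left.chain a) w v l₂ v≤La
    walk (suc zero) (suc zero) = subst₂ (λ y z → Walk (y ∷ path (suc zero) (suc zero) ++ [ z ]))
      (Left.vertex-shared {d} {a} {w} (≤-reflexive (hL-comm a d))) (Right.vertex-shared {d} {a} {u′} (≤-reflexive (hR-comm a d)))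
      (walk-across (Left.chain d) (Right.chain d) (matching-LR d) w u′ (<⇒≤ w<Ld) u′<Rd)
    walk (suc zero) (suc (suc zero)) = walk-over-tops (Left.chain a) (Right.chain a) (roots-LR a a) w w′ w≤La w′≤Ra
    walk (suc (suc zero)) zero = subst₂ (λ y z → Walk (y ∷ path (suc (suc zero)) zero ++ [ z ]))
      (Right.vertex-shared {c} {a} {v′} (≤-reflexive (hR-comm a c))) (Left.vertex-shared {c} {a} {v} (≤-reflexive (hL-comm a c)))
      (walk-across (Right.chain c) (Left.chain c) (matching-RL c) v′ v (<⇒≤ v′<Rc) v<Lc)
    walk (suc (suc zero)) (suc zero) = walk-down (Right.chain a) v′ u′ r₁ (<⇒≤ u′<Ra)
    walk (suc (suc zero)) (suc (suc zero)) = walk-up (Right.chain a) v′ w′ r₂ v′≤Ra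

    path-unique : ∀ i j → Unique (path i j)
    path-unique zero zero = Left.ascent-unique-on a (suc v) (u ∸ suc v) (inner-bound l₁ (<⇒≤ u<La))
    path-unique zero (suc zero) = unique-across
      (Left.descent-unique-on a (suc u) (Left.len a ∸ u) (tail-bound (<⇒≤ u<La)))
      (Right.ascent-unique-on a (suc u′) (Right.len a ∸ u′) (tail-bound (<⇒≤ u′<Ra))) Left.descent-on-side Right.ascent-on-side
    path-unique zero (suc (suc zero)) = unique-across
      (Left.descent-unique-on b (suc u) (Left.len b ∸ u) (tail-bound (<⇒≤ u<Lb)))
      (Right.ascent-unique-on b (suc w′) (Right.len b ∸ w′) (tail-bound (<⇒≤ w′<Rb))) Left.descent-on-side Right.ascent-on-side
    path-unique (suc zero) zero = Left.descent-unique-on a (suc w) (v ∸ suc w) (inner-bound l₂ v≤La)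
    path-unique (suc zero) (suc zero) = unique-across
      (Left.descent-unique-on d (suc w) (Left.len d ∸ w) (tail-bound (<⇒≤ w<Ld)))
      (Right.ascent-unique-on d (suc u′) (Right.len d ∸ u′) (tail-bound (<⇒≤ u′<Rd))) Left.descent-on-side Right.ascent-on-side
    path-unique (suc zero) (suc (suc zero)) = unique-across
      (Left.ascent-unique-on a 0 w (≤-trans w≤La (n≤1+n _)))
      (Right.descent-unique-on a 0 w′ (≤-trans w′≤Ra (n≤1+n _))) Left.ascent-on-side Right.descent-on-side
    path-unique (suc (suc zero)) zero = unique-across′
      (Right.descent-unique-on c (suc v′) (Right.len c ∸ v′) (tail-bound (<⇒≤ v′<Rc)))
      (Left.ascent-unique-on c (suc v) (Left.len c ∸ v) (tail-bound (<⇒≤ v<Lc))) Right.descent-on-side Left.ascent-on-side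
    path-unique (suc (suc zero)) (suc zero) = Right.descent-unique-on a (suc v′) (u′ ∸ suc v′) (inner-bound r₁ (<⇒≤ u′<Ra))
    path-unique (suc (suc zero)) (suc (suc zero)) = Right.ascent-unique-on a (suc w′) (v′ ∸ suc w′) (inner-bound r₂ v′≤Ra)

    onL : CaterpillarPart → Maybe (Fin 3 × Fin 3)
    onL cIn2 = just (zero , zero)
    onL cLegP = just (zero , suc zero)
    onL cLegQ = just (zero , suc (suc zero))
    onL cIn1 = just (suc zero , zero)
    onL cLegS = just (suc zero , suc zero)
    onL cStem = just (suc zero , suc (suc zero))
    onL cLegR = just (suc (suc zero) , zero)
    onL _ = nothing

    onR : CaterpillarPart → Maybe (Fin 3 × Fin 3)
    onR cLegP = just (zero , suc zero)
    onR cLegS = just (zero , suc (suc zero))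
    onR cLegQ = just (suc zero , suc zero)
    onR cStem = just (suc zero , suc (suc zero))
    onR cLegR = just (suc (suc zero) , zero)
    onR cIn2 = just (suc (suc zero) , suc zero)
    onR cIn1 = just (suc (suc zero) , suc (suc zero))
    onR _ = nothing

    label : V → Maybe (Fin 3 × Fin 3)
    label (inj₁ p) = onL (CL.classify (posAddress p))
    label (inj₂ q) = onR (CR.classify (posAddress q))

    label-left : ∀ x k → label (Left.vertex x k) ≡ onL (CL.classify (take k (addr L x)))
    label-left x k = cong (λ σ → onL (CL.classify σ)) (Left.posAddress-vertex x k)

    label-right : ∀ x k → label (Right.vertex x k) ≡ onR (CR.classify (take k (addr R x)))
    label-right x k = cong (λ σ → onR (CR.classify σ)) (Right.posAddress-vertex x k)

    on-descent : ∀ {i j} f {e d} → (∀ {k} → e ≤ k → k < e + d → label (f k) ≡ just (i , j)) →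
                 ∀ {v} → v ∈ descent f e d → label v ≡ just (i , j)
    on-descent f = descent-all f

    on-ascent : ∀ {i j} f {e d} → (∀ {k} → e ≤ k → k < e + d → label (f k) ≡ just (i , j)) →
                ∀ {v} → v ∈ ascent f e d → label v ≡ just (i , j)
    on-ascent f = ascent-all f

    label-path : ∀ i j {v} → v ∈ path i j → label v ≡ just (i , j)
    label-path zero zero = on-ascent _ λ {k} p q →
      let (x , y) = range-inner p q l₁ in trans (label-left a k) (cong onL (CL.in2C x y))
    label-path zero (suc zero) m = [ on-descent _ (λ {k} p q →
        let (x , y) = range-tail p q (<⇒≤ u<La) in trans (label-left a k) (cong onL (CL.legPC x y)))
      , on-ascent _ (λ {k} p q →
        let (x , y) = range-tail p q (<⇒≤ u′<Ra) in trans (label-right a k) (cong onR (CR.legPC x y))) ]′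
      (∈-++⁻ (descent (Left.vertex a) (suc u) (Left.len a ∸ u)) m)
    label-path zero (suc (suc zero)) m = [ on-descent _ (λ {k} p q →
        let (x , y) = range-tail p q (<⇒≤ u<Lb) in trans (label-left b k) (cong onL (CL.legQC x y)))
      , on-ascent _ (λ {k} p q →
        let (x , y) = range-tail p q (<⇒≤ w′<Rb) in trans (label-right b k) (cong onR (CR.legSC x y))) ]′
      (∈-++⁻ (descent (Left.vertex b) (suc u) (Left.len b ∸ u)) m)
    label-path (suc zero) zero = on-descent _ λ {k} p q →
      let (x , y) = range-inner p q l₂ in trans (label-left a k) (cong onL (CL.in1C x y))
    label-path (suc zero) (suc zero) m = [ on-descent _ (λ {k} p q →
        let (x , y) = range-tail p q (<⇒≤ w<Ld) in trans (label-left d k) (cong onL (CL.legSC x y)))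
      , on-ascent _ (λ {k} p q →
        let (x , y) = range-tail p q (<⇒≤ u′<Rd) in trans (label-right d k) (cong onR (CR.legQC x y))) ]′
      (∈-++⁻ (descent (Left.vertex d) (suc w) (Left.len d ∸ w)) m)
    label-path (suc zero) (suc (suc zero)) m = [ on-ascent _ (λ {k} _ q → trans (label-left a k) (cong onL (CL.stemC q)))
      , on-descent _ (λ {k} _ q → trans (label-right a k) (cong onR (CR.stemC q))) ]′
      (∈-++⁻ (ascent (Left.vertex a) 0 w) m)
    label-path (suc (suc zero)) zero m = [ on-descent _ (λ {k} p q →
        let (x , y) = range-tail p q (<⇒≤ v′<Rc) in trans (label-right c k) (cong onR (CR.legRC x y)))
      , on-ascent _ (λ {k} p q →
        let (x , y) = range-tail p q (<⇒≤ v<Lc) in trans (label-left c k) (cong onL (CL.legRC x y))) ]′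
      (∈-++⁻ (descent (Right.vertex c) (suc v′) (Right.len c ∸ v′)) m)
    label-path (suc (suc zero)) (suc zero) = on-descent _ λ {k} p q →
      let (x , y) = range-inner p q r₁ in trans (label-right a k) (cong onR (CR.in2C x y))
    label-path (suc (suc zero)) (suc (suc zero)) = on-ascent _ λ {k} p q →
      let (x , y) = range-inner p q r₂ in trans (label-right a k) (cong onR (CR.in1C x y))

    label-branch : ∀ k → label (branch k) ≡ nothing
    label-branch zero = trans (label-left a u) (cong onL CL.b3C)
    label-branch (suc zero) = trans (label-left a w) (cong onL CL.rootC)
    label-branch (suc (suc zero)) = trans (label-right a v′) (cong onR CR.b2C)
    label-branch (suc (suc (suc zero))) = trans (label-left a v) (cong onL CL.b2C)
    label-branch (suc (suc (suc (suc zero)))) = trans (label-right a u′) (cong onR CR.b3C)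
    label-branch (suc (suc (suc (suc (suc zero))))) = trans (label-right a w′) (cong onR CR.rootC)

    part : V → CaterpillarPart ⊎ CaterpillarPart
    part (inj₁ p) = inj₁ (CL.classify (posAddress p))
    part (inj₂ q) = inj₂ (CR.classify (posAddress q))

    branch-index : CaterpillarPart ⊎ CaterpillarPart → Fin 6
    branch-index (inj₁ cB3) = zero
    branch-index (inj₁ cRoot) = suc zero
    branch-index (inj₂ cB2) = suc (suc zero)
    branch-index (inj₁ cB2) = suc (suc (suc zero))
    branch-index (inj₂ cB3) = suc (suc (suc (suc zero)))
    branch-index (inj₂ cRoot) = suc (suc (suc (suc (suc zero))))
    branch-index _ = zero

    branch-index-branch : ∀ k → branch-index (part (branch k)) ≡ k
    branch-index-branch zero = cong branch-index (cong inj₁ (trans (cong CL.classify (Left.posAddress-vertex a u)) CL.b3C))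
    branch-index-branch (suc zero) = cong branch-index (cong inj₁ (trans (cong CL.classify (Left.posAddress-vertex a w)) CL.rootC))
    branch-index-branch (suc (suc zero)) = cong branch-index (cong inj₂ (trans (cong CR.classify (Right.posAddress-vertex a v′)) CR.b2C))
    branch-index-branch (suc (suc (suc zero))) = cong branch-index (cong inj₁ (trans (cong CL.classify (Left.posAddress-vertex a v)) CL.b2C))
    branch-index-branch (suc (suc (suc (suc zero)))) = cong branch-index (cong inj₂ (trans (cong CR.classify (Right.posAddress-vertex a u′)) CR.b3C))
    branch-index-branch (suc (suc (suc (suc (suc zero))))) = cong branch-index (cong inj₂ (trans (cong CR.classify (Right.posAddress-vertex a w′)) CR.rootC))

    branch-injective : ∀ i j → branch i ≡ branch j → i ≡ j
    branch-injective i j e = trans (sym (branch-index-branch i)) (trans (cong (λ z → branch-index (part z)) e) (branch-index-branch j))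

  caterpillar-k33 : ∀ {a b c d} → CaterpillarQuartet a b c d → Σ (K33Subdivision V Adj) λ S → branchesInL S ≡ 3
  caterpillar-k33 ((a≢b , a≢c , a≢d , b≢c , b≢d , c≢d) , l₁ , l₂ , r₁ , r₂) = subdivision , refl
    where
    open Embedding a≢b a≢c a≢d b≢c b≢d c≢d l₁ l₂ r₁ r₂
    open K33Labelling branch branch-injective path walk path-unique label label-path label-branch

open LeafAddress using (Unique-↭)

↭allFin⇒Unique : ∀ {n} {xs : List (Fin n)} → xs ↭ allFin n → Unique xs
↭allFin⇒Unique {n} p = Unique-↭ (↭-sym p) (allFin⁺ n)

↭allFin⇒∈ : ∀ {n} {xs : List (Fin n)} → xs ↭ allFin n → ∀ x → x ∈ xs
↭allFin⇒∈ p x = ∈-resp-↭ (↭-sym p) (∈-allFin x)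

corollary3 : (n : ℕ) (L R : Tree (Fin n)) → Labelled n L → Labelled n R →
    ¬ Planar L R →
    Σ (K33Subdivision (TV L R) (TAdj L R)) (λ S → branchesInL S ≡ 3)
corollary3 n L R labL labR nonPlanar = k33 nonPlanarQuartet?
  where
  uL : Unique (leaves L)
  uL = ↭allFin⇒Unique labL
  uR : Unique (leaves R)
  uR = ↭allFin⇒Unique labR
  allL : ∀ x → x ∈ leaves L
  allL = ↭allFin⇒∈ labL
  allR : ∀ x → x ∈ leaves R
  allR = ↭allFin⇒∈ labR
  open LcaDepths L R uL uR allL allR
  open Planarity L R uL uR allL allR
  open BalancedK33 L R uL uR allL allR
  open CaterpillarK33 L R uL uR allL allR

  k33 : Dec NonPlanarQuartet → Σ (K33Subdivision (TV L R) (TAdj L R)) (λ S → branchesInL S ≡ 3)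
  k33 (yes (_ , _ , _ , _ , inj₁ quartet)) = balanced-k33 quartet
  k33 (yes (_ , _ , _ , _ , inj₂ quartet)) = caterpillar-k33 quartet
  k33 (no noQuartet) = ⊥-elim (nonPlanar (planar-if-no-quartet noQuartet))
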